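{- Let $T_1,T_2$ be two brooms on a complete split graph $G$ and define $f:\{0,1\}^{Y}\to\mathbb{N}$ by $$f(x)=\mathrm{inv}(\sigma)+\sum_{u\in Q\setminus Y}|A_u|+\sum_{u\in Y}\bigl(|B_u|+2|C_u|x_u+|D_u|(1-x_u)\bigr)+\frac12\sum_{u\in Y}\sum_{v\in E_u}(1+x_u)(1-x_v)+2\sum_{u\in Y}\sum_{v\in F_u}x_u(1-x_v).$$ Then for every $x\in\{0,1\}^{Y}$ there exists a sequence of exactly $f(x)$ rotations transforming $T_1$ into $T_2$ such that a vertex $u\in Y$ appears as a leaf of some broom along the sequence if and only if $x_u=1$.
   Context: A complete split graph $G$ has vertex set partitioned into $P$ ($|P|=p\ge 1$) inducing a clique and $Q$ ($|Q|=q$) inducing an independent set, with every vertex of $P$ adjacent to every vertex of $Q$. A broom on $G$ consists of a handle, a sequence of vertices listed from top (root) to bottom whose elements are exactly $P\cup S$ for some $S\subseteq Q$, with bottommost element in $P$, together with the set $Q\setminus S$ of leaves attached to the bottommost handle vertex; $u$ is above $v$ if it comes earlier in the handle. A rotation is one of: (1) exchange two consecutive handle vertices $u$ (directly above) and $v$, provided that if $v$ is bottommost then $u\in P$; (2) if the vertex $u$ directly above the bottommost handle vertex is in $Q$, remove $u$ from the handle and make it a leaf; (3) remove a leaf and insert it into the handle directly above the bottommost handle vertex. Notation for the fixed brooms $T_1,T_2$: $Y$ is the set of vertices of $Q$ lying in the handles of both $T_1$ and $T_2$; points of $\{0,1\}^Y$ have coordinates $x_u$, $u\in Y$. $\sigma$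 is the permutation of $\{1,\dots,p\}$ obtained by labeling the vertices of $P$ from $1$ to $p$ in their top-to-bottom order in the handle of $T_1$ and reading these labels top to bottom in the handle of $T_2$; $\mathrm{inv}(\sigma)$ is its number of inversions. For $u\in Q\setminus Y$: if $u$ lies in the handle of one of $T_1,T_2$, $A_u$ is the set of vertices of $P$ below $u$ in that handle; otherwise $A_u=\emptyset$. For $u\in Y$: $B_u$ is the set of vertices of $P$ above $u$ in one of $T_1,T_2$ and below $u$ in the other; $C_u$ is the set of vertices of $P$ below $u$ in both; $D_u$ is the set of vertices of $Q\setminus Y$ above $u$ in the handle of $T_1$ or of $T_2$; $E_u$ is the set of vertices of $Y$ above $u$ in one of $T_1,T_2$ and below $u$ in the other; $F_u$ is the set of vertices of $Y$ below $u$ in both. -}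

module Defs where

open import Data.Nat using (ℕ; zero; suc; _+_; _*_; _∸_; _<ᵇ_; _/_)
open import Data.Bool using (Bool; true; false; if_then_else_; _∧_; _∨_; not; T)
open import Data.Fin using (Fin; zero; suc; fromℕ; inject₁)
import Data.Fin.Properties as FinP
open import Data.Sum using (_⊎_; inj₁; inj₂)
open import Data.Sum.Properties using (≡-dec)
open import Data.List using (List; []; _∷_; _++_; [_]; tabulate; filter; map; length)
open import Data.Nat.ListAction using (sum)
import Data.Bool
import Data.Nat
open import Data.List.Relation.Unary.Unique.Propositional using (Unique)
open import Data.List.Membership.Propositional using (_∈_; _∉_)
open import Data.Product using (Σ; ∃; _×_; _,_)
open import Relation.Binary.PropositionalEquality using (_≡_)
open import Relation.Nullary.Decidable using (⌊_⌋)

module _ (p q : ℕ) where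

  -- Vertices of the complete split graph: inj₁ i ∈ P (clique), inj₂ u ∈ Q (independent set)
  Vertex : Set
  Vertex = Fin p ⊎ Fin q

  _==_ : Vertex → Vertex → Bool
  a == b = ⌊ ≡-dec FinP._≟_ FinP._≟_ a b ⌋

  isP : Vertex → Bool
  isP (inj₁ _) = true
  isP (inj₂ _) = false

  isQ : Vertex → Bool
  isQ v = not (isP v)

  -- A handle, listed from top (root) to bottom.  The leaves are the vertices
  -- of Q not on the handle, attached to the bottommost handle vertex.
  Handle : Set
  Handle = List Vertex

  mem : Vertex → Handle → Bool
  mem a [] = false
  mem a (c ∷ cs) = (c == a) ∨ mem a cs

  above : Handle → Vertex → Vertex → Bool
  above [] a b = false
  above (c ∷ cs) a b = if c == a then mem b cs else above cs a b

  -- a handle is (the handle of) a broom: distinct vertices, exactly P ∪ S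
  -- (S ⊆ Q automatic), every vertex of P present, bottommost vertex in P.
  IsBroom : Handle → Set
  IsBroom h = Unique h × (∀ i → inj₁ i ∈ h) × (∃ λ xs → ∃ λ i → h ≡ xs ++ [ inj₁ i ])

  data Rot : Handle → Handle → Set where
    rot-swap   : ∀ xs u v ys → (ys ≡ [] → T (isP u)) →
                 Rot (xs ++ u ∷ v ∷ ys) (xs ++ v ∷ u ∷ ys)
    rot-toLeaf : ∀ xs u b → T (isQ u) →
                 Rot (xs ++ u ∷ b ∷ []) (xs ++ b ∷ [])
    rot-fromLeaf : ∀ xs w b → T (isQ w) → w ∉ (xs ++ b ∷ []) →
                 Rot (xs ++ b ∷ []) (xs ++ w ∷ b ∷ [])

  record RotSeq (k : ℕ) (h₁ h₂ : Handle) : Set where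
    field
      broom : Fin (suc k) → Handle
      start : broom zero ≡ h₁
      end   : broom (fromℕ k) ≡ h₂
      steps : ∀ (i : Fin k) → Rot (broom (inject₁ i)) (broom (suc i))

  Σ[<_]_ : (n : ℕ) → (Fin n → ℕ) → ℕ
  Σ[< n ] f = sum (tabulate f)

  card : (n : ℕ) → (Fin n → Bool) → ℕ
  card n P = Σ[< n ] (λ i → if P i then 1 else 0)

  b2n : Bool → ℕ
  b2n true = 1
  b2n false = 0

  posOf : Vertex → List Vertex → ℕ
  posOf a [] = 0
  posOf a (c ∷ cs) = if c == a then 0 else suc (posOf a cs)

  invList : List ℕ → ℕ
  invList [] = 0
  invList (a ∷ as) = length (filter (λ b → b Data.Nat.<? a) as) + invList as

  module _ (h₁ h₂ : Handle) where

    Pseq : Handle → List Vertex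
    Pseq h = filter (λ v → Data.Bool.T? (isP v)) h

    -- σ: label P by its order in T₁, read labels in T₂'s order
    σ : List ℕ
    σ = map (λ v → posOf v (Pseq h₁)) (Pseq h₂)

    inY : Fin q → Bool
    inY u = mem (inj₂ u) h₁ ∧ mem (inj₂ u) h₂

    ab₁ ab₂ : Vertex → Vertex → Bool
    ab₁ = above h₁
    ab₂ = above h₂

    cardA : Fin q → ℕ
    cardA u = if mem (inj₂ u) h₁ then card p (λ i → ab₁ (inj₂ u) (inj₁ i))
              else if mem (inj₂ u) h₂ then card p (λ i → ab₂ (inj₂ u) (inj₁ i))
              else 0

    split : Vertex → Vertex → Bool
    split v u = (ab₁ v u ∧ ab₂ u v) ∨ (ab₁ u v ∧ ab₂ v u)

    cardB : Fin q → ℕ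
    cardB u = card p (λ i → split (inj₁ i) (inj₂ u))

    cardC : Fin q → ℕ
    cardC u = card p (λ i → ab₁ (inj₂ u) (inj₁ i) ∧ ab₂ (inj₂ u) (inj₁ i))

    cardD : Fin q → ℕ
    cardD u = card q (λ v → not (inY v) ∧ (ab₁ (inj₂ v) (inj₂ u) ∨ ab₂ (inj₂ v) (inj₂ u)))

    inE : Fin q → Fin q → Bool
    inE u v = inY v ∧ split (inj₂ v) (inj₂ u)

    inF : Fin q → Fin q → Bool
    inF u v = inY v ∧ (ab₁ (inj₂ u) (inj₂ v) ∧ ab₂ (inj₂ u) (inj₂ v))

    -- the function f of Lemma 3.2 (x is only consulted on Y)
    f : (Fin q → Bool) → ℕ
    f x = invList σ
        + Σ[< q ] (λ u → if inY u then 0 else cardA u)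
        + Σ[< q ] (λ u → if inY u
                           then cardB u + 2 * cardC u * b2n (x u) + cardD u * (1 ∸ b2n (x u))
                           else 0)
        + (Σ[< q ] (λ u → if inY u
                           then Σ[< q ] (λ v → if inE u v
                                                  then (1 + b2n (x u)) * (1 ∸ b2n (x v))
                                                  else 0)
                           else 0)) / 2
        + 2 * Σ[< q ] (λ u → if inY u
                           then Σ[< q ] (λ v → if inF u v
                                                  then b2n (x u) * (1 ∸ b2n (x v))
                                                  else 0)
                           else 0)

{-# OPTIONS --safe #-}
-- Regard f as a potential Φ(h, x) of the current handle h, computed relative to the
-- fixed target handle h₂ exactly as f computes it for T₁ (so Φ(h₁, x) = f(x)).  When
-- h = h₂ and x vanishes on its Q-vertices, Φ = 0.  Call a Q-vertex of h removable if it
-- is absent from h₂ or marked by x, and kept otherwise.  A greedy choice of rotation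
-- always lowers Φ by exactly one: lower a removable vertex past the kept vertex below it
-- (or make it a leaf when it sits just above the bottom); once every vertex is kept,
-- swap an adjacent pair ordered differently in h₂ (for two P-vertices this removes one
-- inversion of σ); once the handle is sorted, insert the topmost vertex of h₂ that is
-- missing, unmarking it.  Iterating from h₁ reaches h₂ after exactly f(x) rotations, and
-- a vertex of Y becomes a leaf on the way precisely when it is removable, i.e. x_u = 1.
module Submission where

open import Data.Nat using (ℕ; zero; suc; _+_; _*_; _∸_; _/_; _<ᵇ_; _≡ᵇ_; _<?_; _<_; _≤_; s≤s; z≤n)
open import Data.Nat.Properties using (+-commutativeSemigroup; +-assoc; +-comm; +-suc; +-identityʳ; *-identityʳ; *-zeroʳ; +-cancelʳ-≡; suc-injective; <-trans; n<1+n)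
open import Data.Nat.DivMod using (m/n≡1+[m∸n]/n)
open import Data.Nat.Solver using (module +-*-Solver)
open import Algebra.Properties.CommutativeSemigroup +-commutativeSemigroup using () renaming (interchange to +-interchange)
open import Data.Bool using (Bool; true; false; if_then_else_; _∧_; _∨_; not; T; T?)
open import Data.Bool.Properties using (∨-assoc; ∨-identityʳ; if-eta)
open import Data.Fin using (Fin; zero; suc)
import Data.Fin as F
import Data.Fin.Properties as FinP
open import Data.Sum using (_⊎_; inj₁; inj₂)
open import Data.Sum.Properties using (≡-dec)
open import Data.List using (List; []; _∷_; _++_; [_]; map; filter; length)
open import Data.List.Properties using (++-assoc; filter-++; map-∘; map-cong; tabulate-cong)
open import Data.Nat.ListAction using (sum)
open import Data.List.Membership.Propositional using (_∈_; _∉_)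
open import Data.List.Relation.Unary.Any using (here; there)
open import Data.List.Relation.Unary.All.Properties using (All¬⇒¬Any)
open import Data.List.Relation.Unary.AllPairs using ([]; _∷_)
open import Data.List.Relation.Unary.Unique.Propositional using (Unique)
open import Data.Product using (Σ; ∃; _×_; _,_; proj₁; proj₂)
open import Data.Empty using (⊥; ⊥-elim)
open import Data.Unit using (⊤; tt)
open import Function.Bundles using (_⇔_; mk⇔; Equivalence)
open import Relation.Nullary using (yes; no; Dec)
open import Relation.Nullary.Decidable using (⌊_⌋)
open import Relation.Binary.PropositionalEquality using (_≡_; _≢_; refl; sym; trans; cong; cong₂; subst)
open +-*-Solver

import Defs as D

module Rotations (p q : ℕ) where

  Vertex : Set
  Vertex = D.Vertex p q

  Handle : Set
  Handle = D.Handle p q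

  infix 4 _==_ _≟_

  _==_ : Vertex → Vertex → Bool
  _==_ = D._==_ p q

  _≟_ : (a b : Vertex) → Dec (a ≡ b)
  _≟_ = ≡-dec FinP._≟_ FinP._≟_

  mem : Vertex → Handle → Bool
  mem = D.mem p q

  above : Handle → Vertex → Vertex → Bool
  above = D.above p q

  isP isQ : Vertex → Bool
  isP = D.isP p q
  isQ = D.isQ p q

  b2n : Bool → ℕ
  b2n = D.b2n p q

  Σ[<_]_ : (n : ℕ) → (Fin n → ℕ) → ℕ
  Σ[<_]_ = D.Σ[<_]_ p q

  card : (n : ℕ) → (Fin n → Bool) → ℕ
  card = D.card p q

  invList : List ℕ → ℕ
  invList = D.invList p q

  posOf : Vertex → Handle → ℕ
  posOf = D.posOf p q

  Pseq : Handle → Handle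
  Pseq = D.Pseq p q [] []

  σ : Handle → Handle → List ℕ
  σ = D.σ p q

  f : Handle → Handle → (Fin q → Bool) → ℕ
  f = D.f p q

  IsBroom : Handle → Set
  IsBroom = D.IsBroom p q

  Rot : Handle → Handle → Set
  Rot = D.Rot p q

  RotSeq : ℕ → Handle → Handle → Set
  RotSeq = D.RotSeq p q

  ==-refl : ∀ a → (a == a) ≡ true
  ==-refl a with a ≟ a
  ... | yes _ = refl
  ... | no n = ⊥-elim (n refl)

  ≢⇒==-false : ∀ {a b} → a ≢ b → (a == b) ≡ false
  ≢⇒==-false {a} {b} n with a ≟ b
  ... | yes r = ⊥-elim (n r)
  ... | no _ = refl

  ==-sym : ∀ a b → (a == b) ≡ (b == a)
  ==-sym a b with a ≟ b | b ≟ a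
  ... | yes _ | yes _ = refl
  ... | no _ | no _ = refl
  ... | yes r | no n = ⊥-elim (n (sym r))
  ... | no n | yes r = ⊥-elim (n (sym r))

  ∨-true-l : ∀ {a} b → a ≡ true → (a ∨ b) ≡ true
  ∨-true-l b refl = refl

  ∨-true-r : ∀ a {b} → b ≡ true → (a ∨ b) ≡ true
  ∨-true-r false refl = refl
  ∨-true-r true refl = refl

  ∨-false : ∀ {a b} → (a ∨ b) ≡ false → (a ≡ false) × (b ≡ false)
  ∨-false {false} {false} e = refl , refl
  ∨-false {true} ()
  ∨-false {false} {true} ()

  true≢false : true ≡ false → ⊥
  true≢false ()

  if-true : ∀ {A : Set} {b} {m n : A} → b ≡ true → (if b then m else n) ≡ m
  if-true refl = refl

  if-false : ∀ {A : Set} {b} {m n : A} → b ≡ false → (if b then m else n) ≡ n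
  if-false refl = refl

  ∧-true : ∀ {a b} → a ≡ true → b ≡ true → (a ∧ b) ≡ true
  ∧-true refl refl = refl

  ∧-falseˡ : ∀ {a} b → a ≡ false → (a ∧ b) ≡ false
  ∧-falseˡ b refl = refl

  ∧-falseʳ : ∀ a {b} → b ≡ false → (a ∧ b) ≡ false
  ∧-falseʳ false refl = refl
  ∧-falseʳ true refl = refl

  ∨-swap : ∀ a b c → (a ∨ (b ∨ c)) ≡ (b ∨ (a ∨ c))
  ∨-swap false b c = refl
  ∨-swap true false c = refl
  ∨-swap true true c = refl

  ∧-trueˡ : ∀ a {b} → (a ∧ b) ≡ true → a ≡ true
  ∧-trueˡ true _ = refl
  ∧-trueˡ false ()

  ∧-trueʳ : ∀ a {b} → (a ∧ b) ≡ true → b ≡ true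
  ∧-trueʳ true e = e
  ∧-trueʳ false ()

  not-true : ∀ {b} → not b ≡ true → b ≡ false
  not-true {false} _ = refl
  not-true {true} ()

  T⇒≡true : ∀ {b} → T b → b ≡ true
  T⇒≡true {true} _ = refl
  T⇒≡true {false} ()

  ≡true⇒T : ∀ {b} → b ≡ true → T b
  ≡true⇒T refl = tt

  mem⇒∈ : ∀ {a} h → mem a h ≡ true → a ∈ h
  mem⇒∈ [] ()
  mem⇒∈ {a} (c ∷ h) e with c ≟ a
  ... | yes refl = here refl
  ... | no n = there (mem⇒∈ h e)

  ∈⇒mem : ∀ {a} h → a ∈ h → mem a h ≡ true
  ∈⇒mem (c ∷ h) (here refl) rewrite ==-refl c = refl
  ∈⇒mem (c ∷ h) (there i) = ∨-true-r (c == _) (∈⇒mem h i)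

  mem-false⇒∉ : ∀ {a} h → mem a h ≡ false → a ∉ h
  mem-false⇒∉ h e i rewrite ∈⇒mem h i = true≢false e

  ∉⇒mem-false : ∀ {a} h → a ∉ h → mem a h ≡ false
  ∉⇒mem-false {a} h n with mem a h in eq
  ... | false = refl
  ... | true = ⊥-elim (n (mem⇒∈ h eq))

  mem-++ : ∀ a xs ys → mem a (xs ++ ys) ≡ (mem a xs ∨ mem a ys)
  mem-++ a [] ys = refl
  mem-++ a (c ∷ xs) ys rewrite mem-++ a xs ys = sym (∨-assoc (c == a) (mem a xs) (mem a ys))

  Distinct : Handle → Set
  Distinct [] = ⊤
  Distinct (c ∷ cs) = (mem c cs ≡ false) × Distinct cs

  Unique⇒Distinct : ∀ h → Unique h → Distinct h
  Unique⇒Distinct [] _ = tt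
  Unique⇒Distinct (c ∷ h) (c∉h ∷ u) = ∉⇒mem-false h (All¬⇒¬Any c∉h) , Unique⇒Distinct h u

  above-++ : ∀ xs ys c d → above (xs ++ ys) c d ≡ (if mem c xs then (above xs c d ∨ mem d ys) else above ys c d)
  above-++ [] ys c d = refl
  above-++ (x ∷ xs) ys c d with x == c
  ... | true = mem-++ d xs ys
  ... | false = above-++ xs ys c d

  above⇒mem₁ : ∀ h c d → above h c d ≡ true → mem c h ≡ true
  above⇒mem₁ [] c d ()
  above⇒mem₁ (x ∷ h) c d e with x == c
  ... | true = refl
  ... | false = above⇒mem₁ h c d e

  above⇒mem₂ : ∀ h c d → above h c d ≡ true → mem d h ≡ true
  above⇒mem₂ [] c d ()
  above⇒mem₂ (x ∷ h) c d e with x == c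
  ... | true = ∨-true-r (x == d) e
  ... | false = ∨-true-r (x == d) (above⇒mem₂ h c d e)

  above-absent₁ : ∀ h c d → mem c h ≡ false → above h c d ≡ false
  above-absent₁ h c d e with above h c d in eq
  ... | false = refl
  ... | true = ⊥-elim (true≢false (trans (sym (above⇒mem₁ h c d eq)) e))

  above-absent₂ : ∀ h c d → mem d h ≡ false → above h c d ≡ false
  above-absent₂ h c d e with above h c d in eq
  ... | false = refl
  ... | true = ⊥-elim (true≢false (trans (sym (above⇒mem₂ h c d eq)) e))

  above-asym : ∀ h → Distinct h → ∀ c d → above h c d ≡ true → above h d c ≡ false
  above-asym [] _ c d ()
  above-asym (x ∷ h) (nx , u) c d e with x ≟ c | x ≟ d
  ... | yes refl | yes refl = ⊥-elim (true≢false (trans (sym e) nx))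
  ... | yes refl | no n = above-absent₂ h d x nx
  ... | no n | yes refl = ⊥-elim (true≢false (trans (sym (above⇒mem₂ h c x e)) nx))
  ... | no n | no m = above-asym h u c d e

  above-total : ∀ h → Distinct h → ∀ c d → c ≢ d → mem c h ≡ true → mem d h ≡ true →
                (above h c d ≡ true) ⊎ (above h d c ≡ true)
  above-total [] _ c d _ ()
  above-total (x ∷ h) (nx , u) c d cd mc md with x ≟ c | x ≟ d
  ... | yes refl | yes refl = ⊥-elim (cd refl)
  ... | yes refl | no n = inj₁ md
  ... | no n | yes refl = inj₂ mc
  ... | no n | no m = above-total h u c d cd mc md

  above-trans : ∀ h → Distinct h → ∀ c d e → above h c d ≡ true → above h d e ≡ true → above h c e ≡ true
  above-trans [] _ c d e ()
  above-trans (x ∷ h) (nx , u) c d e cd de with x ≟ c | x ≟ d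
  ... | yes refl | yes refl = ⊥-elim (true≢false (trans (sym cd) nx))
  ... | yes refl | no n = above⇒mem₂ h d e de
  ... | no n | yes refl = ⊥-elim (true≢false (trans (sym (above⇒mem₂ h c x cd)) nx))
  ... | no n | no m = above-trans h u c d e cd de

  ExactlyOneAbove : Handle → Vertex → Vertex → Set
  ExactlyOneAbove h2 c d = ((above h2 c d ≡ true) × (above h2 d c ≡ false)) ⊎ ((above h2 c d ≡ false) × (above h2 d c ≡ true))

  exactlyOneAbove : ∀ h2 → Distinct h2 → ∀ c d → c ≢ d → mem c h2 ≡ true → mem d h2 ≡ true → ExactlyOneAbove h2 c d
  exactlyOneAbove h2 U2 c d n mc md with above-total h2 U2 c d n mc md
  ... | inj₁ r = inj₁ (r , above-asym h2 U2 c d r)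
  ... | inj₂ r = inj₂ (above-asym h2 U2 d c r , r)

  distinct-suffix : ∀ xs ys → Distinct (xs ++ ys) → Distinct ys
  distinct-suffix [] ys u = u
  distinct-suffix (x ∷ xs) ys (_ , u) = distinct-suffix xs ys u

  distinct-disjoint : ∀ xs ys c → Distinct (xs ++ ys) → mem c ys ≡ true → mem c xs ≡ false
  distinct-disjoint [] ys c u m = refl
  distinct-disjoint (x ∷ xs) ys c (nx , u) m with x ≟ c
  ... | yes refl rewrite mem-++ x xs ys | m = ⊥-elim (true≢false (trans (sym (∨-true-r (mem x xs) refl)) nx))
  ... | no n = distinct-disjoint xs ys c u m

  distinct-middle : ∀ xs c ys → Distinct (xs ++ c ∷ ys) → (mem c xs ≡ false) × (mem c ys ≡ false)
  distinct-middle xs c ys u = distinct-disjoint xs (c ∷ ys) c u (∨-true-l (mem c ys) (==-refl c)) , proj₁ (distinct-suffix xs (c ∷ ys) u)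

  mem-swap : ∀ xs u v ys c → mem c (xs ++ u ∷ v ∷ ys) ≡ mem c (xs ++ v ∷ u ∷ ys)
  mem-swap xs u v ys c rewrite mem-++ c xs (u ∷ v ∷ ys) | mem-++ c xs (v ∷ u ∷ ys) | ∨-swap (u == c) (v == c) (mem c ys) = refl

  module SwapAt (xs : Handle) (u v : Vertex) (ys : Handle) where
    hs ht : Handle
    hs = xs ++ u ∷ v ∷ ys
    ht = xs ++ v ∷ u ∷ ys

    mem-swapped : ∀ c → mem c hs ≡ mem c ht
    mem-swapped = mem-swap xs u v ys

    above-swap-∷ : u ≢ v → ∀ c d → (c ≡ u → d ≢ v) → (c ≡ v → d ≢ u) → above (u ∷ v ∷ ys) c d ≡ above (v ∷ u ∷ ys) c d
    above-swap-∷ uv c d h1 h2 with c ≟ u | c ≟ v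
    ... | yes refl | yes refl = ⊥-elim (uv refl)
    ... | yes refl | no _ rewrite ==-refl c | ≢⇒==-false (λ e → uv (sym e)) | ≢⇒==-false (λ e → h1 refl (sym e)) = refl
    ... | no _ | yes refl rewrite ==-refl c | ≢⇒==-false uv | ≢⇒==-false (λ e → h2 refl (sym e)) = refl
    ... | no n | no m rewrite ≢⇒==-false (λ e → n (sym e)) | ≢⇒==-false (λ e → m (sym e)) = refl

    above-swapped : u ≢ v → ∀ c d → (c ≡ u → d ≢ v) → (c ≡ v → d ≢ u) → above hs c d ≡ above ht c d
    above-swapped uv c d h1 h2 rewrite above-++ xs (u ∷ v ∷ ys) c d | above-++ xs (v ∷ u ∷ ys) c d
      | above-swap-∷ uv c d h1 h2 | ∨-swap (u == d) (v == d) (mem d ys) = refl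

    distinct-swap : Distinct hs → Distinct ht
    distinct-swap = go xs
      where
      go : ∀ zs → Distinct (zs ++ u ∷ v ∷ ys) → Distinct (zs ++ v ∷ u ∷ ys)
      go [] (mu , mv , uy) with u ≟ v
      ... | yes refl = ⊥-elim (true≢false (trans (sym (∨-true-l (mem u ys) (==-refl u))) mu))
      ... | no n = mv , proj₂ (∨-false mu) , uy
      go (z ∷ zs) (nz , r) = trans (sym (mem-swap zs u v ys z)) nz , go zs r

    module _ (U : Distinct hs) where
      private
        um = distinct-middle xs u (v ∷ ys) U
        vm = distinct-middle (xs ++ [ u ]) v ys (subst Distinct (sym (++-assoc xs [ u ] (v ∷ ys))) U)
      u∉xs : mem u xs ≡ false
      u∉xs = proj₁ um
      v∉xs : mem v xs ≡ false
      v∉xs = proj₁ (∨-false (trans (sym (mem-++ v xs [ u ])) (proj₁ vm)))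
      u≢v : u ≢ v
      u≢v e = true≢false (trans (sym (∨-true-l (mem u ys) (subst (λ z → (z == u) ≡ true) e (==-refl u)))) (proj₂ um))
      u∉ys : mem u ys ≡ false
      u∉ys = proj₂ (∨-false (proj₂ um))
      v∉ys : mem v ys ≡ false
      v∉ys = proj₂ vm

      above-uv : above hs u v ≡ true
      above-uv rewrite above-++ xs (u ∷ v ∷ ys) u v | u∉xs | ==-refl u | ==-refl v = refl
      above-vu : above hs v u ≡ false
      above-vu rewrite above-++ xs (u ∷ v ∷ ys) v u | v∉xs | ≢⇒==-false u≢v | ==-refl v = u∉ys
      above-uv′ : above ht u v ≡ false
      above-uv′ rewrite above-++ xs (v ∷ u ∷ ys) u v | u∉xs | ≢⇒==-false (λ e → u≢v (sym e)) | ==-refl u = v∉ys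
      above-vu′ : above ht v u ≡ true
      above-vu′ rewrite above-++ xs (v ∷ u ∷ ys) v u | v∉xs | ==-refl v | ==-refl u = refl

  module RemoveAt (xs : Handle) (u b : Vertex) where
    hs ht : Handle
    hs = xs ++ u ∷ b ∷ []
    ht = xs ++ b ∷ []

    mem-removed : ∀ c → c ≢ u → mem c hs ≡ mem c ht
    mem-removed c n rewrite mem-++ c xs (u ∷ b ∷ []) | mem-++ c xs (b ∷ []) | ≢⇒==-false (λ e → n (sym e)) = refl

    mem-removed⇒mem : ∀ c → mem c ht ≡ true → mem c hs ≡ true
    mem-removed⇒mem c m with c ≟ u
    ... | yes refl rewrite mem-++ c xs (c ∷ b ∷ []) | ==-refl c = ∨-true-r (mem c xs) refl
    ... | no n = trans (mem-removed c n) m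

    above-removed : ∀ c d → c ≢ u → d ≢ u → above hs c d ≡ above ht c d
    above-removed c d cu du rewrite above-++ xs (u ∷ b ∷ []) c d | above-++ xs (b ∷ []) c d
      | ≢⇒==-false (λ e → cu (sym e)) | ≢⇒==-false (λ e → du (sym e)) = refl

    distinct-remove : Distinct hs → Distinct ht
    distinct-remove = go xs
      where
      go : ∀ zs → Distinct (zs ++ u ∷ b ∷ []) → Distinct (zs ++ b ∷ [])
      go [] (_ , r) = r
      go (z ∷ zs) (nz , r) = nz′ , go zs r
        where
        nz′ : mem z (zs ++ b ∷ []) ≡ false
        nz′ with ∨-false {mem z zs} {mem z (u ∷ b ∷ [])} (trans (sym (mem-++ z zs (u ∷ b ∷ []))) nz)
        ... | e1 , e2 = trans (mem-++ z zs (b ∷ [])) (cong₂ _∨_ e1 (proj₂ (∨-false {u == z} e2)))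

    module _ (U : Distinct hs) where
      private
        um = distinct-middle xs u (b ∷ []) U
      u∉xs : mem u xs ≡ false
      u∉xs = proj₁ um
      u≢b : u ≢ b
      u≢b e = true≢false (trans (sym (∨-true-l false (subst (λ z → (z == u) ≡ true) e (==-refl u)))) (proj₂ um))

      u∉ht : mem u ht ≡ false
      u∉ht rewrite mem-++ u xs (b ∷ []) | u∉xs | ≢⇒==-false (λ e → u≢b (sym e)) = refl

      above-removed₁ : ∀ d → above ht u d ≡ false
      above-removed₁ d = above-absent₁ ht u d u∉ht
      above-removed₂ : ∀ c → above ht c u ≡ false
      above-removed₂ c = above-absent₂ ht c u u∉ht

      above-u : ∀ d → above hs u d ≡ (b == d)
      above-u d rewrite above-++ xs (u ∷ b ∷ []) u d | u∉xs | ==-refl u = ∨-identityʳ (b == d)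

      mem-xs : ∀ c → mem c hs ≡ true → c ≢ u → c ≢ b → mem c xs ≡ true
      mem-xs c m cu cb rewrite mem-++ c xs (u ∷ b ∷ []) | ≢⇒==-false (λ e → cu (sym e)) | ≢⇒==-false (λ e → cb (sym e)) | ∨-identityʳ (mem c xs) = m

      above-to-u : ∀ c → mem c hs ≡ true → c ≢ u → c ≢ b → above hs c u ≡ true
      above-to-u c m cu cb rewrite above-++ xs (u ∷ b ∷ []) c u | mem-xs c m cu cb | ==-refl u = ∨-true-r (above xs c u) refl

      above-b-u : above hs b u ≡ false
      above-b-u = above-asym hs U u b (trans (above-u b) (==-refl b))

  distinct-insert : ∀ xs w b → Distinct (xs ++ b ∷ []) → mem w (xs ++ b ∷ []) ≡ false → Distinct (xs ++ w ∷ b ∷ [])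
  distinct-insert [] w b (nb , u) mw = mw , nb , u
  distinct-insert (x ∷ xs) w b (nx , u) mw = nx′ , distinct-insert xs w b u (proj₂ (∨-false {x == w} mw))
    where
    nx′ : mem x (xs ++ w ∷ b ∷ []) ≡ false
    nx′ with ∨-false {mem x xs} {mem x (b ∷ [])} (trans (sym (mem-++ x xs (b ∷ []))) nx)
    ... | e1 , e2 = trans (mem-++ x xs (w ∷ b ∷ [])) (cong₂ _∨_ e1 (cong₂ _∨_ (trans (==-sym w x) (proj₁ (∨-false {x == w} mw))) e2))

  distinct-prefix : ∀ xs ys → Distinct (xs ++ ys) → Distinct xs
  distinct-prefix [] ys _ = tt
  distinct-prefix (x ∷ xs) ys (nx , u) = proj₁ (∨-false {mem x xs} (trans (sym (mem-++ x xs ys)) nx)) , distinct-prefix xs ys u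

  mem-++ˡ : ∀ c xs ys → mem c xs ≡ true → mem c (xs ++ ys) ≡ true
  mem-++ˡ c xs ys m = trans (mem-++ c xs ys) (∨-true-l (mem c ys) m)

  Σ-cong : ∀ n {f g : Fin n → ℕ} → (∀ i → f i ≡ g i) → Σ[< n ] f ≡ Σ[< n ] g
  Σ-cong n e = cong sum (tabulate-cong e)

  Σ-+ : ∀ n (f g : Fin n → ℕ) → Σ[< n ] (λ i → f i + g i) ≡ Σ[< n ] f + Σ[< n ] g
  Σ-+ zero f g = refl
  Σ-+ (suc n) f g rewrite Σ-+ n (λ i → f (suc i)) (λ i → g (suc i)) = +-interchange (f zero) (g zero) (Σ[< n ] (λ i → f (suc i))) (Σ[< n ] (λ i → g (suc i)))

  Σ-balance : ∀ n (f d g e : Fin n → ℕ) → (∀ i → f i + d i ≡ g i + e i) → Σ[< n ] f + Σ[< n ] d ≡ Σ[< n ] g + Σ[< n ] e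
  Σ-balance n f d g e h = trans (sym (Σ-+ n f d)) (trans (Σ-cong n h) (Σ-+ n g e))

  Σ-zero : ∀ n (f : Fin n → ℕ) → (∀ i → f i ≡ 0) → Σ[< n ] f ≡ 0
  Σ-zero zero f h = refl
  Σ-zero (suc n) f h rewrite h zero = Σ-zero n (λ i → f (suc i)) (λ i → h (suc i))

  single : ∀ {n} → Fin n → ℕ → Fin n → ℕ
  single j c i = if ⌊ i F.≟ j ⌋ then c else 0

  Σ-single : ∀ n (j : Fin n) c → Σ[< n ] (single j c) ≡ c
  Σ-single (suc n) zero c = trans (cong (c +_) (Σ-zero n _ (λ i → refl))) (+-identityʳ c)
  Σ-single (suc n) (suc j) c = trans (Σ-cong n {g = single j c} (λ i → lem i)) (Σ-single n j c)
    where
    lem : ∀ i → single (suc j) c (suc i) ≡ single j c i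
    lem i with i F.≟ j
    ... | yes refl = refl
    ... | no ne = refl

  Σ-update : ∀ n (j : Fin n) (f g : Fin n → ℕ) → (∀ i → i ≢ j → f i ≡ g i) → Σ[< n ] f + g j ≡ Σ[< n ] g + f j
  Σ-update n j f g h = trans (cong (Σ[< n ] f +_) (sym (Σ-single n j (g j))))
                     (trans (Σ-balance n f (single j (g j)) g (single j (f j)) pt) (cong (Σ[< n ] g +_) (Σ-single n j (f j))))
    where
    pt : ∀ i → f i + single j (g j) i ≡ g i + single j (f j) i
    pt i with i F.≟ j
    ... | yes refl = +-comm (f i) (g i)
    ... | no n = trans (+-identityʳ (f i)) (trans (h i n) (sym (+-identityʳ (g i))))

  if-1-0 : ∀ b → (if b then 1 else 0) ≡ b2n b
  if-1-0 true = refl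
  if-1-0 false = refl

  card-Σ : ∀ n (P : Fin n → Bool) → card n P ≡ Σ[< n ] (λ i → b2n (P i))
  card-Σ n P = Σ-cong n (λ i → if-1-0 (P i))

  card-cong : ∀ n {P R : Fin n → Bool} → (∀ i → P i ≡ R i) → card n P ≡ card n R
  card-cong n e = Σ-cong n (λ i → cong (λ b → if b then 1 else 0) (e i))

  card-zero : ∀ n (P : Fin n → Bool) → (∀ i → P i ≡ false) → card n P ≡ 0
  card-zero n P h = Σ-zero n _ (λ i → cong (λ b → if b then 1 else 0) (h i))

  card-update : ∀ n (j : Fin n) (P R : Fin n → Bool) → (∀ i → i ≢ j → P i ≡ R i) → card n P + b2n (R j) ≡ card n R + b2n (P j)
  card-update n j P R h = trans (cong (_+ b2n (R j)) (card-Σ n P)) (trans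
     (Σ-update n j (λ i → b2n (P i)) (λ i → b2n (R i)) (λ i ne → cong b2n (h i ne)))
     (cong (_+ b2n (P j)) (sym (card-Σ n R))))

  inj₁-inj : ∀ {a b : Fin p} → _≡_ {A = Vertex} (inj₁ a) (inj₁ b) → a ≡ b
  inj₁-inj refl = refl

  inj₂-inj : ∀ {a b : Fin q} → _≡_ {A = Vertex} (inj₂ a) (inj₂ b) → a ≡ b
  inj₂-inj refl = refl

  card-singleton : (j : Fin p) → card p (λ i → inj₁ j == inj₁ i) ≡ 1
  card-singleton j = trans (Σ-cong p pt) (Σ-single p j 1)
    where
    pt : ∀ i → (if inj₁ j == inj₁ i then 1 else 0) ≡ single j 1 i
    pt i with i F.≟ j
    ... | yes refl rewrite ==-refl (inj₁ i) = refl
    ... | no n rewrite ≢⇒==-false {inj₁ j} {inj₁ i} (λ e → n (sym (inj₁-inj e))) = refl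

  Σ-update₂ : ∀ n (j k : Fin n) → j ≢ k → (f g : Fin n → ℕ) → (∀ i → i ≢ j → i ≢ k → f i ≡ g i) →
           Σ[< n ] f + (g j + g k) ≡ Σ[< n ] g + (f j + f k)
  Σ-update₂ n j k jk f g h =
    trans (cong (Σ[< n ] f +_) (sym (trans (Σ-+ n (single j (g j)) (single k (g k))) (cong₂ _+_ (Σ-single n j (g j)) (Σ-single n k (g k))))))
    (trans (Σ-balance n f (λ i → single j (g j) i + single k (g k) i) g (λ i → single j (f j) i + single k (f k) i) pt)
           (cong (Σ[< n ] g +_) (trans (Σ-+ n (single j (f j)) (single k (f k))) (cong₂ _+_ (Σ-single n j (f j)) (Σ-single n k (f k))))))
    where
    pt : ∀ i → f i + (single j (g j) i + single k (g k) i) ≡ g i + (single j (f j) i + single k (f k) i)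
    pt i with i F.≟ j | i F.≟ k
    ... | yes refl | yes refl = ⊥-elim (jk refl)
    ... | yes refl | no _ rewrite +-identityʳ (g i) | +-identityʳ (f i) = +-comm (f i) (g i)
    ... | no _ | yes refl = +-comm (f i) (g i)
    ... | no a | no b = cong (_+ 0) (h i a b)

  Σ-cong-at : ∀ n (j : Fin n) (f g : Fin n → ℕ) → (∀ i → i ≢ j → f i ≡ g i) → f j ≡ g j → Σ[< n ] f ≡ Σ[< n ] g
  Σ-cong-at n j f g h e = Σ-cong n pt
    where
    pt : ∀ i → f i ≡ g i
    pt i with i F.≟ j
    ... | yes refl = e
    ... | no m = h i m

  -- The potential

  -- f with the membership and the order of the first handle abstracted to M and A.
  module Potential (h2 : Handle) where
    mem₂ : Vertex → Bool
    mem₂ c = mem c h2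
    above₂ : Vertex → Vertex → Bool
    above₂ = above h2

    module _ (M : Vertex → Bool) (A : Vertex → Vertex → Bool) where
      inY : Fin q → Bool
      inY u = M (inj₂ u) ∧ mem₂ (inj₂ u)
      cardA : Fin q → ℕ
      cardA u = if M (inj₂ u) then card p (λ i → A (inj₂ u) (inj₁ i))
             else if mem₂ (inj₂ u) then card p (λ i → above₂ (inj₂ u) (inj₁ i))
             else 0
      split : Vertex → Vertex → Bool
      split v u = (A v u ∧ above₂ u v) ∨ (A u v ∧ above₂ v u)
      cardB : Fin q → ℕ
      cardB u = card p (λ i → split (inj₁ i) (inj₂ u))
      cardC : Fin q → ℕ
      cardC u = card p (λ i → A (inj₂ u) (inj₁ i) ∧ above₂ (inj₂ u) (inj₁ i))
      inD : Fin q → Fin q → Bool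
      inD u v = not (inY v) ∧ (A (inj₂ v) (inj₂ u) ∨ above₂ (inj₂ v) (inj₂ u))
      cardD : Fin q → ℕ
      cardD u = card q (inD u)
      inE : Fin q → Fin q → Bool
      inE u v = inY v ∧ split (inj₂ v) (inj₂ u)
      inF : Fin q → Fin q → Bool
      inF u v = inY v ∧ (A (inj₂ u) (inj₂ v) ∧ above₂ (inj₂ u) (inj₂ v))

      termA : Fin q → ℕ
      termA u = if inY u then 0 else cardA u
      sumA : ℕ
      sumA = Σ[< q ] termA

      module _ (x : Fin q → Bool) where
        termBCD : Fin q → ℕ
        termBCD u = if inY u then cardB u + 2 * cardC u * b2n (x u) + cardD u * (1 ∸ b2n (x u)) else 0
        termE : Fin q → Fin q → ℕ
        termE u v = if inE u v then (1 + b2n (x u)) * (1 ∸ b2n (x v)) else 0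
        rowE : Fin q → ℕ
        rowE u = if inY u then Σ[< q ] (termE u) else 0
        termF : Fin q → Fin q → ℕ
        termF u v = if inF u v then b2n (x u) * (1 ∸ b2n (x v)) else 0
        rowF : Fin q → ℕ
        rowF u = if inY u then Σ[< q ] (termF u) else 0
        sumBCD sumE sumF : ℕ
        sumBCD = Σ[< q ] termBCD
        sumE = Σ[< q ] rowE
        sumF = Σ[< q ] rowF
        potential : ℕ → ℕ
        potential i = i + sumA + sumBCD + sumE / 2 + 2 * sumF

    membership : Handle → Vertex → Bool
    membership h c = mem c h

    f≡potential : ∀ h1 x → f h1 h2 x ≡ potential (membership h1) (above h1) x (invList (σ h1 h2))
    f≡potential h1 x = refl

  module PotentialCong (h2 : Handle) (M M′ : Vertex → Bool) (A A′ : Vertex → Vertex → Bool) where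
    open Potential h2

    inY-cong : ∀ w → M (inj₂ w) ≡ M′ (inj₂ w) → inY M A w ≡ inY M′ A′ w
    inY-cong w e = cong (λ b → b ∧ mem₂ (inj₂ w)) e

    termA-cong : ∀ w → M (inj₂ w) ≡ M′ (inj₂ w) → (∀ i → A (inj₂ w) (inj₁ i) ≡ A′ (inj₂ w) (inj₁ i)) → termA M A w ≡ termA M′ A′ w
    termA-cong w e h rewrite e | card-cong p {λ i → A (inj₂ w) (inj₁ i)} {λ i → A′ (inj₂ w) (inj₁ i)} h = refl

    split-cong : ∀ c d → A c d ≡ A′ c d → A d c ≡ A′ d c → split M A c d ≡ split M′ A′ c d
    split-cong c d e1 e2 rewrite e1 | e2 = refl

    cardB-cong : ∀ w → (∀ i → A (inj₁ i) (inj₂ w) ≡ A′ (inj₁ i) (inj₂ w)) → (∀ i → A (inj₂ w) (inj₁ i) ≡ A′ (inj₂ w) (inj₁ i)) → cardB M A w ≡ cardB M′ A′ w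
    cardB-cong w h1 h2′ = card-cong p (λ i → split-cong (inj₁ i) (inj₂ w) (h1 i) (h2′ i))

    cardC-cong : ∀ w → (∀ i → A (inj₂ w) (inj₁ i) ≡ A′ (inj₂ w) (inj₁ i)) → cardC M A w ≡ cardC M′ A′ w
    cardC-cong w h = card-cong p (λ i → cong (λ b → b ∧ above₂ (inj₂ w) (inj₁ i)) (h i))

    inD-cong : ∀ w v → M (inj₂ v) ≡ M′ (inj₂ v) → A (inj₂ v) (inj₂ w) ≡ A′ (inj₂ v) (inj₂ w) → inD M A w v ≡ inD M′ A′ w v
    inD-cong w v e1 e2 rewrite e1 | e2 = refl

    cardD-cong : ∀ w → (∀ v → inD M A w v ≡ inD M′ A′ w v) → cardD M A w ≡ cardD M′ A′ w
    cardD-cong w h = card-cong q h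

    termBCD-cong : ∀ {x x′ : Fin q → Bool} w → M (inj₂ w) ≡ M′ (inj₂ w) → cardB M A w ≡ cardB M′ A′ w → cardC M A w ≡ cardC M′ A′ w →
           cardD M A w ≡ cardD M′ A′ w → x w ≡ x′ w → termBCD M A x w ≡ termBCD M′ A′ x′ w
    termBCD-cong w e1 e2 e3 e4 e5 rewrite e1 | e2 | e3 | e4 | e5 = refl

    inE-cong : ∀ u v → M (inj₂ v) ≡ M′ (inj₂ v) → A (inj₂ v) (inj₂ u) ≡ A′ (inj₂ v) (inj₂ u) → A (inj₂ u) (inj₂ v) ≡ A′ (inj₂ u) (inj₂ v) →
           inE M A u v ≡ inE M′ A′ u v
    inE-cong u v e1 e2 e3 rewrite e1 | e2 | e3 = refl

    termE-cong : ∀ {x x′ : Fin q → Bool} u v → inE M A u v ≡ inE M′ A′ u v → x u ≡ x′ u → x v ≡ x′ v → termE M A x u v ≡ termE M′ A′ x′ u v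
    termE-cong u v e1 e2 e3 rewrite e1 | e2 | e3 = refl

    rowE-cong : ∀ {x x′ : Fin q → Bool} u → M (inj₂ u) ≡ M′ (inj₂ u) → (∀ v → termE M A x u v ≡ termE M′ A′ x′ u v) → rowE M A x u ≡ rowE M′ A′ x′ u
    rowE-cong {x} {x′} u e h rewrite e | Σ-cong q {termE M A x u} {termE M′ A′ x′ u} h = refl

    inF-cong : ∀ u v → M (inj₂ v) ≡ M′ (inj₂ v) → A (inj₂ u) (inj₂ v) ≡ A′ (inj₂ u) (inj₂ v) → inF M A u v ≡ inF M′ A′ u v
    inF-cong u v e1 e2 rewrite e1 | e2 = refl

    termF-cong : ∀ {x x′ : Fin q → Bool} u v → inF M A u v ≡ inF M′ A′ u v → x u ≡ x′ u → x v ≡ x′ v → termF M A x u v ≡ termF M′ A′ x′ u v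
    termF-cong u v e1 e2 e3 rewrite e1 | e2 | e3 = refl

    rowF-cong : ∀ {x x′ : Fin q → Bool} u → M (inj₂ u) ≡ M′ (inj₂ u) → (∀ v → termF M A x u v ≡ termF M′ A′ x′ u v) → rowF M A x u ≡ rowF M′ A′ x′ u
    rowF-cong {x} {x′} u e h rewrite e | Σ-cong q {termF M A x u} {termF M′ A′ x′ u} h = refl

    potential-cong : ∀ {x x′ : Fin q → Bool} i → (∀ c → M c ≡ M′ c) → (∀ c d → A c d ≡ A′ c d) → (∀ u → x u ≡ x′ u) →
          potential M A x i ≡ potential M′ A′ x′ i
    potential-cong {x} {x′} i hM hA hx
      rewrite Σ-cong q {termA M A} {termA M′ A′} (λ w → termA-cong w (hM _) (λ i → hA _ _))
            | Σ-cong q {termBCD M A x} {termBCD M′ A′ x′} (λ w → termBCD-cong {x} {x′} w (hM _) (cardB-cong w (λ i → hA _ _) (λ i → hA _ _)) (cardC-cong w (λ i → hA _ _))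
                                                   (cardD-cong w (λ v → inD-cong w v (hM _) (hA _ _))) (hx w))
            | Σ-cong q {rowE M A x} {rowE M′ A′ x′} (λ u → rowE-cong {x} {x′} u (hM _) (λ v → termE-cong {x} {x′} u v (inE-cong u v (hM _) (hA _ _) (hA _ _)) (hx u) (hx v)))
            | Σ-cong q {rowF M A x} {rowF M′ A′ x′} (λ u → rowF-cong {x} {x′} u (hM _) (λ v → termF-cong {x} {x′} u v (inF-cong u v (hM _) (hA _ _)) (hx u) (hx v)))
      = refl

  -- Change of the potential under a rotation

  module SwapPotential (h2 : Handle) (M : Vertex → Bool) (x : Fin q → Bool) (A A′ : Vertex → Vertex → Bool) where
    open Potential h2
    open PotentialCong h2 M M A A′

    module QP (u : Fin q)
      (hQQ : ∀ v w → A (inj₂ v) (inj₂ w) ≡ A′ (inj₂ v) (inj₂ w))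
      (hQP : ∀ w i → w ≢ u → A (inj₂ w) (inj₁ i) ≡ A′ (inj₂ w) (inj₁ i))
      (hPQ : ∀ w i → w ≢ u → A (inj₁ i) (inj₂ w) ≡ A′ (inj₁ i) (inj₂ w)) where

      sumA-rel : sumA M A + termA M A′ u ≡ sumA M A′ + termA M A u
      sumA-rel = Σ-update q u (termA M A) (termA M A′) (λ w n → termA-cong w refl (λ i → hQP w i n))

      sumBCD-rel : sumBCD M A x + termBCD M A′ x u ≡ sumBCD M A′ x + termBCD M A x u
      sumBCD-rel = Σ-update q u (termBCD M A x) (termBCD M A′ x)
        (λ w n → termBCD-cong {x = x} {x} w refl (cardB-cong w (λ i → hPQ w i n) (λ i → hQP w i n)) (cardC-cong w (λ i → hQP w i n))
                   (cardD-cong w (λ v → inD-cong w v refl (hQQ v w))) refl)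

      sumE-eq : sumE M A x ≡ sumE M A′ x
      sumE-eq = Σ-cong q (λ w → rowE-cong {x = x} {x} w refl (λ v → termE-cong {x = x} {x} w v (inE-cong w v refl (hQQ v w) (hQQ w v)) refl refl))

      sumF-eq : sumF M A x ≡ sumF M A′ x
      sumF-eq = Σ-cong q (λ w → rowF-cong {x = x} {x} w refl (λ v → termF-cong {x = x} {x} w v (inF-cong w v refl (hQQ w v)) refl refl))

    module PP
      (hQQ : ∀ v w → A (inj₂ v) (inj₂ w) ≡ A′ (inj₂ v) (inj₂ w))
      (hQP : ∀ w i → A (inj₂ w) (inj₁ i) ≡ A′ (inj₂ w) (inj₁ i))
      (hPQ : ∀ w i → A (inj₁ i) (inj₂ w) ≡ A′ (inj₁ i) (inj₂ w)) where

      potential-eq : ∀ i → potential M A x i ≡ potential M A′ x i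
      potential-eq i
        rewrite Σ-cong q {termA M A} {termA M A′} (λ w → termA-cong w refl (λ i → hQP w i))
              | Σ-cong q {termBCD M A x} {termBCD M A′ x} (λ w → termBCD-cong {x = x} {x} w refl (cardB-cong w (λ i → hPQ w i) (λ i → hQP w i)) (cardC-cong w (λ i → hQP w i))
                   (cardD-cong w (λ v → inD-cong w v refl (hQQ v w))) refl)
              | Σ-cong q {rowE M A x} {rowE M A′ x} (λ w → rowE-cong {x = x} {x} w refl (λ v → termE-cong {x = x} {x} w v (inE-cong w v refl (hQQ v w) (hQQ w v)) refl refl))
              | Σ-cong q {rowF M A x} {rowF M A′ x} (λ w → rowF-cong {x = x} {x} w refl (λ v → termF-cong {x = x} {x} w v (inF-cong w v refl (hQQ w v)) refl refl))
        = refl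

    module QQ (u w : Fin q) (uw : u ≢ w)
      (hQQ : ∀ v k → (v ≡ u → k ≢ w) → (v ≡ w → k ≢ u) → A (inj₂ v) (inj₂ k) ≡ A′ (inj₂ v) (inj₂ k))
      (hQP : ∀ k i → A (inj₂ k) (inj₁ i) ≡ A′ (inj₂ k) (inj₁ i))
      (hPQ : ∀ k i → A (inj₁ i) (inj₂ k) ≡ A′ (inj₁ i) (inj₂ k)) where

      sumA-eq : sumA M A ≡ sumA M A′
      sumA-eq = Σ-cong q (λ k → termA-cong k refl (λ i → hQP k i))

      private
        hQQ′ : ∀ v k → v ≢ u → v ≢ w → A (inj₂ v) (inj₂ k) ≡ A′ (inj₂ v) (inj₂ k)
        hQQ′ v k n1 n2 = hQQ v k (λ e → ⊥-elim (n1 e)) (λ e → ⊥-elim (n2 e))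
        hQQ″ : ∀ v k → k ≢ u → k ≢ w → A (inj₂ v) (inj₂ k) ≡ A′ (inj₂ v) (inj₂ k)
        hQQ″ v k n1 n2 = hQQ v k (λ _ e → n2 e) (λ _ e → n1 e)

      termBCD-same : ∀ k → k ≢ u → k ≢ w → termBCD M A x k ≡ termBCD M A′ x k
      termBCD-same k n1 n2 = termBCD-cong {x = x} {x} k refl (cardB-cong k (λ i → hPQ k i) (λ i → hQP k i)) (cardC-cong k (λ i → hQP k i))
                   (cardD-cong k (λ v → inD-cong k v refl (hQQ″ v k n1 n2))) refl

      sumBCD-rel : sumBCD M A x + (termBCD M A′ x u + termBCD M A′ x w) ≡ sumBCD M A′ x + (termBCD M A x u + termBCD M A x w)
      sumBCD-rel = Σ-update₂ q u w uw (termBCD M A x) (termBCD M A′ x) termBCD-same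

      rowE-same : ∀ k → k ≢ u → k ≢ w → rowE M A x k ≡ rowE M A′ x k
      rowE-same k n1 n2 = rowE-cong {x = x} {x} k refl (λ v → termE-cong {x = x} {x} k v (inE-cong k v refl (hQQ″ v k n1 n2) (hQQ′ k v n1 n2)) refl refl)

      sumE-rel : sumE M A x + (rowE M A′ x u + rowE M A′ x w) ≡ sumE M A′ x + (rowE M A x u + rowE M A x w)
      sumE-rel = Σ-update₂ q u w uw (rowE M A x) (rowE M A′ x) rowE-same

      rowF-same : ∀ k → k ≢ u → k ≢ w → rowF M A x k ≡ rowF M A′ x k
      rowF-same k n1 n2 = rowF-cong {x = x} {x} k refl (λ v → termF-cong {x = x} {x} k v (inF-cong k v refl (hQQ′ k v n1 n2)) refl refl)

      sumF-rel : sumF M A x + (rowF M A′ x u + rowF M A′ x w) ≡ sumF M A′ x + (rowF M A x u + rowF M A x w)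
      sumF-rel = Σ-update₂ q u w uw (rowF M A x) (rowF M A′ x) rowF-same

      rowE-rel : ∀ k k′ → k ≢ k′ → (∀ v → v ≢ k′ → termE M A x k v ≡ termE M A′ x k v) →
                 Σ[< q ] (termE M A x k) + termE M A′ x k k′ ≡ Σ[< q ] (termE M A′ x k) + termE M A x k k′
      rowE-rel k k′ _ h = Σ-update q k′ (termE M A x k) (termE M A′ x k) h

      rowF-rel : ∀ k k′ → (∀ v → v ≢ k′ → termF M A x k v ≡ termF M A′ x k v) →
                 Σ[< q ] (termF M A x k) + termF M A′ x k k′ ≡ Σ[< q ] (termF M A′ x k) + termF M A x k k′
      rowF-rel k k′ h = Σ-update q k′ (termF M A x k) (termF M A′ x k) h

  [2+m]/2 : ∀ m → (2 + m) / 2 ≡ suc (m / 2)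
  [2+m]/2 m = m/n≡1+[m∸n]/n {2 + m} {2} (s≤s (s≤s z≤n))

  [m+2k]/2 : ∀ m k → (m + 2 * k) / 2 ≡ m / 2 + k
  [m+2k]/2 m zero rewrite +-identityʳ m = sym (+-identityʳ (m / 2))
  [m+2k]/2 m (suc k) = trans (cong (_/ 2) e) (trans ([2+m]/2 (m + 2 * k)) (trans (cong suc ([m+2k]/2 m k)) (sym (+-suc (m / 2) k))))
    where
    e : m + 2 * suc k ≡ 2 + (m + 2 * k)
    e = solve 2 (λ m k → m :+ con 2 :* (con 1 :+ k) := con 2 :+ (m :+ con 2 :* k)) refl m k

  dec-inv : ∀ {i iv′} a b c d → i ≡ suc iv′ → i + a + b + c + d ≡ suc (iv′ + a + b + c + d)
  dec-inv a b c d refl = refl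

  dec-A : ∀ i {a a′} b c d → a ≡ suc a′ → i + a + b + c + d ≡ suc (i + a′ + b + c + d)
  dec-A i {a′ = a′} b c d refl rewrite +-suc i a′ = refl

  dec-BCD : ∀ i a {b b′} c d → b ≡ suc b′ → i + a + b + c + d ≡ suc (i + a + b′ + c + d)
  dec-BCD i a {b′ = b′} c d refl rewrite +-suc (i + a) b′ = refl

  dec-E : ∀ i a b {t t′} d → t ≡ 2 + t′ → i + a + b + t / 2 + d ≡ suc (i + a + b + t′ / 2 + d)
  dec-E i a b {t′ = t′} d refl rewrite [2+m]/2 t′ | +-suc (i + a + b) (t′ / 2) = refl

  trade-E-F : ∀ i a b {t t′ s s′} → t + 2 ≡ t′ → s ≡ suc s′ → i + a + b + t / 2 + 2 * s ≡ suc (i + a + b + t′ / 2 + 2 * s′)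
  trade-E-F i a b {t} {s′ = s′} refl refl rewrite +-comm t 2 | [2+m]/2 t =
    solve 5 (λ i a b h s → i :+ a :+ b :+ h :+ con 2 :* (con 1 :+ s) := con 1 :+ (i :+ a :+ b :+ (con 1 :+ h) :+ con 2 :* s)) refl i a b (t / 2) s′

  trade-A-BCD-E : ∀ i a b b′ e L K z → b + K ≡ b′ + suc L →
                  i + a + b + (e + (K + K)) / 2 + z ≡ suc (i + (a + L) + b′ + e / 2 + z)
  trade-A-BCD-E i a b b′ e L K z eq rewrite sym (cong (e +_) (cong (K +_) (+-identityʳ K))) | [m+2k]/2 e K =
    trans (solve 6 (λ i a b h K z → i :+ a :+ b :+ (h :+ K) :+ z := i :+ a :+ (b :+ K) :+ h :+ z) refl i a b (e / 2) K z)
      (trans (cong (λ m → i + a + m + e / 2 + z) eq)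
        (solve 6 (λ i a b′ L h z → i :+ a :+ (b′ :+ (con 1 :+ L)) :+ h :+ z := con 1 :+ (i :+ (a :+ L) :+ b′ :+ h :+ z)) refl i a b′ L (e / 2) z))

  trade-A-BCD-E′ : ∀ i a b b′ e L Λ z → b + L ≡ b′ + (Λ + 1) →
                   i + (a + L) + b + e / 2 + z ≡ suc (i + a + b′ + (e + (Λ + Λ)) / 2 + z)
  trade-A-BCD-E′ i a b b′ e L Λ z eq rewrite sym (cong (e +_) (cong (Λ +_) (+-identityʳ Λ))) | [m+2k]/2 e Λ =
    trans (solve 6 (λ i a L b h z → i :+ (a :+ L) :+ b :+ h :+ z := i :+ a :+ (b :+ L) :+ h :+ z) refl i a L b (e / 2) z)
      (trans (cong (λ m → i + a + m + e / 2 + z) eq)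
        (solve 6 (λ i a b′ Λ h z → i :+ a :+ (b′ :+ (Λ :+ con 1)) :+ h :+ z := con 1 :+ (i :+ a :+ b′ :+ (h :+ Λ) :+ z)) refl i a b′ Λ (e / 2) z))

  module Unfold (h2 : Handle) (M : Vertex → Bool) (A : Vertex → Vertex → Bool) where
    open Potential h2

    inY-true : ∀ {u} → M (inj₂ u) ≡ true → mem₂ (inj₂ u) ≡ true → inY M A u ≡ true
    inY-true e1 e2 = ∧-true e1 e2
    inY-falseˡ : ∀ {u} → M (inj₂ u) ≡ false → inY M A u ≡ false
    inY-falseˡ {u} e = ∧-falseˡ (mem₂ (inj₂ u)) e
    inY-falseʳ : ∀ {u} → mem₂ (inj₂ u) ≡ false → inY M A u ≡ false
    inY-falseʳ {u} e = ∧-falseʳ (M (inj₂ u)) e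

    termA-Y : ∀ {u} → inY M A u ≡ true → termA M A u ≡ 0
    termA-Y e = if-true e
    termA-N : ∀ {u} → inY M A u ≡ false → termA M A u ≡ cardA M A u
    termA-N e = if-false e
    cardA-T : ∀ {u} → M (inj₂ u) ≡ true → cardA M A u ≡ card p (λ i → A (inj₂ u) (inj₁ i))
    cardA-T e = if-true e
    cardA-FT : ∀ {u} → M (inj₂ u) ≡ false → mem₂ (inj₂ u) ≡ true → cardA M A u ≡ card p (λ i → above₂ (inj₂ u) (inj₁ i))
    cardA-FT e1 e2 = trans (if-false e1) (if-true e2)
    cardA-FF : ∀ {u} → M (inj₂ u) ≡ false → mem₂ (inj₂ u) ≡ false → cardA M A u ≡ 0
    cardA-FF e1 e2 = trans (if-false e1) (if-false e2)

    module _ (x : Fin q → Bool) where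
      termBCD-Y : ∀ {u} → inY M A u ≡ true → termBCD M A x u ≡ cardB M A u + 2 * cardC M A u * b2n (x u) + cardD M A u * (1 ∸ b2n (x u))
      termBCD-Y e = if-true e
      termBCD-N : ∀ {u} → inY M A u ≡ false → termBCD M A x u ≡ 0
      termBCD-N e = if-false e
      termBCD-Y0 : ∀ {u} → inY M A u ≡ true → x u ≡ false → termBCD M A x u ≡ cardB M A u + cardD M A u
      termBCD-Y0 {u} e ex rewrite termBCD-Y e | ex | *-zeroʳ (2 * cardC M A u) | *-identityʳ (cardD M A u) | +-identityʳ (cardB M A u) = refl
      termBCD-Y1 : ∀ {u} → inY M A u ≡ true → x u ≡ true → termBCD M A x u ≡ cardB M A u + 2 * cardC M A u
      termBCD-Y1 {u} e ex rewrite termBCD-Y e | ex | *-zeroʳ (cardD M A u) | *-identityʳ (2 * cardC M A u) = +-identityʳ _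
      rowE-Y : ∀ {u} → inY M A u ≡ true → rowE M A x u ≡ Σ[< q ] (termE M A x u)
      rowE-Y e = if-true e
      rowE-N : ∀ {u} → inY M A u ≡ false → rowE M A x u ≡ 0
      rowE-N e = if-false e
      rowF-Y : ∀ {u} → inY M A u ≡ true → rowF M A x u ≡ Σ[< q ] (termF M A x u)
      rowF-Y e = if-true e
      rowF-N : ∀ {u} → inY M A u ≡ false → rowF M A x u ≡ 0
      rowF-N e = if-false e
      termE-T : ∀ {u v} → inE M A u v ≡ true → termE M A x u v ≡ (1 + b2n (x u)) * (1 ∸ b2n (x v))
      termE-T e = if-true e
      termE-F : ∀ {u v} → inE M A u v ≡ false → termE M A x u v ≡ 0
      termE-F e = if-false e
      termF-T : ∀ {u v} → inF M A u v ≡ true → termF M A x u v ≡ b2n (x u) * (1 ∸ b2n (x v))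
      termF-T e = if-true e
      termF-F : ∀ {u v} → inF M A u v ≡ false → termF M A x u v ≡ 0
      termF-F e = if-false e

  cancel : ∀ a b c → a + c ≡ b + c → a ≡ b
  cancel a b c e = +-cancelʳ-≡ c a b e

  cancel-suc : ∀ a b c → a + c ≡ b + suc c → a ≡ suc b
  cancel-suc a b c e = cancel a (suc b) c (trans e (+-suc b c))

  cancel-suc′ : ∀ a b c → a + suc c ≡ b + c → suc a ≡ b
  cancel-suc′ a b c e = cancel (suc a) b c (trans (sym (+-suc a c)) e)

  cancel-rows : ∀ {a b x1 x2 y1 y2} → a + (x1 + y1) ≡ b + (x2 + y2) → x1 ≡ x2 → y1 ≡ y2 → a ≡ b
  cancel-rows {a} {b} {x1} {y1 = y1} e refl refl = cancel a b (x1 + y1) e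

  +-2*-suc : ∀ b b′ c c′ → suc b ≡ b′ → c ≡ suc c′ → b + 2 * c ≡ suc (b′ + 2 * c′)
  +-2*-suc b .(suc b) .(suc c′) c′ refl refl =
    solve 2 (λ b c → b :+ con 2 :* (con 1 :+ c) := con 1 :+ ((con 1 :+ b) :+ con 2 :* c)) refl b c′

  -- A and A′ are the orders of a handle before and after two adjacent vertices are exchanged.
  module SwapCases (h2 : Handle) (M : Vertex → Bool) (x : Fin q → Bool) (A A′ : Vertex → Vertex → Bool) where
    open Potential h2
    open PotentialCong h2 M M A A′
    open SwapPotential h2 M x A A′
    open Unfold h2 M A
    private
      module R′ = Unfold h2 M A′

    module QPCase (u : Fin q) (j : Fin p)
      (hQQ : ∀ v w → A (inj₂ v) (inj₂ w) ≡ A′ (inj₂ v) (inj₂ w))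
      (hQP : ∀ w i → w ≢ u → A (inj₂ w) (inj₁ i) ≡ A′ (inj₂ w) (inj₁ i))
      (hPQ : ∀ w i → w ≢ u → A (inj₁ i) (inj₂ w) ≡ A′ (inj₁ i) (inj₂ w))
      (hQPu : ∀ i → i ≢ j → A (inj₂ u) (inj₁ i) ≡ A′ (inj₂ u) (inj₁ i))
      (hPQu : ∀ i → i ≢ j → A (inj₁ i) (inj₂ u) ≡ A′ (inj₁ i) (inj₂ u)) where
      open QP u hQQ hQP hPQ

      cardB-update : cardB M A u + b2n (split M A′ (inj₁ j) (inj₂ u)) ≡ cardB M A′ u + b2n (split M A (inj₁ j) (inj₂ u))
      cardB-update = card-update p j _ _ (λ i n → split-cong (inj₁ i) (inj₂ u) (hPQu i n) (hQPu i n))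

      cardC-update : cardC M A u + b2n (A′ (inj₂ u) (inj₁ j) ∧ above₂ (inj₂ u) (inj₁ j)) ≡ cardC M A′ u + b2n (A (inj₂ u) (inj₁ j) ∧ above₂ (inj₂ u) (inj₁ j))
      cardC-update = card-update p j _ _ (λ i n → cong (λ b → b ∧ above₂ (inj₂ u) (inj₁ i)) (hQPu i n))

      cardD-eq : cardD M A u ≡ cardD M A′ u
      cardD-eq = cardD-cong u (λ v → inD-cong u v refl (hQQ v u))

      lower-absent-past-P : M (inj₂ u) ≡ true → mem₂ (inj₂ u) ≡ false → A (inj₂ u) (inj₁ j) ≡ true → A′ (inj₂ u) (inj₁ j) ≡ false →
               ∀ i → potential M A x i ≡ suc (potential M A′ x i)
      lower-absent-past-P Mu m2u e1 e2 i = trans (cong₂ (λ a b → i + sumA M A + a + b / 2 + 2 * sumF M A x) sumBCD≡ sumE-eq)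
                                (trans (cong (λ b → i + sumA M A + sumBCD M A′ x + sumE M A′ x / 2 + 2 * b) sumF-eq)
                                       (dec-A i (sumBCD M A′ x) (sumE M A′ x / 2) (2 * sumF M A′ x) sumA≡))
        where
        yN : inY M A u ≡ false
        yN = inY-falseʳ {u} m2u
        yN′ : inY M A′ u ≡ false
        yN′ = R′.inY-falseʳ {u} m2u
        termA-u≡ : termA M A u ≡ suc (termA M A′ u)
        termA-u≡ rewrite termA-N yN | R′.termA-N yN′ | cardA-T Mu | R′.cardA-T Mu =
          cancel-suc _ _ 0 (trans (cong (λ b → card p (λ i → A (inj₂ u) (inj₁ i)) + b2n b) (sym e2))
            (trans (card-update p j (λ i → A (inj₂ u) (inj₁ i)) (λ i → A′ (inj₂ u) (inj₁ i)) hQPu)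
               (cong (λ b → card p (λ i → A′ (inj₂ u) (inj₁ i)) + b2n b) e1)))
        sumA≡ : sumA M A ≡ suc (sumA M A′)
        sumA≡ = cancel-suc _ _ _ (trans sumA-rel (cong (sumA M A′ +_) termA-u≡))
        sumBCD≡ : sumBCD M A x ≡ sumBCD M A′ x
        sumBCD≡ = cancel _ _ 0 (trans (cong (sumBCD M A x +_) (sym (R′.termBCD-N x yN′))) (trans sumBCD-rel (cong (sumBCD M A′ x +_) (termBCD-N x yN))))

      lower-marked-past-P : inY M A u ≡ true → x u ≡ true → A (inj₂ u) (inj₁ j) ≡ true → A (inj₁ j) (inj₂ u) ≡ false →
               A′ (inj₂ u) (inj₁ j) ≡ false → A′ (inj₁ j) (inj₂ u) ≡ true → ExactlyOneAbove h2 (inj₂ u) (inj₁ j) →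
               ∀ i → potential M A x i ≡ suc (potential M A′ x i)
      lower-marked-past-P yu xu e1 e2 e3 e4′ ex i = trans (cong₂ (λ a b → i + sumA M A + a + b / 2 + 2 * sumF M A x) refl sumE-eq)
                                (trans (cong₂ (λ a b → i + a + sumBCD M A x + sumE M A′ x / 2 + 2 * b) sumA≡ sumF-eq)
                                       (dec-BCD i (sumA M A′) (sumE M A′ x / 2) (2 * sumF M A′ x) sumBCD≡))
        where
        sumA≡ : sumA M A ≡ sumA M A′
        sumA≡ = cancel _ _ 0 (trans (cong (sumA M A +_) (sym (R′.termA-Y yu))) (trans sumA-rel (cong (sumA M A′ +_) (termA-Y yu))))
        sA : split M A (inj₁ j) (inj₂ u) ≡ above₂ (inj₁ j) (inj₂ u)
        sA rewrite e1 | e2 = refl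
        sA′ : split M A′ (inj₁ j) (inj₂ u) ≡ above₂ (inj₂ u) (inj₁ j)
        sA′ rewrite e3 | e4′ = ∨-identityʳ (above₂ (inj₂ u) (inj₁ j))
        b1 : cardB M A u + b2n (above₂ (inj₂ u) (inj₁ j)) ≡ cardB M A′ u + b2n (above₂ (inj₁ j) (inj₂ u))
        b1 = trans (cong (λ b → cardB M A u + b2n b) (sym sA′)) (trans cardB-update (cong (λ b → cardB M A′ u + b2n b) sA))
        c1 : cardC M A u + 0 ≡ cardC M A′ u + b2n (above₂ (inj₂ u) (inj₁ j))
        c1 = trans (cong (λ b → cardC M A u + b2n (b ∧ above₂ (inj₂ u) (inj₁ j))) (sym e3)) (trans cardC-update (cong (λ b → cardC M A′ u + b2n (b ∧ above₂ (inj₂ u) (inj₁ j))) e1))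
        BC : ExactlyOneAbove h2 (inj₂ u) (inj₁ j) → cardB M A u + 2 * cardC M A u ≡ suc (cardB M A′ u + 2 * cardC M A′ u)
        BC (inj₁ (a , b)) =
              let cb = cancel-suc′ _ _ 0 (sym (trans (sym (cong (λ z → cardB M A′ u + b2n z) b)) (trans (sym b1) (cong (λ z → cardB M A u + b2n z) a))))
                  cc = cancel-suc _ _ 0 (trans c1 (cong (λ z → cardC M A′ u + b2n z) a))
              in +-2*-suc _ _ _ _ cb cc
        BC (inj₂ (a , b)) =
              let cb = cancel-suc _ _ 0 (trans (sym (cong (λ z → cardB M A u + b2n z) a)) (trans b1 (cong (λ z → cardB M A′ u + b2n z) b)))
                  cc = cancel _ _ 0 (trans c1 (cong (λ z → cardC M A′ u + b2n z) a))
              in cong₂ (λ m n → m + 2 * n) cb cc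
        sumBCD≡ : sumBCD M A x ≡ suc (sumBCD M A′ x)
        sumBCD≡ = cancel-suc _ _ _ (trans sumBCD-rel (cong (sumBCD M A′ x +_) (trans (termBCD-Y1 x yu xu) (trans (BC ex) (sym (cong suc (R′.termBCD-Y1 x yu xu)))))))

      reorder-kept-P : inY M A u ≡ true → x u ≡ false → split M A (inj₁ j) (inj₂ u) ≡ true → split M A′ (inj₁ j) (inj₂ u) ≡ false →
               ∀ i → potential M A x i ≡ suc (potential M A′ x i)
      reorder-kept-P yu xu s1 s2 i = trans (cong₂ (λ a b → i + sumA M A + sumBCD M A x + a / 2 + 2 * b) sumE-eq sumF-eq)
                                (trans (cong (λ a → i + a + sumBCD M A x + sumE M A′ x / 2 + 2 * sumF M A′ x) sumA≡)
                                       (dec-BCD i (sumA M A′) (sumE M A′ x / 2) (2 * sumF M A′ x) sumBCD≡))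
        where
        sumA≡ : sumA M A ≡ sumA M A′
        sumA≡ = cancel _ _ 0 (trans (cong (sumA M A +_) (sym (R′.termA-Y yu))) (trans sumA-rel (cong (sumA M A′ +_) (termA-Y yu))))
        cardB-u≡ : cardB M A u ≡ suc (cardB M A′ u)
        cardB-u≡ = cancel-suc _ _ 0 (trans (cong (λ b → cardB M A u + b2n b) (sym s2)) (trans cardB-update (cong (λ b → cardB M A′ u + b2n b) s1)))
        sumBCD≡ : sumBCD M A x ≡ suc (sumBCD M A′ x)
        sumBCD≡ = cancel-suc _ _ _ (trans sumBCD-rel (cong (sumBCD M A′ x +_) (trans (termBCD-Y0 x yu xu) (trans (cong₂ _+_ cardB-u≡ cardD-eq)
                   (sym (cong suc (R′.termBCD-Y0 x yu xu)))))))

    module QQCase (u w : Fin q) (uw : u ≢ w)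
      (hQQ : ∀ v k → (v ≡ u → k ≢ w) → (v ≡ w → k ≢ u) → A (inj₂ v) (inj₂ k) ≡ A′ (inj₂ v) (inj₂ k))
      (hQP : ∀ k i → A (inj₂ k) (inj₁ i) ≡ A′ (inj₂ k) (inj₁ i))
      (hPQ : ∀ k i → A (inj₁ i) (inj₂ k) ≡ A′ (inj₁ i) (inj₂ k))
      (A1 : A (inj₂ u) (inj₂ w) ≡ true) (A2 : A (inj₂ w) (inj₂ u) ≡ false)
      (A1′ : A′ (inj₂ u) (inj₂ w) ≡ false) (A2′ : A′ (inj₂ w) (inj₂ u) ≡ true) where
      open QQ u w uw hQQ hQP hPQ

      private
        wu : w ≢ u
        wu e = uw (sym e)
      Au1 : ∀ v → v ≢ w → A (inj₂ v) (inj₂ u) ≡ A′ (inj₂ v) (inj₂ u)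
      Au1 v n = hQQ v u (λ _ e → uw e) (λ e _ → n e)
      Au2 : ∀ v → v ≢ w → A (inj₂ u) (inj₂ v) ≡ A′ (inj₂ u) (inj₂ v)
      Au2 v n = hQQ u v (λ _ e → n e) (λ e _ → uw e)
      Aw1 : ∀ v → v ≢ u → A (inj₂ v) (inj₂ w) ≡ A′ (inj₂ v) (inj₂ w)
      Aw1 v n = hQQ v w (λ e _ → n e) (λ _ e → wu e)
      Aw2 : ∀ v → v ≢ u → A (inj₂ w) (inj₂ v) ≡ A′ (inj₂ w) (inj₂ v)
      Aw2 v n = hQQ w v (λ e _ → wu e) (λ _ e → n e)

      termE-u-off : ∀ v → v ≢ w → termE M A x u v ≡ termE M A′ x u v
      termE-u-off v n = termE-cong {x = x} {x} u v (inE-cong u v refl (Au1 v n) (Au2 v n)) refl refl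
      termE-w-off : ∀ v → v ≢ u → termE M A x w v ≡ termE M A′ x w v
      termE-w-off v n = termE-cong {x = x} {x} w v (inE-cong w v refl (Aw1 v n) (Aw2 v n)) refl refl
      termF-u-off : ∀ v → v ≢ w → termF M A x u v ≡ termF M A′ x u v
      termF-u-off v n = termF-cong {x = x} {x} u v (inF-cong u v refl (Au2 v n)) refl refl
      termF-w-off : ∀ v → v ≢ u → termF M A x w v ≡ termF M A′ x w v
      termF-w-off v n = termF-cong {x = x} {x} w v (inF-cong w v refl (Aw2 v n)) refl refl

      cardB-u≡ : cardB M A u ≡ cardB M A′ u
      cardB-u≡ = cardB-cong u (λ i → hPQ u i) (λ i → hQP u i)
      cardB-w≡ : cardB M A w ≡ cardB M A′ w
      cardB-w≡ = cardB-cong w (λ i → hPQ w i) (λ i → hQP w i)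
      cardC-u≡ : cardC M A u ≡ cardC M A′ u
      cardC-u≡ = cardC-cong u (λ i → hQP u i)
      cardC-w≡ : cardC M A w ≡ cardC M A′ w
      cardC-w≡ = cardC-cong w (λ i → hQP w i)

      sumBCD-both-Y : inY M A u ≡ true → inY M A w ≡ true → sumBCD M A x ≡ sumBCD M A′ x
      sumBCD-both-Y yu yw = cancel-rows sumBCD-rel termBCD-u≡ termBCD-w≡
        where
        termBCD-u≡ : termBCD M A′ x u ≡ termBCD M A x u
        termBCD-u≡ = sym (termBCD-cong {x = x} {x} u refl cardB-u≡ cardC-u≡ (cardD-cong u dd) refl)
          where
          dd : ∀ v → inD M A u v ≡ inD M A′ u v
          dd v with v F.≟ w
          ... | yes refl = trans (∧-falseˡ _ (cong not yw)) (sym (∧-falseˡ _ (cong not yw)))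
          ... | no n = inD-cong u v refl (Au1 v n)
        termBCD-w≡ : termBCD M A′ x w ≡ termBCD M A x w
        termBCD-w≡ = sym (termBCD-cong {x = x} {x} w refl cardB-w≡ cardC-w≡ (cardD-cong w dd) refl)
          where
          dd : ∀ v → inD M A w v ≡ inD M A′ w v
          dd v with v F.≟ u
          ... | yes refl = trans (∧-falseˡ _ (cong not yu)) (sym (∧-falseˡ _ (cong not yu)))
          ... | no n = inD-cong w v refl (Aw1 v n)

      rowF-w-same : x w ≡ false → rowF M A′ x w ≡ rowF M A x w
      rowF-w-same xw = sym (rowF-cong {x = x} {x} w refl entry)
        where
        zero-at-u : ∀ {B} → termF M B x w u ≡ 0
        zero-at-u {B} with inF M B w u
        ... | true rewrite xw = refl
        ... | false = refl
        entry : ∀ v → termF M A x w v ≡ termF M A′ x w v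
        entry v with v F.≟ u
        ... | yes refl = trans (zero-at-u {A}) (sym (zero-at-u {A′}))
        ... | no n = termF-w-off v n

      rowE-drops-by-one : ∀ k l → k ≢ l → inY M A k ≡ true → (1 + b2n (x k)) * (1 ∸ b2n (x l)) ≡ 1 →
                          inE M A k l ≡ true → inE M A′ k l ≡ false →
                          (∀ v → v ≢ l → termE M A x k v ≡ termE M A′ x k v) → rowE M A x k ≡ suc (rowE M A′ x k)
      rowE-drops-by-one k l kl yk value e e′ others =
        cancel-suc _ _ 0 (trans (cong (_+ _) (rowE-Y x yk)) (trans (cong (Σ[< q ] (termE M A x k) +_) (sym (R′.termE-F x e′)))
          (trans (rowE-rel k l kl others) (cong₂ _+_ (sym (R′.rowE-Y x yk)) (trans (termE-T x e) value)))))

      lower-absent-past-kept : M (inj₂ u) ≡ true → mem₂ (inj₂ u) ≡ false → inY M A w ≡ true → x w ≡ false →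
               ∀ i → potential M A x i ≡ suc (potential M A′ x i)
      lower-absent-past-kept Mu m2u yw xw i = trans (cong₂ (λ a b → i + a + sumBCD M A x + b / 2 + 2 * sumF M A x) sumA-eq sumE≡)
                                (trans (cong (λ b → i + sumA M A′ + sumBCD M A x + sumE M A′ x / 2 + 2 * b) sumF≡)
                                       (dec-BCD i (sumA M A′) (sumE M A′ x / 2) (2 * sumF M A′ x) sumBCD≡))
        where
        yu : inY M A u ≡ false
        yu = inY-falseʳ {u} m2u
        yu′ : inY M A′ u ≡ false
        yu′ = R′.inY-falseʳ {u} m2u
        dP-u : inD M A w u ≡ true
        dP-u rewrite yu | A1 = refl
        dP-u′ : inD M A′ w u ≡ false
        dP-u′ rewrite yu | A1′ | above-absent₁ h2 (inj₂ u) (inj₂ w) m2u = refl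
        cardD-w≡ : cardD M A w ≡ suc (cardD M A′ w)
        cardD-w≡ = cancel-suc _ _ 0 (trans (cong (λ b → cardD M A w + b2n b) (sym dP-u′))
                (trans (card-update q u (inD M A w) (inD M A′ w) (λ v n → inD-cong w v refl (Aw1 v n))) (cong (λ b → cardD M A′ w + b2n b) dP-u)))
        termBCD-w≡ : termBCD M A x w ≡ suc (termBCD M A′ x w)
        termBCD-w≡ = trans (termBCD-Y0 x yw xw) (trans (cong₂ _+_ cardB-w≡ cardD-w≡) (trans (+-suc _ _) (cong suc (sym (R′.termBCD-Y0 x yw xw)))))
        sumBCD≡ : sumBCD M A x ≡ suc (sumBCD M A′ x)
        sumBCD≡ = cancel-suc _ _ _ (trans sumBCD-rel (cong (sumBCD M A′ x +_)
                (trans (cong₂ _+_ (termBCD-N x yu) termBCD-w≡) (cong suc (cong (_+ termBCD M A′ x w) (sym (R′.termBCD-N x yu′)))))))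
        rowE-w≡ : rowE M A′ x w ≡ rowE M A x w
        rowE-w≡ = sym (rowE-cong {x = x} {x} w refl ent)
          where
          ent : ∀ v → termE M A x w v ≡ termE M A′ x w v
          ent v with v F.≟ u
          ... | yes refl = trans (termE-F x (∧-falseˡ _ yu)) (sym (R′.termE-F x (∧-falseˡ _ yu′)))
          ... | no n = termE-w-off v n
        sumE≡ : sumE M A x ≡ sumE M A′ x
        sumE≡ = cancel-rows sumE-rel (trans (R′.rowE-N x yu′) (sym (rowE-N x yu))) rowE-w≡
        rowF-w≡ : rowF M A′ x w ≡ rowF M A x w
        rowF-w≡ = sym (rowF-cong {x = x} {x} w refl ent)
          where
          ent : ∀ v → termF M A x w v ≡ termF M A′ x w v
          ent v with v F.≟ u
          ... | yes refl = trans (termF-F x (∧-falseˡ _ yu)) (sym (R′.termF-F x (∧-falseˡ _ yu′)))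
          ... | no n = termF-w-off v n
        sumF≡ : sumF M A x ≡ sumF M A′ x
        sumF≡ = cancel-rows sumF-rel (trans (R′.rowF-N x yu′) (sym (rowF-N x yu))) rowF-w≡

      private
        module MarkedAboveKept (yu : inY M A u ≡ true) (xu : x u ≡ true) (yw : inY M A w ≡ true) (xw : x w ≡ false) where
          rowE-w-same : rowE M A′ x w ≡ rowE M A x w
          rowE-w-same = sym (rowE-cong {x = x} {x} w refl entry)
            where
            zero-at-u : ∀ {B} → termE M B x w u ≡ 0
            zero-at-u {B} with inE M B w u
            ... | true rewrite xu = *-zeroʳ (1 + b2n (x w))
            ... | false = refl
            entry : ∀ v → termE M A x w v ≡ termE M A′ x w v
            entry v with v F.≟ u
            ... | yes refl = trans (zero-at-u {A}) (sym (zero-at-u {A′}))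
            ... | no n = termE-w-off v n

          rowE-u-rel : rowE M A x u + termE M A′ x u w ≡ rowE M A′ x u + termE M A x u w
          rowE-u-rel = trans (cong (_+ termE M A′ x u w) (rowE-Y x yu))
            (trans (rowE-rel u w uw termE-u-off) (cong (_+ termE M A x u w) (sym (R′.rowE-Y x yu))))

          rowF-u-rel : rowF M A x u + termF M A′ x u w ≡ rowF M A′ x u + termF M A x u w
          rowF-u-rel = trans (cong (_+ termF M A′ x u w) (rowF-Y x yu))
            (trans (rowF-rel u w termF-u-off) (cong (_+ termF M A x u w) (sym (R′.rowF-Y x yu))))

          inE-uw : inE M A u w ≡ above₂ (inj₂ w) (inj₂ u)
          inE-uw rewrite yw | A1 | A2 = refl
          inE-uw′ : inE M A′ u w ≡ above₂ (inj₂ u) (inj₂ w)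
          inE-uw′ rewrite yw | A1′ | A2′ = ∨-identityʳ _
          inF-uw : inF M A u w ≡ above₂ (inj₂ u) (inj₂ w)
          inF-uw rewrite yw | A1 = refl
          inF-uw′ : inF M A′ u w ≡ false
          inF-uw′ rewrite yw | A1′ = refl

          termE-value : (1 + b2n (x u)) * (1 ∸ b2n (x w)) ≡ 2
          termE-value rewrite xu | xw = refl
          termF-value : b2n (x u) * (1 ∸ b2n (x w)) ≡ 1
          termF-value rewrite xu | xw = refl

          u-above-w : above₂ (inj₂ u) (inj₂ w) ≡ true → above₂ (inj₂ w) (inj₂ u) ≡ false →
                      ∀ i → potential M A x i ≡ suc (potential M A′ x i)
          u-above-w a b i = trans (cong₂ (λ m n → i + m + n + sumE M A x / 2 + 2 * sumF M A x) sumA-eq (sumBCD-both-Y yu yw))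
                                   (trade-E-F i (sumA M A′) (sumBCD M A′ x) sumE-grows sumF-drops)
            where
            rowE-u-grows : rowE M A x u + 2 ≡ rowE M A′ x u
            rowE-u-grows = trans (cong (rowE M A x u +_) (sym (trans (R′.termE-T x (trans inE-uw′ a)) termE-value)))
              (trans rowE-u-rel (trans (cong (rowE M A′ x u +_) (termE-F x (trans inE-uw b))) (+-identityʳ _)))
            sumE-grows : sumE M A x + 2 ≡ sumE M A′ x
            sumE-grows = cancel _ _ (rowE M A x u + rowE M A x w)
              (trans (solve 3 (λ a b c → a :+ con 2 :+ (b :+ c) := a :+ ((b :+ con 2) :+ c)) refl (sumE M A x) (rowE M A x u) (rowE M A x w))
                (trans (cong₂ (λ m n → sumE M A x + (m + n)) rowE-u-grows (sym rowE-w-same)) sumE-rel))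
            rowF-u-drops : rowF M A x u ≡ suc (rowF M A′ x u)
            rowF-u-drops = cancel-suc _ _ 0 (trans (cong (rowF M A x u +_) (sym (R′.termF-F x inF-uw′)))
              (trans rowF-u-rel (cong (rowF M A′ x u +_) (trans (termF-T x (trans inF-uw a)) termF-value))))
            sumF-drops : sumF M A x ≡ suc (sumF M A′ x)
            sumF-drops = cancel-suc _ _ _ (trans sumF-rel (cong (sumF M A′ x +_) (cong₂ _+_ rowF-u-drops (sym (rowF-w-same xw)))))

          w-above-u : above₂ (inj₂ u) (inj₂ w) ≡ false → above₂ (inj₂ w) (inj₂ u) ≡ true →
                      ∀ i → potential M A x i ≡ suc (potential M A′ x i)
          w-above-u a b i = trans (cong₂ (λ m n → i + m + n + sumE M A x / 2 + 2 * sumF M A x) sumA-eq (sumBCD-both-Y yu yw))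
                               (trans (cong (λ z → i + sumA M A′ + sumBCD M A′ x + sumE M A x / 2 + 2 * z) sumF-same)
                                 (dec-E i (sumA M A′) (sumBCD M A′ x) (2 * sumF M A′ x) sumE-drops))
            where
            rowE-u-drops : rowE M A x u ≡ 2 + rowE M A′ x u
            rowE-u-drops = trans (sym (+-identityʳ _)) (trans (cong (rowE M A x u +_) (sym (R′.termE-F x (trans inE-uw′ a))))
              (trans rowE-u-rel (trans (cong (rowE M A′ x u +_) (trans (termE-T x (trans inE-uw b)) termE-value)) (+-comm _ 2))))
            sumE-drops : sumE M A x ≡ 2 + sumE M A′ x
            sumE-drops = cancel _ _ (rowE M A′ x u + rowE M A′ x w)
              (trans sumE-rel (trans (cong (λ z → sumE M A′ x + (z + rowE M A x w)) rowE-u-drops)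
                (trans (cong (λ z → sumE M A′ x + (2 + rowE M A′ x u + z)) (sym rowE-w-same))
                  (solve 3 (λ a b c → a :+ (con 2 :+ b :+ c) := con 2 :+ a :+ (b :+ c)) refl (sumE M A′ x) (rowE M A′ x u) (rowE M A′ x w)))))
            rowF-u-same : rowF M A x u ≡ rowF M A′ x u
            rowF-u-same = cancel _ _ 0 (trans (cong (rowF M A x u +_) (sym (R′.termF-F x inF-uw′)))
              (trans rowF-u-rel (cong (rowF M A′ x u +_) (termF-F x (trans inF-uw a)))))
            sumF-same : sumF M A x ≡ sumF M A′ x
            sumF-same = cancel-rows sumF-rel (sym rowF-u-same) (rowF-w-same xw)

      lower-marked-past-kept : inY M A u ≡ true → x u ≡ true → inY M A w ≡ true → x w ≡ false → ExactlyOneAbove h2 (inj₂ u) (inj₂ w) →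
               ∀ i → potential M A x i ≡ suc (potential M A′ x i)
      lower-marked-past-kept yu xu yw xw (inj₁ (a , b)) = MarkedAboveKept.u-above-w yu xu yw xw a b
      lower-marked-past-kept yu xu yw xw (inj₂ (a , b)) = MarkedAboveKept.w-above-u yu xu yw xw a b

      reorder-kept-kept : inY M A u ≡ true → x u ≡ false → inY M A w ≡ true → x w ≡ false →
               above₂ (inj₂ w) (inj₂ u) ≡ true → above₂ (inj₂ u) (inj₂ w) ≡ false →
               ∀ i → potential M A x i ≡ suc (potential M A′ x i)
      reorder-kept-kept yu xu yw xw a b i = trans (cong₂ (λ m n → i + m + n + sumE M A x / 2 + 2 * sumF M A x) sumA-eq (sumBCD-both-Y yu yw))
                             (trans (cong (λ z → i + sumA M A′ + sumBCD M A′ x + sumE M A x / 2 + 2 * z) sumF-same)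
                             (dec-E i (sumA M A′) (sumBCD M A′ x) (2 * sumF M A′ x) sumE-drops))
        where
        value : ∀ k l → x k ≡ false → x l ≡ false → (1 + b2n (x k)) * (1 ∸ b2n (x l)) ≡ 1
        value k l e1 e2 rewrite e1 | e2 = refl
        inE-uw : inE M A u w ≡ true
        inE-uw rewrite yw | A1 | A2 | a = refl
        inE-uw′ : inE M A′ u w ≡ false
        inE-uw′ rewrite yw | A1′ | A2′ | b = refl
        inE-wu : inE M A w u ≡ true
        inE-wu rewrite yu | A1 | A2 | a = refl
        inE-wu′ : inE M A′ w u ≡ false
        inE-wu′ rewrite yu | A1′ | A2′ | b = refl
        sumE-drops : sumE M A x ≡ 2 + sumE M A′ x
        sumE-drops = cancel _ _ (rowE M A′ x u + rowE M A′ x w)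
          (trans sumE-rel (trans (cong₂ (λ m n → sumE M A′ x + (m + n))
                                   (rowE-drops-by-one u w uw yu (value u w xu xw) inE-uw inE-uw′ termE-u-off)
                                   (rowE-drops-by-one w u (λ e → uw (sym e)) yw (value w u xw xu) inE-wu inE-wu′ termE-w-off))
            (solve 3 (λ a b c → a :+ ((con 1 :+ b) :+ (con 1 :+ c)) := con 2 :+ a :+ (b :+ c)) refl (sumE M A′ x) (rowE M A′ x u) (rowE M A′ x w))))
        rowF-u-same : rowF M A′ x u ≡ rowF M A x u
        rowF-u-same = sym (rowF-cong {x = x} {x} u refl entry)
          where
          entry : ∀ v → termF M A x u v ≡ termF M A′ x u v
          entry v with v F.≟ w
          ... | yes refl = trans (termF-F x f1) (sym (R′.termF-F x f2))
            where
            f1 : inF M A u v ≡ false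
            f1 rewrite yw | A1 | b = refl
            f2 : inF M A′ u v ≡ false
            f2 rewrite yw | A1′ = refl
          ... | no n = termF-u-off v n
        sumF-same : sumF M A x ≡ sumF M A′ x
        sumF-same = cancel-rows sumF-rel rowF-u-same (rowF-w-same xw)

  Q≢ : ∀ {k u : Fin q} → k ≢ u → inj₂ k ≢ inj₂ u
  Q≢ n e = n (inj₂-inj e)

  P≢Q : ∀ {i : Fin p} {u : Fin q} → inj₁ i ≢ inj₂ u
  P≢Q ()

  module RemovalCong (h2 : Handle) (Mb Ms : Vertex → Bool) (Ab As : Vertex → Vertex → Bool) (u : Fin q) (xb xs : Fin q → Bool)
    (hx : ∀ v → v ≢ u → xb v ≡ xs v)
    (hM : ∀ c → c ≢ inj₂ u → Mb c ≡ Ms c)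
    (hA : ∀ c d → c ≢ inj₂ u → d ≢ inj₂ u → Ab c d ≡ As c d) where
    open Potential h2
    open PotentialCong h2 Mb Ms Ab As

    inY-off : ∀ k → k ≢ u → inY Mb Ab k ≡ inY Ms As k
    inY-off k n = inY-cong k (hM _ (Q≢ n))
    termA-off : ∀ k → k ≢ u → termA Mb Ab k ≡ termA Ms As k
    termA-off k n = termA-cong k (hM _ (Q≢ n)) (λ i → hA _ _ (Q≢ n) P≢Q)
    cardB-off : ∀ k → k ≢ u → cardB Mb Ab k ≡ cardB Ms As k
    cardB-off k n = cardB-cong k (λ i → hA _ _ P≢Q (Q≢ n)) (λ i → hA _ _ (Q≢ n) P≢Q)
    cardC-off : ∀ k → k ≢ u → cardC Mb Ab k ≡ cardC Ms As k
    cardC-off k n = cardC-cong k (λ i → hA _ _ (Q≢ n) P≢Q)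
    inD-off : ∀ k v → k ≢ u → v ≢ u → inD Mb Ab k v ≡ inD Ms As k v
    inD-off k v n m = inD-cong k v (hM _ (Q≢ m)) (hA _ _ (Q≢ m) (Q≢ n))
    termE-off : ∀ k v → k ≢ u → v ≢ u → termE Mb Ab xb k v ≡ termE Ms As xs k v
    termE-off k v n m = termE-cong {x = xb} {xs} k v (inE-cong k v (hM _ (Q≢ m)) (hA _ _ (Q≢ m) (Q≢ n)) (hA _ _ (Q≢ n) (Q≢ m))) (hx k n) (hx v m)
    termF-off : ∀ k v → k ≢ u → v ≢ u → termF Mb Ab xb k v ≡ termF Ms As xs k v
    termF-off k v n m = termF-cong {x = xb} {xs} k v (inF-cong k v (hM _ (Q≢ m)) (hA _ _ (Q≢ n) (Q≢ m))) (hx k n) (hx v m)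

    rowE-off : ∀ k → k ≢ u → termE Mb Ab xb k u ≡ termE Ms As xs k u → rowE Mb Ab xb k ≡ rowE Ms As xs k
    rowE-off k n eu = rowE-cong {x = xb} {xs} k (hM _ (Q≢ n)) ent
      where
      ent : ∀ v → termE Mb Ab xb k v ≡ termE Ms As xs k v
      ent v with v F.≟ u
      ... | yes refl = eu
      ... | no m = termE-off k v n m
    rowF-off : ∀ k → k ≢ u → termF Mb Ab xb k u ≡ termF Ms As xs k u → rowF Mb Ab xb k ≡ rowF Ms As xs k
    rowF-off k n eu = rowF-cong {x = xb} {xs} k (hM _ (Q≢ n)) ent
      where
      ent : ∀ v → termF Mb Ab xb k v ≡ termF Ms As xs k v
      ent v with v F.≟ u
      ... | yes refl = eu
      ... | no m = termF-off k v n m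

  -- M, A describe xs ++ u ∷ j ∷ [] and M′, A′ the handle xs ++ j ∷ [] obtained by making u a leaf.
  module Removal (h2 : Handle) (M M′ : Vertex → Bool) (A A′ : Vertex → Vertex → Bool) (x : Fin q → Bool) (u : Fin q) (j : Fin p)
    (hM : ∀ c → c ≢ inj₂ u → M c ≡ M′ c)
    (hA : ∀ c d → c ≢ inj₂ u → d ≢ inj₂ u → A c d ≡ A′ c d)
    (Mu : M (inj₂ u) ≡ true) (Mu′ : M′ (inj₂ u) ≡ false)
    (A′u1 : ∀ d → A′ (inj₂ u) d ≡ false) (A′u2 : ∀ c → A′ c (inj₂ u) ≡ false)
    (Au1 : ∀ d → A (inj₂ u) d ≡ (inj₁ j == d))
    (Au2 : ∀ c → M c ≡ true → c ≢ inj₂ u → c ≢ inj₁ j → A c (inj₂ u) ≡ true)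
    (Abu : A (inj₁ j) (inj₂ u) ≡ false) where
    open Potential h2
    open PotentialCong h2 M M′ A A′
    open RemovalCong h2 M M′ A A′ u x x (λ _ _ → refl) hM hA
    open Unfold h2 M A
    private
      module R′ = Unfold h2 M′ A′

    Au-Q : ∀ k → A (inj₂ u) (inj₂ k) ≡ false
    Au-Q k = trans (Au1 (inj₂ k)) (≢⇒==-false (P≢Q {j} {k}))

    remove-absent : mem₂ (inj₂ u) ≡ false → ∀ i → potential M A x i ≡ suc (potential M′ A′ x i)
    remove-absent m2u i = trans (cong₂ (λ a b → i + sumA M A + a + b / 2 + 2 * sumF M A x) sumBCD≡ sumE≡)
                      (trans (cong (λ b → i + sumA M A + sumBCD M′ A′ x + sumE M′ A′ x / 2 + 2 * b) sumF≡)
                         (dec-A i (sumBCD M′ A′ x) (sumE M′ A′ x / 2) (2 * sumF M′ A′ x) sumA≡))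
      where
      yu : inY M A u ≡ false
      yu = inY-falseʳ {u} m2u
      yu′ : inY M′ A′ u ≡ false
      yu′ = R′.inY-falseʳ {u} m2u
      termA-u≡ : termA M A u ≡ 1
      termA-u≡ = trans (termA-N yu) (trans (cardA-T Mu) (trans (card-cong p (λ i → Au1 (inj₁ i))) (card-singleton j)))
      r2u′ : termA M′ A′ u ≡ 0
      r2u′ = trans (R′.termA-N yu′) (R′.cardA-FF Mu′ m2u)
      sumA≡ : sumA M A ≡ suc (sumA M′ A′)
      sumA≡ = cancel-suc _ _ 0 (trans (cong (sumA M A +_) (sym r2u′)) (trans (Σ-update q u (termA M A) (termA M′ A′) termA-off) (cong (sumA M′ A′ +_) termA-u≡)))
      dPu : ∀ k → inD M A k u ≡ inD M′ A′ k u
      dPu k = trans (∧-falseʳ _ e1) (sym (∧-falseʳ _ e2))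
        where
        e1 : (A (inj₂ u) (inj₂ k) ∨ above₂ (inj₂ u) (inj₂ k)) ≡ false
        e1 rewrite Au-Q k | above-absent₁ h2 (inj₂ u) (inj₂ k) m2u = refl
        e2 : (A′ (inj₂ u) (inj₂ k) ∨ above₂ (inj₂ u) (inj₂ k)) ≡ false
        e2 rewrite A′u1 (inj₂ k) | above-absent₁ h2 (inj₂ u) (inj₂ k) m2u = refl
      sumBCD≡ : sumBCD M A x ≡ sumBCD M′ A′ x
      sumBCD≡ = Σ-cong-at q u (termBCD M A x) (termBCD M′ A′ x)
              (λ k n → termBCD-cong {x = x} {x} k (hM _ (Q≢ n)) (cardB-off k n) (cardC-off k n)
                         (cardD-cong k (λ v → dd k n v)) refl)
              (trans (termBCD-N x yu) (sym (R′.termBCD-N x yu′)))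
        where
        dd : ∀ k → k ≢ u → ∀ v → inD M A k v ≡ inD M′ A′ k v
        dd k n v with v F.≟ u
        ... | yes refl = dPu k
        ... | no m = inD-off k v n m
      sumE≡ : sumE M A x ≡ sumE M′ A′ x
      sumE≡ = Σ-cong-at q u (rowE M A x) (rowE M′ A′ x)
              (λ k n → rowE-off k n (trans (termE-F x (∧-falseˡ _ yu)) (sym (R′.termE-F x (∧-falseˡ _ yu′)))))
              (trans (rowE-N x yu) (sym (R′.rowE-N x yu′)))
      sumF≡ : sumF M A x ≡ sumF M′ A′ x
      sumF≡ = Σ-cong-at q u (rowF M A x) (rowF M′ A′ x)
              (λ k n → rowF-off k n (trans (termF-F x (∧-falseˡ _ yu)) (sym (R′.termF-F x (∧-falseˡ _ yu′)))))
              (trans (rowF-N x yu) (sym (R′.rowF-N x yu′)))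


    module RemoveMarked (m2u : mem₂ (inj₂ u) ≡ true) (xu : x u ≡ true) (MP : ∀ i → M (inj₁ i) ≡ true) (exb : ExactlyOneAbove h2 (inj₂ u) (inj₁ j)) where
      yu : inY M A u ≡ true
      yu = inY-true {u} Mu m2u
      yu′ : inY M′ A′ u ≡ false
      yu′ = R′.inY-falseˡ {u} Mu′

      -- Making u a leaf adds L = |A_u| to the A-sum; each kept v ∈ Y below u in h₂ (counted by K)
      -- gains u in D_v, and the row of u in the E-sum, worth 2K, disappears.
      κ : Fin q → ℕ
      κ v = if inY M′ A′ v then b2n (above₂ (inj₂ u) (inj₂ v)) * (1 ∸ b2n (x v)) else 0
      K : ℕ
      K = Σ[< q ] κ
      L : ℕ
      L = card p (λ i → above₂ (inj₂ u) (inj₁ i))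

      sumA≡ : sumA M A + L ≡ sumA M′ A′
      sumA≡ = trans (cong (sumA M A +_) (sym (trans (R′.termA-N yu′) (R′.cardA-FT Mu′ m2u))))
              (trans (Σ-update q u (termA M A) (termA M′ A′) termA-off) (trans (cong (sumA M′ A′ +_) (termA-Y yu)) (+-identityʳ _)))

      BC : cardB M A u + 2 * cardC M A u ≡ suc L
      BC = trans (cong₂ _+_ (card-Σ p _) (cong (2 *_) (card-Σ p _)))
             (trans (cong (Σ[< p ] (λ i → b2n (split M A (inj₁ i) (inj₂ u))) +_) (cong (Σ[< p ] (λ i → b2n (A (inj₂ u) (inj₁ i) ∧ above₂ (inj₂ u) (inj₁ i))) +_) (+-identityʳ _)))
             (trans (cong (Σ[< p ] (λ i → b2n (split M A (inj₁ i) (inj₂ u))) +_) (sym (Σ-+ p _ _)))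
             (trans (sym (Σ-+ p _ _))
             (trans (Σ-cong p pt)
             (trans (Σ-+ p _ _) (trans (cong₂ _+_ (sym (card-Σ p _)) (trans (sym (card-Σ p _)) (card-singleton j))) (+-comm L 1)))))))
        where
        pt : ∀ i → b2n (split M A (inj₁ i) (inj₂ u)) + (b2n (A (inj₂ u) (inj₁ i) ∧ above₂ (inj₂ u) (inj₁ i)) + b2n (A (inj₂ u) (inj₁ i) ∧ above₂ (inj₂ u) (inj₁ i)))
                   ≡ b2n (above₂ (inj₂ u) (inj₁ i)) + b2n (inj₁ j == inj₁ i)
        pt i with i F.≟ j
        ... | yes refl rewrite Au1 (inj₁ i) | ==-refl (inj₁ i) | Abu = ex exb
          where
          ex : ExactlyOneAbove h2 (inj₂ u) (inj₁ i) → b2n (above₂ (inj₁ i) (inj₂ u)) + (b2n (above₂ (inj₂ u) (inj₁ i)) + b2n (above₂ (inj₂ u) (inj₁ i))) ≡ b2n (above₂ (inj₂ u) (inj₁ i)) + 1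
          ex (inj₁ (a , b)) rewrite a | b = refl
          ex (inj₂ (a , b)) rewrite a | b = refl
        ... | no n rewrite Au1 (inj₁ i) | ≢⇒==-false {inj₁ j} {inj₁ i} (λ e → n (sym (inj₁-inj e)))
                         | Au2 (inj₁ i) (MP i) P≢Q (λ e → n (inj₁-inj e)) = cong (λ b → b2n b + 0) (∨-identityʳ _)

      termBCD-u≡ : termBCD M A x u ≡ suc L
      termBCD-u≡ = trans (termBCD-Y1 x yu xu) BC

      cDe-k : ∀ k → k ≢ u → cardD M A k + b2n (above₂ (inj₂ u) (inj₂ k)) ≡ cardD M′ A′ k
      cDe-k k n = trans (cong (λ b → cardD M A k + b2n b) (sym dPu′)) (trans (card-update q u (inD M A k) (inD M′ A′ k) (λ v m → inD-off k v n m))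
                  (trans (cong (λ b → cardD M′ A′ k + b2n b) dPu) (+-identityʳ _)))
        where
        dPu′ : inD M′ A′ k u ≡ above₂ (inj₂ u) (inj₂ k)
        dPu′ rewrite yu′ | A′u1 (inj₂ k) = refl
        dPu : inD M A k u ≡ false
        dPu rewrite yu = refl

      sumBCD≡ : sumBCD M A x + K ≡ sumBCD M′ A′ x + suc L
      sumBCD≡ = trans (Σ-balance q (termBCD M A x) κ (termBCD M′ A′ x) (single u (suc L)) pt) (cong (sumBCD M′ A′ x +_) (Σ-single q u (suc L)))
        where
        pt : ∀ k → termBCD M A x k + κ k ≡ termBCD M′ A′ x k + single u (suc L) k
        pt k with k F.≟ u
        ... | yes refl rewrite termBCD-u≡ | R′.termBCD-N x yu′ | if-false {m = b2n (above₂ (inj₂ k) (inj₂ k)) * (1 ∸ b2n (x k))} {n = 0} yu′ = +-identityʳ _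
        ... | no n with inY M A k in ey
        ...   | false rewrite R′.termBCD-N x (trans (sym (inY-off k n)) ey) | if-false {m = b2n (above₂ (inj₂ u) (inj₂ k)) * (1 ∸ b2n (x k))} {n = 0} (trans (sym (inY-off k n)) ey) = refl
        ...   | true rewrite R′.termBCD-Y x (trans (sym (inY-off k n)) ey) | if-true {m = b2n (above₂ (inj₂ u) (inj₂ k)) * (1 ∸ b2n (x k))} {n = 0} (trans (sym (inY-off k n)) ey)
                         | cardB-off k n | cardC-off k n | sym (cDe-k k n) | +-identityʳ (cardB M′ A′ k + 2 * cardC M′ A′ k * b2n (x k) + (cardD M A k + b2n (above₂ (inj₂ u) (inj₂ k))) * (1 ∸ b2n (x k))) =
                    solve 5 (λ b c d a t → b :+ c :+ d :* t :+ a :* t := b :+ c :+ (d :+ a) :* t) refl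
                      (cardB M′ A′ k) (2 * cardC M′ A′ k * b2n (x k)) (cardD M A k) (b2n (above₂ (inj₂ u) (inj₂ k))) (1 ∸ b2n (x k))

      e4uv-ne : ∀ v → v ≢ u → termE M A x u v ≡ κ v + κ v
      e4uv-ne v n = cases (inY M A v) refl
        where
        cases : ∀ b → inY M A v ≡ b → termE M A x u v ≡ κ v + κ v
        cases false ey = trans (termE-F x (∧-falseˡ _ ey)) (sym (cong₂ _+_ κ0 κ0))
          where
          κ0 : κ v ≡ 0
          κ0 = if-false (trans (sym (inY-off v n)) ey)
        cases true ey = trans fin (sym (cong₂ _+_ κ1 κ1))
          where
          κ1 : κ v ≡ b2n (above₂ (inj₂ u) (inj₂ v)) * (1 ∸ b2n (x v))
          κ1 = if-true (trans (sym (inY-off v n)) ey)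
          Mv : M (inj₂ v) ≡ true
          Mv = ∧-trueˡ (M (inj₂ v)) ey
          ie : inE M A u v ≡ above₂ (inj₂ u) (inj₂ v)
          ie rewrite ey | Au2 (inj₂ v) Mv (Q≢ n) (λ ()) | Au-Q v = ∨-identityʳ _
          fin′ : ∀ b → inE M A u v ≡ b → termE M A x u v ≡ b2n b * (1 ∸ b2n (x v)) + b2n b * (1 ∸ b2n (x v))
          fin′ false e = termE-F x e
          fin′ true e rewrite termE-T x e | xu with x v
          ... | true = refl
          ... | false = refl
          fin : termE M A x u v ≡ b2n (above₂ (inj₂ u) (inj₂ v)) * (1 ∸ b2n (x v)) + b2n (above₂ (inj₂ u) (inj₂ v)) * (1 ∸ b2n (x v))
          fin = fin′ _ ie

      e4uv : ∀ v → termE M A x u v ≡ κ v + κ v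
      e4uv v with v F.≟ u
      ... | yes refl = trans (termE-F x not-in-E) (sym (cong₂ _+_ κ0 κ0))
        where
        not-in-E : inE M A v v ≡ false
        not-in-E rewrite Au1 (inj₂ v) | ≢⇒==-false (P≢Q {j} {v}) = ∧-falseʳ _ refl
        κ0 : κ v ≡ 0
        κ0 = if-false yu′
      ... | no n = e4uv-ne v n

      sumE≡ : sumE M A x ≡ sumE M′ A′ x + (K + K)
      sumE≡ = trans (sym (+-identityʳ _)) (trans (cong (sumE M A x +_) (sym (R′.rowE-N x yu′)))
              (trans (Σ-update q u (rowE M A x) (rowE M′ A′ x) (λ k n → rowE-off k n (e4ku k n)))
                (cong (sumE M′ A′ x +_) (trans (rowE-Y x yu) (trans (Σ-cong q e4uv) (Σ-+ q κ κ))))))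
        where
        e4ku : ∀ k → k ≢ u → termE M A x k u ≡ termE M′ A′ x k u
        e4ku k n = trans z (sym (R′.termE-F x (∧-falseˡ _ yu′)))
          where
          z : termE M A x k u ≡ 0
          z with inE M A k u
          ... | false = refl
          ... | true rewrite xu = *-zeroʳ (1 + b2n (x k))

      sumF≡ : sumF M A x ≡ sumF M′ A′ x
      sumF≡ = Σ-cong-at q u (rowF M A x) (rowF M′ A′ x) (λ k n → rowF-off k n (e5ku k n))
              (trans (rowF-Y x yu) (trans (Σ-zero q _ (λ v → termF-F x (∧-falseʳ (inY M A v) (∧-falseˡ (above₂ (inj₂ u) (inj₂ v)) (Au-Q v))))) (sym (R′.rowF-N x yu′))))
        where
        e5ku : ∀ k → k ≢ u → termF M A x k u ≡ termF M′ A′ x k u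
        e5ku k n = trans z (sym (R′.termF-F x (∧-falseˡ _ yu′)))
          where
          z : termF M A x k u ≡ 0
          z with inF M A k u
          ... | false = refl
          ... | true rewrite xu = *-zeroʳ (b2n (x k))

      remove-marked : ∀ i → potential M A x i ≡ suc (potential M′ A′ x i)
      remove-marked i = trans (cong₂ (λ a b → i + sumA M A + sumBCD M A x + a / 2 + 2 * b) sumE≡ sumF≡)
                    (trans (trade-A-BCD-E i (sumA M A) (sumBCD M A x) (sumBCD M′ A′ x) (sumE M′ A′ x) L K (2 * sumF M′ A′ x) sumBCD≡)
                      (cong (λ a → suc (i + a + sumBCD M′ A′ x + sumE M′ A′ x / 2 + 2 * sumF M′ A′ x)) sumA≡))

  -- M, A describe xs ++ j ∷ [] and M′, A′ the handle xs ++ w ∷ j ∷ [] obtained by inserting the leaf w.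
  module Insertion (h2 : Handle) (M M′ : Vertex → Bool) (A A′ : Vertex → Vertex → Bool) (x x′ : Fin q → Bool) (w : Fin q) (j : Fin p)
    (hx : ∀ v → v ≢ w → x′ v ≡ x v) (xw′ : x′ w ≡ false)
    (hM : ∀ c → c ≢ inj₂ w → M′ c ≡ M c)
    (hA : ∀ c d → c ≢ inj₂ w → d ≢ inj₂ w → A′ c d ≡ A c d)
    (Mw : M (inj₂ w) ≡ false) (Mw′ : M′ (inj₂ w) ≡ true)
    (Aw1 : ∀ d → A (inj₂ w) d ≡ false)
    (A′w1 : ∀ d → A′ (inj₂ w) d ≡ (inj₁ j == d))
    (A′w2 : ∀ c → M′ c ≡ true → c ≢ inj₂ w → c ≢ inj₁ j → A′ c (inj₂ w) ≡ true)
    (A′bw : A′ (inj₁ j) (inj₂ w) ≡ false)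
    (A′mem : ∀ c d → A′ c d ≡ true → M′ c ≡ true)
    (MP : ∀ i → M (inj₁ i) ≡ true)
    (noR : ∀ v → M (inj₂ v) ≡ true → Potential.mem₂ h2 (inj₂ v) ≡ true)
    (x0 : ∀ v → Potential.inY h2 M A v ≡ true → x v ≡ false)
    (m2w : Potential.mem₂ h2 (inj₂ w) ≡ true)
    (a2bw : above h2 (inj₁ j) (inj₂ w) ≡ false) (a2wb : above h2 (inj₂ w) (inj₁ j) ≡ true)
    (abv-in : ∀ c → above h2 c (inj₂ w) ≡ true → M c ≡ true) where
    open Potential h2
    open PotentialCong h2 M′ M A′ A
    open RemovalCong h2 M′ M A′ A w x′ x hx hM hA
    open Unfold h2 M A
    private
      module R′ = Unfold h2 M′ A′

    yw : inY M A w ≡ false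
    yw = inY-falseˡ {w} Mw
    yw′ : inY M′ A′ w ≡ true
    yw′ = R′.inY-true {w} Mw′ m2w

    -- Inserting w removes L = |A_w| from the A-sum; each v ∈ Y below w in h₂ (counted by Λ)
    -- loses w from D_v, and w and v enter each other's E-sets, adding 2Λ to the E-sum.
    lam : Fin q → ℕ
    lam k = if inY M A k then b2n (above₂ (inj₂ w) (inj₂ k)) else 0
    Λ : ℕ
    Λ = Σ[< q ] lam
    L : ℕ
    L = card p (λ i → above₂ (inj₂ w) (inj₁ i))

    A′w-Q : ∀ k → A′ (inj₂ w) (inj₂ k) ≡ false
    A′w-Q k = trans (A′w1 (inj₂ k)) (≢⇒==-false (P≢Q {j} {k}))

    A′kw : ∀ k → inY M A k ≡ true → k ≢ w → A′ (inj₂ k) (inj₂ w) ≡ true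
    A′kw k ey n = A′w2 (inj₂ k) (trans (hM _ (Q≢ n)) (∧-trueˡ _ ey)) (Q≢ n) (λ ())

    iYk : ∀ k → k ≢ w → inY M′ A′ k ≡ inY M A k
    iYk k n = inY-off k n

    sumA≡ : sumA M A ≡ sumA M′ A′ + L
    sumA≡ = trans (sym (+-identityʳ _)) (trans (cong (sumA M A +_) (sym (R′.termA-Y yw′)))
            (trans (Σ-update q w (termA M A) (termA M′ A′) (λ k n → sym (termA-off k n))) (cong (sumA M′ A′ +_) (trans (termA-N yw) (cardA-FT Mw m2w)))))

    cardB-w≡ : cardB M′ A′ w + 1 ≡ L
    cardB-w≡ = trans (cong (cardB M′ A′ w +_) (sym (card-singleton j))) (trans (cong₂ _+_ (card-Σ p _) (card-Σ p _))
            (trans (sym (Σ-+ p _ _)) (trans (Σ-cong p pt) (sym (card-Σ p _)))))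
      where
      pt : ∀ i → b2n (split M′ A′ (inj₁ i) (inj₂ w)) + b2n (inj₁ j == inj₁ i) ≡ b2n (above₂ (inj₂ w) (inj₁ i))
      pt i with i F.≟ j
      ... | yes refl rewrite A′bw | A′w1 (inj₁ i) | ==-refl (inj₁ i) | a2bw | a2wb = refl
      ... | no n rewrite A′w1 (inj₁ i) | ≢⇒==-false {inj₁ j} {inj₁ i} (λ e → n (sym (inj₁-inj e)))
                       | A′w2 (inj₁ i) (trans (hM _ P≢Q) (MP i)) P≢Q (λ e → n (inj₁-inj e)) = trans (+-identityʳ _) (cong b2n (∨-identityʳ _))

    cardD-w≡ : cardD M′ A′ w ≡ 0
    cardD-w≡ = card-zero q (inD M′ A′ w) pt
      where
      pt : ∀ v → inD M′ A′ w v ≡ false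
      pt v = go (inY M′ A′ v) refl
        where
        go : ∀ b → inY M′ A′ v ≡ b → inD M′ A′ w v ≡ false
        go true e = ∧-falseˡ _ (cong not e)
        go false e = ∧-falseʳ _ (orF (A′ (inj₂ v) (inj₂ w)) refl (above₂ (inj₂ v) (inj₂ w)) refl)
          where
          mv : M (inj₂ v) ≡ true → ⊥
          mv mq with v F.≟ w
          ... | yes refl = true≢false (trans (sym mq) Mw)
          ... | no n = true≢false (trans (sym (R′.inY-true {v} (trans (hM _ (Q≢ n)) mq) (noR v mq))) e)
          orF : ∀ b1 → A′ (inj₂ v) (inj₂ w) ≡ b1 → ∀ b2 → above₂ (inj₂ v) (inj₂ w) ≡ b2 → (b1 ∨ b2) ≡ false
          orF false _ false _ = refl
          orF false _ true e2 = ⊥-elim (mv (abv-in _ e2))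
          orF true e1 _ _ with v F.≟ w
          ... | yes refl = ⊥-elim (true≢false (trans (sym e1) (A′w-Q v)))
          ... | no n = ⊥-elim (mv (trans (sym (hM _ (Q≢ n))) (A′mem _ _ e1)))

    r3w′ : termBCD M′ A′ x′ w + 1 ≡ L
    r3w′ = trans (cong (_+ 1) (trans (R′.termBCD-Y0 x′ yw′ xw′) (trans (cong (cardB M′ A′ w +_) cardD-w≡) (+-identityʳ _)))) cardB-w≡

    cDe-k : ∀ k → k ≢ w → cardD M A k ≡ cardD M′ A′ k + b2n (above₂ (inj₂ w) (inj₂ k))
    cDe-k k n = trans (sym (+-identityʳ _)) (trans (cong (cardD M A k +_) (sym dP1))
                   (trans (card-update q w (inD M A k) (inD M′ A′ k) (λ v m → sym (inD-off k v n m))) (cong (λ b → cardD M′ A′ k + b2n b) dP2)))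
      where
      dP1 : b2n (inD M′ A′ k w) ≡ 0
      dP1 rewrite yw′ = refl
      dP2 : inD M A k w ≡ above₂ (inj₂ w) (inj₂ k)
      dP2 rewrite yw | Aw1 (inj₂ k) = refl

    sumBCD≡ : sumBCD M A x + L ≡ sumBCD M′ A′ x′ + (Λ + 1)
    sumBCD≡ = trans (cong (sumBCD M A x +_) (sym (Σ-single q w L)))
            (trans (Σ-balance q (termBCD M A x) (single w L) (termBCD M′ A′ x′) (λ k → lam k + single w 1 k) pt)
               (cong (sumBCD M′ A′ x′ +_) (trans (Σ-+ q lam (single w 1)) (cong (Λ +_) (Σ-single q w 1)))))
      where
      pt : ∀ k → termBCD M A x k + single w L k ≡ termBCD M′ A′ x′ k + (lam k + single w 1 k)
      pt k with k F.≟ w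
      ... | yes refl rewrite termBCD-N x yw | if-false {m = b2n (above₂ (inj₂ k) (inj₂ k))} {n = 0} yw = sym r3w′
      ... | no n = go (inY M A k) refl
        where
        go : ∀ b → inY M A k ≡ b → termBCD M A x k + 0 ≡ termBCD M′ A′ x′ k + (lam k + 0)
        go false e rewrite termBCD-N x e | R′.termBCD-N x′ (trans (iYk k n) e) | if-false {m = b2n (above₂ (inj₂ w) (inj₂ k))} {n = 0} e = refl
        go true e rewrite termBCD-Y0 x e (x0 k e) | R′.termBCD-Y0 x′ (trans (iYk k n) e) (trans (hx k n) (x0 k e))
                        | if-true {m = b2n (above₂ (inj₂ w) (inj₂ k))} {n = 0} e | cardB-off k n
                        | +-identityʳ (cardB M A k + cardD M A k) | +-identityʳ (b2n (above₂ (inj₂ w) (inj₂ k))) | cDe-k k n =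
            sym (+-assoc (cardB M A k) (cardD M′ A′ k) _)

    val1 : ∀ k → k ≢ w → inY M A k ≡ true → (1 + b2n (x′ w)) * (1 ∸ b2n (x′ k)) ≡ 1
    val1 k n e rewrite xw′ | hx k n | x0 k e = refl
    val1′ : ∀ k → k ≢ w → inY M A k ≡ true → (1 + b2n (x′ k)) * (1 ∸ b2n (x′ w)) ≡ 1
    val1′ k n e rewrite xw′ | hx k n | x0 k e = refl

    e4w : ∀ v → termE M′ A′ x′ w v ≡ lam v
    e4w v with v F.≟ w
    ... | yes refl rewrite if-false {m = b2n (above₂ (inj₂ v) (inj₂ v))} {n = 0} yw = R′.termE-F x′ not-in-E
      where
      not-in-E : inE M′ A′ v v ≡ false
      not-in-E rewrite A′w-Q v = ∧-falseʳ _ refl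
    ... | no n = go (inY M A v) refl
      where
      go : ∀ b → inY M A v ≡ b → termE M′ A′ x′ w v ≡ lam v
      go false e = trans (R′.termE-F x′ (∧-falseˡ _ (trans (iYk v n) e))) (sym (if-false e))
      go true e = trans (fin (above₂ (inj₂ w) (inj₂ v)) refl) (sym (if-true e))
        where
        ie : inE M′ A′ w v ≡ above₂ (inj₂ w) (inj₂ v)
        ie rewrite trans (iYk v n) e | A′kw v e n | A′w-Q v = ∨-identityʳ _
        fin : ∀ b → above₂ (inj₂ w) (inj₂ v) ≡ b → termE M′ A′ x′ w v ≡ b2n (above₂ (inj₂ w) (inj₂ v))
        fin false eb = trans (R′.termE-F x′ (trans ie eb)) (cong b2n (sym eb))
        fin true eb = trans (R′.termE-T x′ (trans ie eb)) (trans (val1 v n e) (cong b2n (sym eb)))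

    sumE≡ : sumE M A x + (Λ + Λ) ≡ sumE M′ A′ x′
    sumE≡ = trans (cong (sumE M A x +_) (cong (Λ +_) (sym (Σ-single q w Λ))))
            (trans (cong (sumE M A x +_) (sym (Σ-+ q lam (single w Λ))))
            (trans (Σ-balance q (rowE M A x) (λ k → lam k + single w Λ k) (rowE M′ A′ x′) (λ _ → 0) pt)
               (trans (cong (sumE M′ A′ x′ +_) (Σ-zero q _ (λ _ → refl))) (+-identityʳ _))))
      where
      pt : ∀ k → rowE M A x k + (lam k + single w Λ k) ≡ rowE M′ A′ x′ k + 0
      pt k with k F.≟ w
      ... | yes refl rewrite rowE-N x yw | if-false {m = b2n (above₂ (inj₂ k) (inj₂ k))} {n = 0} yw | R′.rowE-Y x′ yw′ | Σ-cong q e4w = sym (+-identityʳ _)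
      ... | no n = go (inY M A k) refl
        where
        go : ∀ b → inY M A k ≡ b → rowE M A x k + (lam k + 0) ≡ rowE M′ A′ x′ k + 0
        go false e rewrite rowE-N x e | R′.rowE-N x′ (trans (iYk k n) e) | if-false {m = b2n (above₂ (inj₂ w) (inj₂ k))} {n = 0} e = refl
        go true e rewrite rowE-Y x e | R′.rowE-Y x′ (trans (iYk k n) e) | if-true {m = b2n (above₂ (inj₂ w) (inj₂ k))} {n = 0} e
                        | +-identityʳ (b2n (above₂ (inj₂ w) (inj₂ k))) | +-identityʳ (Σ[< q ] (termE M′ A′ x′ k)) =
            trans (cong (Σ[< q ] (termE M A x k) +_) (sym ekw′)) (trans (sym (Σ-update q w (termE M′ A′ x′ k) (termE M A x k) (λ v m → termE-off k v n m)))
              (trans (cong (Σ[< q ] (termE M′ A′ x′ k) +_) ekw) (+-identityʳ _)))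
          where
          ekw : termE M A x k w ≡ 0
          ekw = termE-F x (∧-falseˡ _ yw)
          ie : inE M′ A′ k w ≡ above₂ (inj₂ w) (inj₂ k)
          ie rewrite yw′ | A′kw k e n | A′w-Q k = refl
          ekw′ : termE M′ A′ x′ k w ≡ b2n (above₂ (inj₂ w) (inj₂ k))
          ekw′ = fin (above₂ (inj₂ w) (inj₂ k)) refl
            where
            fin : ∀ b → above₂ (inj₂ w) (inj₂ k) ≡ b → termE M′ A′ x′ k w ≡ b2n (above₂ (inj₂ w) (inj₂ k))
            fin false eb = trans (R′.termE-F x′ (trans ie eb)) (cong b2n (sym eb))
            fin true eb = trans (R′.termE-T x′ (trans ie eb)) (trans (val1′ k n e) (cong b2n (sym eb)))

    sumF≡ : sumF M A x ≡ sumF M′ A′ x′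
    sumF≡ = sym (Σ-cong-at q w (rowF M′ A′ x′) (rowF M A x) (λ k n → rowF-off k n (ent k n))
            (trans (R′.rowF-Y x′ yw′) (trans (Σ-zero q _ (λ v → R′.termF-F x′ (∧-falseʳ (inY M′ A′ v) (∧-falseˡ (above₂ (inj₂ w) (inj₂ v)) (A′w-Q v))))) (sym (rowF-N x yw)))))
      where
      ent : ∀ k → k ≢ w → termF M′ A′ x′ k w ≡ termF M A x k w
      ent k n = trans (go (A′ (inj₂ k) (inj₂ w)) refl) (sym (termF-F x (∧-falseˡ _ yw)))
        where
        go : ∀ b → A′ (inj₂ k) (inj₂ w) ≡ b → termF M′ A′ x′ k w ≡ 0
        go false eb = R′.termF-F x′ (∧-falseʳ (inY M′ A′ w) (∧-falseˡ (above₂ (inj₂ k) (inj₂ w)) eb))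
        go true eb with inF M′ A′ k w
        ... | false = refl
        ... | true rewrite hx k n | x0 k (inY-true {k} (trans (sym (hM _ (Q≢ n))) (A′mem _ _ eb)) (noR k (trans (sym (hM _ (Q≢ n))) (A′mem _ _ eb)))) = refl

    insert-kept : ∀ i → potential M A x i ≡ suc (potential M′ A′ x′ i)
    insert-kept i = trans (cong₂ (λ a b → i + a + sumBCD M A x + sumE M A x / 2 + 2 * b) sumA≡ sumF≡)
                 (trans (trade-A-BCD-E′ i (sumA M′ A′) (sumBCD M A x) (sumBCD M′ A′ x′) (sumE M A x) L Λ (2 * sumF M′ A′ x′) sumBCD≡)
                   (cong (λ a → suc (i + sumA M′ A′ + sumBCD M′ A′ x′ + a / 2 + 2 * sumF M′ A′ x′)) sumE≡))

  -- Inversions of σ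

  transpose : ℕ → ℕ → ℕ
  transpose zero zero = 1
  transpose zero (suc zero) = 0
  transpose zero (suc (suc n)) = suc (suc n)
  transpose (suc m) zero = zero
  transpose (suc m) (suc n) = suc (transpose m n)

  countBelow : ℕ → List ℕ → ℕ
  countBelow y [] = 0
  countBelow y (b ∷ l) = b2n (b <ᵇ y) + countBelow y l

  countEq : ℕ → List ℕ → ℕ
  countEq y [] = 0
  countEq y (b ∷ l) = b2n (b ≡ᵇ y) + countEq y l

  ascents : ℕ → List ℕ → ℕ
  ascents m [] = 0
  ascents m (y ∷ l) = (if y ≡ᵇ m then countEq (suc m) l else 0) + ascents m l

  descents : ℕ → List ℕ → ℕ
  descents m [] = 0
  descents m (y ∷ l) = (if y ≡ᵇ suc m then countEq m l else 0) + descents m l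

  length-filter-< : ∀ y l → length (filter (λ b → b <? y) l) ≡ countBelow y l
  length-filter-< y [] = refl
  length-filter-< y (b ∷ l) with b <ᵇ y
  ... | true = cong suc (length-filter-< y l)
  ... | false = length-filter-< y l

  invList-∷ : ∀ a as → invList (a ∷ as) ≡ countBelow a as + invList as
  invList-∷ a as = cong (_+ invList as) (length-filter-< a as)

  transpose-<ᵇ : ∀ m b y → b2n (transpose m b <ᵇ transpose m y) + (if y ≡ᵇ suc m then b2n (b ≡ᵇ m) else 0) ≡ b2n (b <ᵇ y) + (if y ≡ᵇ m then b2n (b ≡ᵇ suc m) else 0)
  transpose-<ᵇ zero zero zero = refl
  transpose-<ᵇ zero zero (suc zero) = refl
  transpose-<ᵇ zero zero (suc (suc y)) = refl
  transpose-<ᵇ zero (suc zero) zero = refl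
  transpose-<ᵇ zero (suc zero) (suc zero) = refl
  transpose-<ᵇ zero (suc zero) (suc (suc y)) = refl
  transpose-<ᵇ zero (suc (suc b)) zero = refl
  transpose-<ᵇ zero (suc (suc b)) (suc zero) = refl
  transpose-<ᵇ zero (suc (suc b)) (suc (suc y)) = refl
  transpose-<ᵇ (suc m) zero zero = refl
  transpose-<ᵇ (suc m) zero (suc y) rewrite if-eta (y ≡ᵇ suc m) {0} | if-eta (y ≡ᵇ m) {0} = refl
  transpose-<ᵇ (suc m) (suc b) zero = refl
  transpose-<ᵇ (suc m) (suc b) (suc y) = transpose-<ᵇ m b y

  countBelow-transpose : ∀ m y as → countBelow (transpose m y) (map (transpose m) as) + (if y ≡ᵇ suc m then countEq m as else 0)
                       ≡ countBelow y as + (if y ≡ᵇ m then countEq (suc m) as else 0)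
  countBelow-transpose m y [] rewrite if-eta (y ≡ᵇ suc m) {0} | if-eta (y ≡ᵇ m) {0} = refl
  countBelow-transpose m y (b ∷ as) = trans (cong ((b2n (transpose m b <ᵇ transpose m y) + countBelow (transpose m y) (map (transpose m) as)) +_) (dist (y ≡ᵇ suc m) (b2n (b ≡ᵇ m)) (countEq m as)))
     (trans (+-interchange (b2n (transpose m b <ᵇ transpose m y)) (countBelow (transpose m y) (map (transpose m) as)) (if y ≡ᵇ suc m then b2n (b ≡ᵇ m) else 0) (if y ≡ᵇ suc m then countEq m as else 0))
     (trans (cong₂ _+_ (transpose-<ᵇ m b y) (countBelow-transpose m y as))
     (trans (sym (+-interchange (b2n (b <ᵇ y)) (countBelow y as) (if y ≡ᵇ m then b2n (b ≡ᵇ suc m) else 0) (if y ≡ᵇ m then countEq (suc m) as else 0)))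
     (cong ((b2n (b <ᵇ y) + countBelow y as) +_) (sym (dist (y ≡ᵇ m) (b2n (b ≡ᵇ suc m)) (countEq (suc m) as)))))))
    where
    dist : ∀ c a b → (if c then a + b else 0) ≡ (if c then a else 0) + (if c then b else 0)
    dist true a b = refl
    dist false a b = refl

  invList-transpose : ∀ m l → invList (map (transpose m) l) + descents m l ≡ invList l + ascents m l
  invList-transpose m [] = refl
  invList-transpose m (y ∷ l) rewrite invList-∷ (transpose m y) (map (transpose m) l) | invList-∷ y l =
    trans (+-interchange (countBelow (transpose m y) (map (transpose m) l)) (invList (map (transpose m) l)) (if y ≡ᵇ suc m then countEq m l else 0) (descents m l))
    (trans (cong₂ _+_ (countBelow-transpose m y l) (invList-transpose m l))
    (sym (+-interchange (countBelow y l) (invList l) (if y ≡ᵇ m then countEq (suc m) l else 0) (ascents m l))))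

  Pseq-++ : ∀ xs ys → Pseq (xs ++ ys) ≡ Pseq xs ++ Pseq ys
  Pseq-++ xs ys = filter-++ (λ v → T? (isP v)) xs ys

  mem-Pseq-P : ∀ (i : Fin p) h → mem (inj₁ i) (Pseq h) ≡ mem (inj₁ i) h
  mem-Pseq-P i [] = refl
  mem-Pseq-P i (inj₁ l ∷ h) = cong ((inj₁ l == inj₁ i) ∨_) (mem-Pseq-P i h)
  mem-Pseq-P i (inj₂ l ∷ h) rewrite ≢⇒==-false {inj₂ l} {inj₁ i} (λ ()) = mem-Pseq-P i h

  distinct-Pseq : ∀ h → Distinct h → Distinct (Pseq h)
  distinct-Pseq [] _ = tt
  distinct-Pseq (inj₁ l ∷ h) (n , u) = trans (mem-Pseq-P l h) n , distinct-Pseq h u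
  distinct-Pseq (inj₂ l ∷ h) (n , u) = distinct-Pseq h u

  above-Pseq : ∀ h (i k : Fin p) → above (Pseq h) (inj₁ i) (inj₁ k) ≡ above h (inj₁ i) (inj₁ k)
  above-Pseq [] i k = refl
  above-Pseq (inj₁ l ∷ h) i k with inj₁ l == inj₁ i
  ... | true = mem-Pseq-P k h
  ... | false = above-Pseq h i k
  above-Pseq (inj₂ l ∷ h) i k rewrite ≢⇒==-false {inj₂ l} {inj₁ i} (λ ()) = above-Pseq h i k

  posOf-swap : ∀ ps a b rs c → a ≢ b → posOf c (ps ++ a ∷ b ∷ rs) ≡ transpose (length ps) (posOf c (ps ++ b ∷ a ∷ rs))
  posOf-swap [] a b rs c a≢b with a ≟ c | b ≟ c
  ... | yes refl | yes refl = ⊥-elim (a≢b refl)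
  ... | yes refl | no _ = refl
  ... | no _ | yes refl = refl
  ... | no _ | no _ with posOf c rs
  ...   | zero = refl
  ...   | suc _ = refl
  posOf-swap (x ∷ ps) a b rs c a≢b with x == c
  ... | true = refl
  ... | false = cong suc (posOf-swap ps a b rs c a≢b)

  posOf-++ : ∀ ps r c → posOf c (ps ++ r) ≡ (if mem c ps then posOf c ps else length ps + posOf c r)
  posOf-++ [] r c = refl
  posOf-++ (x ∷ ps) r c with x == c
  ... | true = refl
  ... | false rewrite posOf-++ ps r c with mem c ps
  ...   | true = refl
  ...   | false = refl

  posOf-< : ∀ ps c → mem c ps ≡ true → posOf c ps < length ps
  posOf-< [] c ()
  posOf-< (x ∷ ps) c e with x == c
  ... | true = s≤s z≤n
  ... | false = s≤s (posOf-< ps c e)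

  ≡ᵇ-lt : ∀ n m → n < m → (n ≡ᵇ m) ≡ false
  ≡ᵇ-lt zero (suc m) _ = refl
  ≡ᵇ-lt (suc n) (suc m) (s≤s l) = ≡ᵇ-lt n m l

  ≡ᵇ-p0 : ∀ m n → ((m + n) ≡ᵇ m) ≡ (n ≡ᵇ 0)
  ≡ᵇ-p0 zero n = refl
  ≡ᵇ-p0 (suc m) n = ≡ᵇ-p0 m n

  ≡ᵇ-p1 : ∀ m n → ((m + n) ≡ᵇ suc m) ≡ (n ≡ᵇ 1)
  ≡ᵇ-p1 zero n = refl
  ≡ᵇ-p1 (suc m) n = ≡ᵇ-p1 m n

  module PosFacts (ps : Handle) (b a : Vertex) (rs : Handle) (U : Distinct (ps ++ b ∷ a ∷ rs)) where
    L′ : Handle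
    L′ = ps ++ b ∷ a ∷ rs
    m : ℕ
    m = length ps

    private
      bm = distinct-middle ps b (a ∷ rs) U
      am = distinct-middle (ps ++ [ b ]) a rs (subst Distinct (sym (++-assoc ps [ b ] (a ∷ rs))) U)
      b∉ps : mem b ps ≡ false
      b∉ps = proj₁ bm
      a∉ps : mem a ps ≡ false
      a∉ps = proj₁ (∨-false (trans (sym (mem-++ a ps [ b ])) (proj₁ am)))
      b≢a : b ≢ a
      b≢a e = true≢false (trans (sym (∨-true-l (mem b rs) (subst (λ z → (z == b) ≡ true) e (==-refl b)))) (proj₂ bm))
      ne-ps : ∀ c d → mem c ps ≡ true → mem d ps ≡ false → (c == d) ≡ false
      ne-ps c d mc md = ≢⇒==-false (λ e → true≢false (trans (sym mc) (subst (λ z → mem z ps ≡ false) (sym e) md)))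

    pos-m : ∀ c → (posOf c L′ ≡ᵇ m) ≡ (c == b)
    pos-m c rewrite posOf-++ ps (b ∷ a ∷ rs) c with mem c ps in mc
    ... | true rewrite ne-ps c b mc b∉ps = ≡ᵇ-lt _ _ (posOf-< ps c mc)
    ... | false rewrite ≡ᵇ-p0 m (posOf c (b ∷ a ∷ rs)) | ==-sym c b with b == c
    ...   | true = refl
    ...   | false = refl

    pos-m1 : ∀ c → (posOf c L′ ≡ᵇ suc m) ≡ (c == a)
    pos-m1 c rewrite posOf-++ ps (b ∷ a ∷ rs) c with mem c ps in mc
    ... | true rewrite ne-ps c a mc a∉ps = ≡ᵇ-lt _ _ (<-trans (posOf-< ps c mc) (n<1+n m))
    ... | false rewrite ≡ᵇ-p1 m (posOf c (b ∷ a ∷ rs)) | ==-sym c a with b ≟ c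
    ...   | yes refl rewrite ≢⇒==-false (λ (e : a ≡ b) → b≢a (sym e)) = refl
    ...   | no n with a == c
    ...     | true = refl
    ...     | false = refl

  countV : Vertex → Handle → ℕ
  countV b [] = 0
  countV b (c ∷ S) = b2n (c == b) + countV b S

  pairsV : Vertex → Vertex → Handle → ℕ
  pairsV a b [] = 0
  pairsV a b (c ∷ S) = (if c == a then countV b S else 0) + pairsV a b S

  countEq-map : ∀ S (g : Vertex → ℕ) k b → (∀ c → (g c ≡ᵇ k) ≡ (c == b)) → countEq k (map g S) ≡ countV b S
  countEq-map [] g k b h = refl
  countEq-map (c ∷ S) g k b h = cong₂ _+_ (cong b2n (h c)) (countEq-map S g k b h)

  ascents-map : ∀ S (g : Vertex → ℕ) m a b → (∀ c → (g c ≡ᵇ m) ≡ (c == a)) → (∀ c → (g c ≡ᵇ suc m) ≡ (c == b)) → ascents m (map g S) ≡ pairsV a b S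
  ascents-map [] g m a b ha hb = refl
  ascents-map (c ∷ S) g m a b ha hb rewrite ha c | countEq-map S g (suc m) b hb = cong (_ +_) (ascents-map S g m a b ha hb)

  descents-map : ∀ S (g : Vertex → ℕ) m a b → (∀ c → (g c ≡ᵇ m) ≡ (c == a)) → (∀ c → (g c ≡ᵇ suc m) ≡ (c == b)) → descents m (map g S) ≡ pairsV b a S
  descents-map [] g m a b ha hb = refl
  descents-map (c ∷ S) g m a b ha hb rewrite hb c | countEq-map S g m a ha = cong (_ +_) (descents-map S g m a b ha hb)

  countV-distinct : ∀ S b → Distinct S → countV b S ≡ b2n (mem b S)
  countV-distinct [] b _ = refl
  countV-distinct (c ∷ S) b (nc , u) with c ≟ b
  ... | yes refl rewrite countV-distinct S c u | nc = refl
  ... | no n = countV-distinct S b u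

  pairsV-distinct : ∀ S a b → Distinct S → pairsV a b S ≡ b2n (above S a b)
  pairsV-distinct [] a b _ = refl
  pairsV-distinct (c ∷ S) a b (nc , u) with c ≟ a
  ... | yes refl rewrite countV-distinct S b u | pairsV-distinct S c b u | above-absent₁ S c b nc = +-identityʳ _
  ... | no n = pairsV-distinct S a b u

  invList-swap-P : ∀ h2 xs (i k : Fin p) ys → Distinct (xs ++ inj₁ i ∷ inj₁ k ∷ ys) → Distinct h2 → above h2 (inj₁ k) (inj₁ i) ≡ true →
           invList (σ (xs ++ inj₁ i ∷ inj₁ k ∷ ys) h2) ≡ suc (invList (σ (xs ++ inj₁ k ∷ inj₁ i ∷ ys) h2))
  invList-swap-P h2 xs i k ys U U2 a2ki = goal
    where
    a = inj₁ i
    b = inj₁ k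
    ps = Pseq xs
    rs = Pseq ys
    S = Pseq h2
    e1 : Pseq (xs ++ a ∷ b ∷ ys) ≡ ps ++ a ∷ b ∷ rs
    e1 = Pseq-++ xs (a ∷ b ∷ ys)
    e2 : Pseq (xs ++ b ∷ a ∷ ys) ≡ ps ++ b ∷ a ∷ rs
    e2 = Pseq-++ xs (b ∷ a ∷ ys)
    U′ : Distinct (ps ++ b ∷ a ∷ rs)
    U′ = subst Distinct e2 (distinct-Pseq _ (SwapAt.distinct-swap xs a b ys U))
    a≢b : a ≢ b
    a≢b = SwapAt.u≢v xs a b ys U
    g′ : Vertex → ℕ
    g′ c = posOf c (ps ++ b ∷ a ∷ rs)
    open PosFacts ps b a rs U′ using (pos-m; pos-m1; m)
    s1 : σ (xs ++ a ∷ b ∷ ys) h2 ≡ map (transpose m) (map g′ S)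
    s1 = trans (cong (λ L → map (λ v → posOf v L) S) e1)
           (trans (map-cong (λ c → posOf-swap ps a b rs c a≢b) S) (map-∘ S))
    s2 : σ (xs ++ b ∷ a ∷ ys) h2 ≡ map g′ S
    s2 = cong (λ L → map (λ v → posOf v L) S) e2
    US : Distinct S
    US = distinct-Pseq h2 U2
    W1 : ascents m (map g′ S) ≡ 1
    W1 = trans (ascents-map S g′ m b a pos-m pos-m1) (trans (pairsV-distinct S b a US) (cong b2n (trans (above-Pseq h2 k i) a2ki)))
    Z0 : descents m (map g′ S) ≡ 0
    Z0 = trans (descents-map S g′ m b a pos-m pos-m1) (trans (pairsV-distinct S a b US) (cong b2n (trans (above-Pseq h2 i k) (above-asym h2 U2 b a a2ki))))
    goal : invList (σ (xs ++ a ∷ b ∷ ys) h2) ≡ suc (invList (σ (xs ++ b ∷ a ∷ ys) h2))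
    goal rewrite s1 | s2 = trans (sym (+-identityʳ _)) (trans (cong (invList (map (transpose m) (map g′ S)) +_) (sym Z0)) (trans (invList-transpose m (map g′ S))
             (trans (cong (invList (map g′ S) +_) W1) (+-comm _ 1))))

  Pseq-swap-Q : ∀ xs (u : Fin q) v ys → Pseq (xs ++ inj₂ u ∷ v ∷ ys) ≡ Pseq (xs ++ v ∷ inj₂ u ∷ ys)
  Pseq-swap-Q xs u (inj₁ i) ys = trans (Pseq-++ xs _) (sym (Pseq-++ xs _))
  Pseq-swap-Q xs u (inj₂ w) ys = trans (Pseq-++ xs _) (sym (Pseq-++ xs _))

  Pseq-swap-Q′ : ∀ xs v (u : Fin q) ys → Pseq (xs ++ v ∷ inj₂ u ∷ ys) ≡ Pseq (xs ++ inj₂ u ∷ v ∷ ys)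
  Pseq-swap-Q′ xs v u ys = sym (Pseq-swap-Q xs u v ys)

  Pseq-remove-Q : ∀ xs (u : Fin q) b → Pseq (xs ++ inj₂ u ∷ b ∷ []) ≡ Pseq (xs ++ b ∷ [])
  Pseq-remove-Q xs u b = trans (Pseq-++ xs _) (sym (Pseq-++ xs _))

  σ-cong : ∀ h h′ h2 → Pseq h ≡ Pseq h′ → σ h h2 ≡ σ h′ h2
  σ-cong h h′ h2 e = cong (λ L → map (λ v → posOf v L) (Pseq h2)) e

  invList-map-suc : ∀ l → invList (map suc l) ≡ invList l
  invList-map-suc [] = refl
  invList-map-suc (y ∷ l) rewrite invList-∷ (suc y) (map suc l) | invList-∷ y l | invList-map-suc l = cong (_+ invList l) (cs l)
    where
    cs : ∀ l → countBelow (suc y) (map suc l) ≡ countBelow y l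
    cs [] = refl
    cs (b ∷ l) = cong (b2n (b <ᵇ y) +_) (cs l)

  posOf-∷ : ∀ c L l → mem c l ≡ false → map (λ v → posOf v (c ∷ L)) l ≡ map (λ v → suc (posOf v L)) l
  posOf-∷ c L [] _ = refl
  posOf-∷ c L (d ∷ l) e with ∨-false {d == c} e
  ... | e1 , e2 rewrite ==-sym c d | e1 = cong (_ ∷_) (posOf-∷ c L l e2)

  countBelow-0 : ∀ l → countBelow 0 l ≡ 0
  countBelow-0 [] = refl
  countBelow-0 (b ∷ l) = countBelow-0 l

  invList-positions : ∀ L → Distinct L → invList (map (λ v → posOf v L) L) ≡ 0
  invList-positions [] _ = refl
  invList-positions (c ∷ L) (nc , u) rewrite ==-refl c | posOf-∷ c L L nc | invList-∷ 0 (map (λ v → suc (posOf v L)) L)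
    | countBelow-0 (map (λ v → suc (posOf v L)) L) | map-∘ {g = ℕ.suc} {f = λ v → posOf v L} L | invList-map-suc (map (λ v → posOf v L) L) = invList-positions L u

  σ-self : ∀ h → Distinct h → invList (σ h h) ≡ 0
  σ-self h u = invList-positions (Pseq h) (distinct-Pseq h u)

  module AtTarget (h2 : Handle) (U2 : Distinct h2) (x : Fin q → Bool)
    (xf : ∀ k → Potential.inY h2 (Potential.mem₂ h2) (above h2) k ≡ true → x k ≡ false) where
    open Potential h2
    open Unfold h2 mem₂ above₂

    private
      ∧-self-false : ∀ a → (a ∧ a) ≡ false → a ≡ false
      ∧-self-false false _ = refl
      ∧-self-false true ()
      split-false : ∀ c d → split mem₂ above₂ c d ≡ false
      split-false c d with above₂ c d in e
      ... | false with above₂ d c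
      ...   | false = refl
      ...   | true = refl
      split-false c d | true rewrite above-asym h2 U2 c d e = refl

    termA-zero : ∀ k → termA mem₂ above₂ k ≡ 0
    termA-zero k with inY mem₂ above₂ k in e
    ... | true = refl
    ... | false rewrite ∧-self-false (mem₂ (inj₂ k)) e = refl

    termBCD-zero : ∀ k → termBCD mem₂ above₂ x k ≡ 0
    termBCD-zero k with inY mem₂ above₂ k in e
    ... | false = refl
    ... | true = trans (sym (termBCD-Y x e)) (trans (termBCD-Y0 x e (xf k e)) (cong₂ _+_ (card-zero p _ (λ i → split-false (inj₁ i) (inj₂ k))) (card-zero q _ dz)))
      where
      dz : ∀ v → inD mem₂ above₂ k v ≡ false
      dz v with inY mem₂ above₂ v in ev
      ... | true = refl
      ... | false rewrite above-absent₁ h2 (inj₂ v) (inj₂ k) (∧-self-false (mem₂ (inj₂ v)) ev) = refl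

    rowE-zero : ∀ k → rowE mem₂ above₂ x k ≡ 0
    rowE-zero k with inY mem₂ above₂ k in e
    ... | false = refl
    ... | true = Σ-zero q _ (λ v → termE-F x (∧-falseʳ (inY mem₂ above₂ v) (split-false (inj₂ v) (inj₂ k))))

    rowF-zero : ∀ k → rowF mem₂ above₂ x k ≡ 0
    rowF-zero k with inY mem₂ above₂ k in e
    ... | false = refl
    ... | true rewrite xf k e = Σ-zero q _ (λ v → if-eta (inF mem₂ above₂ k v))

    potential-target : potential mem₂ above₂ x 0 ≡ 0
    potential-target rewrite Σ-zero q _ termA-zero | Σ-zero q _ termBCD-zero | Σ-zero q _ rowE-zero | Σ-zero q _ rowF-zero = refl

  -- The greedy sequence of rotations

  endsInP : Handle → Bool
  endsInP [] = false
  endsInP (c ∷ []) = isP c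
  endsInP (c ∷ d ∷ l) = endsInP (d ∷ l)

  endsInP-++ : ∀ xs c l → endsInP (xs ++ c ∷ l) ≡ endsInP (c ∷ l)
  endsInP-++ [] c l = refl
  endsInP-++ (x ∷ []) c l = refl
  endsInP-++ (x ∷ y ∷ xs) c l = endsInP-++ (y ∷ xs) c l

  endsInP⇒ : ∀ h → endsInP h ≡ true → Σ Handle λ zs → Σ (Fin p) λ t → h ≡ zs ++ [ inj₁ t ]
  endsInP⇒ [] ()
  endsInP⇒ (inj₁ t ∷ []) _ = [] , t , refl
  endsInP⇒ (inj₂ u ∷ []) ()
  endsInP⇒ (c ∷ d ∷ l) e with endsInP⇒ (d ∷ l) e
  ... | zs , t , eq = c ∷ zs , t , cong (c ∷_) eq

  Broom : Handle → Set
  Broom h = Distinct h × (∀ i → mem (inj₁ i) h ≡ true) × (endsInP h ≡ true)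

  IsBroom⇒Broom : ∀ h → IsBroom h → Broom h
  IsBroom⇒Broom h (u , allP , (xs , i , refl)) = Unique⇒Distinct h u , (λ j → ∈⇒mem h (allP j)) , endsInP-++ xs (inj₁ i) []

  Adjacent : (Vertex → Vertex → Set) → Handle → Set
  Adjacent R [] = ⊤
  Adjacent R (c ∷ []) = ⊤
  Adjacent R (c ∷ d ∷ l) = R c d × Adjacent R (d ∷ l)

  AdjacentNot : (Vertex → Vertex → Bool) → Handle → Set
  AdjacentNot g = Adjacent (λ c d → g c d ≡ false)

  data AdjacentSearch (g : Vertex → Vertex → Bool) (h : Handle) : Set where
    found : ∀ xs a b ys → h ≡ xs ++ a ∷ b ∷ ys → g a b ≡ true → AdjacentNot g (xs ++ [ a ]) → AdjacentSearch g h
    none  : AdjacentNot g h → AdjacentSearch g h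

  searchAdjacent : ∀ g h → AdjacentSearch g h
  searchAdjacent g [] = none tt
  searchAdjacent g (c ∷ []) = none tt
  searchAdjacent g (c ∷ d ∷ l) = step (g c d) refl (searchAdjacent g (d ∷ l))
    where
    step : ∀ b → g c d ≡ b → AdjacentSearch g (d ∷ l) → AdjacentSearch g (c ∷ d ∷ l)
    step true e _ = found [] c d l refl e tt
    step false e (none n) = none (e , n)
    step false e (found [] a b ys refl ga an) = found (c ∷ []) a b ys refl ga (e , tt)
    step false e (found (y ∷ xs) a b ys refl ga an) = found (c ∷ y ∷ xs) a b ys refl ga (e , an)

  data Search (g : Vertex → Bool) (h : Handle) : Set where
    found : ∀ l1 w l2 → h ≡ l1 ++ w ∷ l2 → g w ≡ true → (∀ c → mem c l1 ≡ true → g c ≡ false) → Search g h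
    none  : (∀ c → mem c h ≡ true → g c ≡ false) → Search g h

  search : ∀ g h → Search g h
  search g [] = none (λ c ())
  search g (c ∷ h) with g c in e
  ... | true = found [] c h refl e (λ _ ())
  ... | false with search g h
  ...   | found l1 w l2 refl gw hl = found (c ∷ l1) w l2 refl gw hl′
    where
    hl′ : ∀ d → mem d (c ∷ l1) ≡ true → g d ≡ false
    hl′ d m with c ≟ d
    ... | yes refl = e
    ... | no n = hl d m
  ...   | none hn = none hn′
    where
    hn′ : ∀ d → mem d (c ∷ h) ≡ true → g d ≡ false
    hn′ d m with c ≟ d
    ... | yes refl = e
    ... | no n = hn d m

  adjacent-propagate : ∀ (g : Vertex → Vertex → Bool) (R : Vertex → Bool) → (∀ c d → g c d ≡ false → R d ≡ false → R c ≡ false) →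
             ∀ l → endsInP l ≡ true → (∀ c → isP c ≡ true → R c ≡ false) → AdjacentNot g l → ∀ c → mem c l ≡ true → R c ≡ false
  adjacent-propagate g R hg [] () hP an c m
  adjacent-propagate g R hg (x ∷ []) lb hP an c m with x ≟ c
  ... | yes refl = hP x lb
  ... | no n = ⊥-elim (true≢false (sym m))
  adjacent-propagate g R hg (x ∷ y ∷ l) lb hP (gxy , an) = go (adjacent-propagate g R hg (y ∷ l) lb hP an)
    where
    go : (∀ c → mem c (y ∷ l) ≡ true → R c ≡ false) → ∀ c → mem c (x ∷ y ∷ l) ≡ true → R c ≡ false
    go ih c m with x ≟ c
    ... | yes refl = hg x y gxy (ih y (trans (cong (_∨ mem y l) (==-refl y)) refl))
    ... | no n = ih c m

  adjacent-above⇒above : ∀ h2 → Distinct h2 → ∀ l → Adjacent (λ c d → above h2 c d ≡ true) l → ∀ c d → above l c d ≡ true → above h2 c d ≡ true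
  adjacent-above⇒above h2 U2 [] _ c d ()
  adjacent-above⇒above h2 U2 (x ∷ []) ap c d e with x ≟ c
  ... | yes refl = ⊥-elim (true≢false (sym e))
  ... | no n = ⊥-elim (true≢false (sym e))
  adjacent-above⇒above h2 U2 (x ∷ y ∷ l) (axy , ap) = go (adjacent-above⇒above h2 U2 (y ∷ l) ap)
    where
    go : (∀ c d → above (y ∷ l) c d ≡ true → above h2 c d ≡ true) → ∀ c d → above (x ∷ y ∷ l) c d ≡ true → above h2 c d ≡ true
    go ih c d e with x ≟ c
    ... | no n = ih c d e
    ... | yes refl with y ≟ d
    ...   | yes refl = axy
    ...   | no n = above-trans h2 U2 x y d axy (ih y d (trans (cong (λ b → if b then mem d l else above l y d) (==-refl y)) e))

  adjnot⇒asc : ∀ h2 → Distinct h2 → ∀ l → Distinct l → (∀ c → mem c l ≡ true → mem c h2 ≡ true) →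
               AdjacentNot (λ c d → above h2 d c) l → Adjacent (λ c d → above h2 c d ≡ true) l
  adjnot⇒asc h2 U2 [] _ _ _ = tt
  adjnot⇒asc h2 U2 (x ∷ []) _ _ _ = tt
  adjnot⇒asc h2 U2 (x ∷ y ∷ l) (nx , u) hm (g , an) = xy , adjnot⇒asc h2 U2 (y ∷ l) u (λ c m → hm c (∨-true-r (x == c) m)) an
    where
    x≢y : x ≢ y
    x≢y e = true≢false (trans (sym (∨-true-l (mem x l) (subst (λ z → (y == z) ≡ true) (sym e) (==-refl y)))) nx)
    xy : above h2 x y ≡ true
    xy with above-total h2 U2 x y x≢y (hm x (∨-true-l _ (==-refl x))) (hm y (∨-true-r (x == y) (∨-true-l _ (==-refl y))))
    ... | inj₁ r = r
    ... | inj₂ r = ⊥-elim (true≢false (trans (sym r) g))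

  same-order⇒≡ : ∀ l1 l2 → Distinct l1 → Distinct l2 → (∀ c → mem c l1 ≡ mem c l2) → (∀ c d → above l1 c d ≡ true → above l2 c d ≡ true) → l1 ≡ l2
  same-order⇒≡ [] [] _ _ _ _ = refl
  same-order⇒≡ [] (y ∷ l2) _ _ hm _ = ⊥-elim (true≢false (trans (sym (∨-true-l (mem y l2) (==-refl y))) (sym (hm y))))
  same-order⇒≡ (x ∷ l1) [] _ _ hm _ = ⊥-elim (true≢false (trans (sym (∨-true-l (mem x l1) (==-refl x))) (hm x)))
  same-order⇒≡ (x ∷ l1) (y ∷ l2) (nx , u1) (ny , u2) hm ho with x ≟ y
  ... | yes refl = cong (x ∷_) (same-order⇒≡ l1 l2 u1 u2 hm′ ho′)
    where
    hm′ : ∀ c → mem c l1 ≡ mem c l2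
    hm′ c with x ≟ c
    ... | yes refl = trans nx (sym ny)
    ... | no n = trans (sym (cong (_∨ mem c l1) (≢⇒==-false n))) (trans (hm c) (cong (_∨ mem c l2) (≢⇒==-false n)))
    ho′ : ∀ c d → above l1 c d ≡ true → above l2 c d ≡ true
    ho′ c d e with x ≟ c
    ... | yes refl = ⊥-elim (true≢false (trans (sym (above⇒mem₁ l1 c d e)) nx))
    ... | no n = trans (sym (cong (λ b → if b then mem d l2 else above l2 c d) (≢⇒==-false n)))
                   (ho c d (trans (cong (λ b → if b then mem d l1 else above l1 c d) (≢⇒==-false n)) e))
  ... | no n = ⊥-elim (true≢false (trans (sym x-above-y) (above-absent₂ l2 x y ny)))
    where
    my : mem y l1 ≡ true
    my = trans (sym (cong (_∨ mem y l1) (≢⇒==-false n))) (trans (hm y) (∨-true-l _ (==-refl y)))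
    r1 : above (x ∷ l1) x y ≡ true
    r1 = trans (cong (λ b → if b then mem y l1 else above l1 x y) (==-refl x)) my
    x-above-y : above l2 x y ≡ true
    x-above-y = trans (sym (cong (λ b → if b then mem y l2 else above l2 x y) (≢⇒==-false (λ e → n (sym e))))) (ho x y r1)

  above-last-false : ∀ zs t → Distinct (zs ++ [ t ]) → ∀ d → above (zs ++ [ t ]) t d ≡ false
  above-last-false zs t U d rewrite above-++ zs [ t ] t d | proj₁ (distinct-middle zs t [] U) | ==-refl t = refl

  module Greedy (h2 : Handle) (B2 : Broom h2) where
    open Potential h2

    U2 : Distinct h2
    U2 = proj₁ B2

    P⊆h2 : ∀ i → mem (inj₁ i) h2 ≡ true
    P⊆h2 = proj₁ (proj₂ B2)

    h2-endsInP : endsInP h2 ≡ true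
    h2-endsInP = proj₂ (proj₂ B2)

    fₜ : Handle → (Fin q → Bool) → ℕ
    fₜ h x = f h h2 x

    invₜ : Handle → ℕ
    invₜ h = invList (σ h h2)

    inYₜ : Handle → Fin q → Bool
    inYₜ h u = D.inY p q h h2 u

    TracksLeaves : Handle → (Fin q → Bool) → Handle → (Fin q → Bool) → Set
    TracksLeaves h x h′ x′ = ∀ u → inYₜ h u ≡ true → ((mem (inj₂ u) h′ ≡ true) × (x′ u ≡ x u)) ⊎ ((mem (inj₂ u) h′ ≡ false) × (x u ≡ true))

    Step : Handle → (Fin q → Bool) → Set
    Step h x = Σ Handle λ h′ → Σ (Fin q → Bool) λ x′ → Rot h h′ × Broom h′ × (fₜ h x ≡ suc (fₜ h′ x′)) × TracksLeaves h x h′ x′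

    swap-step : ∀ xs a b ys x → Broom (xs ++ a ∷ b ∷ ys) → (ys ≡ [] → T (isP a)) →
             potential (membership (xs ++ a ∷ b ∷ ys)) (above (xs ++ a ∷ b ∷ ys)) x (invₜ (xs ++ a ∷ b ∷ ys))
               ≡ suc (potential (membership (xs ++ a ∷ b ∷ ys)) (above (xs ++ b ∷ a ∷ ys)) x (invₜ (xs ++ b ∷ a ∷ ys))) →
             Step (xs ++ a ∷ b ∷ ys) x
    swap-step xs a b ys x (U , aP , lb) cond drop =
      xs ++ b ∷ a ∷ ys , x , D.rot-swap xs a b ys cond , B′ , f-drops , leaves
      where
      open SwapAt xs a b ys
      B′ : Broom (xs ++ b ∷ a ∷ ys)
      B′ = distinct-swap U , (λ i → trans (sym (mem-swapped (inj₁ i))) (aP i)) , lb′ ys refl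
        where
        lb′ : ∀ zs → ys ≡ zs → endsInP (xs ++ b ∷ a ∷ ys) ≡ true
        lb′ [] refl = trans (endsInP-++ xs b (a ∷ [])) (T⇒≡true (cond refl))
        lb′ (z ∷ zs) refl = trans (endsInP-++ xs b (a ∷ z ∷ zs)) (trans (sym (endsInP-++ xs a (b ∷ z ∷ zs))) lb)
      f-drops : fₜ (xs ++ a ∷ b ∷ ys) x ≡ suc (fₜ (xs ++ b ∷ a ∷ ys) x)
      f-drops = trans (f≡potential hs x) (trans drop (cong suc (trans
             (PotentialCong.potential-cong h2 (membership hs) (membership ht) (above ht) (above ht) {x} {x} (invₜ ht) mem-swapped (λ _ _ → refl) (λ _ → refl))
             (sym (f≡potential ht x)))))
      leaves : TracksLeaves (xs ++ a ∷ b ∷ ys) x (xs ++ b ∷ a ∷ ys) x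
      leaves u e = inj₁ (trans (sym (mem-swapped (inj₂ u))) (∧-trueˡ _ e) , refl)

    mem-Q-here : ∀ xs (u : Fin q) b ys → mem (inj₂ u) (xs ++ inj₂ u ∷ b ∷ ys) ≡ true
    mem-Q-here xs u b ys = trans (mem-++ _ xs _) (∨-true-r (mem (inj₂ u) xs) (∨-true-l _ (==-refl (inj₂ u))))

    remove-step : ∀ xs (u : Fin q) (j : Fin p) x → Broom (xs ++ inj₂ u ∷ inj₁ j ∷ []) →
            (mem₂ (inj₂ u) ≡ false) ⊎ ((mem₂ (inj₂ u) ≡ true) × (x u ≡ true)) → Step (xs ++ inj₂ u ∷ inj₁ j ∷ []) x
    remove-step xs u j x (U , aP , _) cs = xs ++ inj₁ j ∷ [] , x , D.rot-toLeaf xs (inj₂ u) (inj₁ j) tt , B′ , f-drops cs , leaves cs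
      where
      open RemoveAt xs (inj₂ u) (inj₁ j)
      B′ : Broom (xs ++ inj₁ j ∷ [])
      B′ = distinct-remove U , (λ i → trans (sym (mem-removed (inj₁ i) (λ ()))) (aP i)) , endsInP-++ xs (inj₁ j) []
      open Removal h2 (membership hs) (membership ht) (above hs) (above ht) x u j mem-removed above-removed (mem-Q-here xs u (inj₁ j) []) (u∉ht U)
                  (above-removed₁ U) (above-removed₂ U) (above-u U) (above-to-u U) (above-b-u U)
      inv-same : invₜ hs ≡ invₜ ht
      inv-same = cong invList (σ-cong hs ht h2 (Pseq-remove-Q xs u (inj₁ j)))
      f-drops : (mem₂ (inj₂ u) ≡ false) ⊎ ((mem₂ (inj₂ u) ≡ true) × (x u ≡ true)) → fₜ hs x ≡ suc (fₜ ht x)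
      f-drops (inj₁ m2u) = trans (f≡potential hs x) (trans (remove-absent m2u (invₜ hs)) (cong suc (trans (cong (potential (membership ht) (above ht) x) inv-same) (sym (f≡potential ht x)))))
      f-drops (inj₂ (m2u , xu)) = trans (f≡potential hs x) (trans (RemoveMarked.remove-marked m2u xu aP (exactlyOneAbove h2 U2 (inj₂ u) (inj₁ j) (λ ()) m2u (P⊆h2 j)) (invₜ hs))
                               (cong suc (trans (cong (potential (membership ht) (above ht) x) inv-same) (sym (f≡potential ht x)))))
      leaves : (mem₂ (inj₂ u) ≡ false) ⊎ ((mem₂ (inj₂ u) ≡ true) × (x u ≡ true)) → TracksLeaves hs x ht x
      leaves cs v e with v F.≟ u
      leaves (inj₁ m2u) v e | yes refl = ⊥-elim (true≢false (trans (sym e) (∧-falseʳ (membership hs (inj₂ v)) m2u)))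
      leaves (inj₂ (_ , xu)) v e | yes refl = inj₂ (u∉ht U , xu)
      ... | no n = inj₁ (trans (sym (mem-removed (inj₂ v) (Q≢ n))) (∧-trueˡ _ e) , refl)

    insert-step : ∀ xs (j : Fin p) (w : Fin q) x → Broom (xs ++ inj₁ j ∷ []) → mem (inj₂ w) (xs ++ inj₁ j ∷ []) ≡ false →
            (∀ v → mem (inj₂ v) (xs ++ inj₁ j ∷ []) ≡ true → mem₂ (inj₂ v) ≡ true) →
            (∀ v → mem (inj₂ v) (xs ++ inj₁ j ∷ []) ≡ true → x v ≡ false) →
            mem₂ (inj₂ w) ≡ true → above h2 (inj₁ j) (inj₂ w) ≡ false → above h2 (inj₂ w) (inj₁ j) ≡ true →
            (∀ c → above h2 c (inj₂ w) ≡ true → mem c (xs ++ inj₁ j ∷ []) ≡ true) →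
            Step (xs ++ inj₁ j ∷ []) x
    insert-step xs j w x (U , aP , _) Mw noR xF m2w a2bw a2wb abv =
      xs ++ inj₂ w ∷ inj₁ j ∷ [] , x′ , D.rot-fromLeaf xs (inj₂ w) (inj₁ j) tt (mem-false⇒∉ (xs ++ inj₁ j ∷ []) Mw) , B′ , f-drops , leaves
      where
      open RemoveAt xs (inj₂ w) (inj₁ j)
      x′ : Fin q → Bool
      x′ v = if ⌊ v F.≟ w ⌋ then false else x v
      hx : ∀ v → v ≢ w → x′ v ≡ x v
      hx v n with v F.≟ w
      ... | yes e = ⊥-elim (n e)
      ... | no _ = refl
      xw′ : x′ w ≡ false
      xw′ with w F.≟ w
      ... | yes _ = refl
      ... | no n = ⊥-elim (n refl)
      Uhs : Distinct hs
      Uhs = distinct-insert xs (inj₂ w) (inj₁ j) U Mw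
      B′ : Broom hs
      B′ = Uhs , (λ i → mem-removed⇒mem (inj₁ i) (aP i)) , endsInP-++ xs (inj₂ w) (inj₁ j ∷ [])
      x0 : ∀ v → Potential.inY h2 (membership ht) (above ht) v ≡ true → x v ≡ false
      x0 v e = xF v (∧-trueˡ _ e)
      open Insertion h2 (membership ht) (membership hs) (above ht) (above hs) x x′ w j hx xw′ mem-removed above-removed Mw (mem-Q-here xs w (inj₁ j) [])
                  (λ d → above-absent₁ ht (inj₂ w) d Mw) (above-u Uhs) (above-to-u Uhs) (above-b-u Uhs) (above⇒mem₁ hs)
                  aP noR x0 m2w a2bw a2wb abv
      inv-same : invₜ ht ≡ invₜ hs
      inv-same = cong invList (σ-cong ht hs h2 (sym (Pseq-remove-Q xs w (inj₁ j))))
      f-drops : fₜ ht x ≡ suc (fₜ hs x′)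
      f-drops = trans (f≡potential ht x) (trans (insert-kept (invₜ ht)) (cong suc (trans (cong (potential (membership hs) (above hs) x′) inv-same) (sym (f≡potential hs x′)))))
      leaves : TracksLeaves ht x hs x′
      leaves v e with v F.≟ w
      ... | yes refl = ⊥-elim (true≢false (trans (sym (∧-trueˡ _ e)) Mw))
      ... | no n = inj₁ (trans (mem-removed (inj₂ v) (Q≢ n)) (∧-trueˡ _ e) , refl)

    mem-Q-next : ∀ xs a (u : Fin q) ys → mem (inj₂ u) (xs ++ a ∷ inj₂ u ∷ ys) ≡ true
    mem-Q-next xs a u ys = trans (mem-++ _ xs _) (∨-true-r (mem (inj₂ u) xs) (∨-true-r (a == inj₂ u) (∨-true-l _ (==-refl (inj₂ u)))))

    data QPReason (u : Fin q) (j : Fin p) (x : Fin q → Bool) : Set where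
      absent : mem₂ (inj₂ u) ≡ false → QPReason u j x
      marked : mem₂ (inj₂ u) ≡ true → x u ≡ true → QPReason u j x
      misordered : mem₂ (inj₂ u) ≡ true → x u ≡ false → above h2 (inj₁ j) (inj₂ u) ≡ true → QPReason u j x

    swap-QP-step : ∀ xs (u : Fin q) (j : Fin p) ys x → Broom (xs ++ inj₂ u ∷ inj₁ j ∷ ys) → ys ≢ [] → QPReason u j x →
             Step (xs ++ inj₂ u ∷ inj₁ j ∷ ys) x
    swap-QP-step xs u j ys x B@(U , _) ne reason = swap-step xs (inj₂ u) (inj₁ j) ys x B (λ e → ⊥-elim (ne e)) drop
      where
      open SwapAt xs (inj₂ u) (inj₁ j) ys
      uv : inj₂ u ≢ inj₁ j
      uv ()
      open SwapCases h2 (membership hs) x (above hs) (above ht)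
      open QPCase u j (λ v w → above-swapped uv (inj₂ v) (inj₂ w) (λ _ ()) (λ ()))
                      (λ w i n → above-swapped uv (inj₂ w) (inj₁ i) (λ e → ⊥-elim (n (inj₂-inj e))) (λ ()))
                      (λ w i n → above-swapped uv (inj₁ i) (inj₂ w) (λ ()) (λ _ e → n (inj₂-inj e)))
                      (λ i n → above-swapped uv (inj₂ u) (inj₁ i) (λ _ e → n (inj₁-inj e)) (λ ()))
                      (λ i n → above-swapped uv (inj₁ i) (inj₂ u) (λ ()) (λ e _ → n (inj₁-inj e)))
      inv-same : invₜ hs ≡ invₜ ht
      inv-same = cong invList (σ-cong hs ht h2 (Pseq-swap-Q xs u (inj₁ j) ys))
      Mu : membership hs (inj₂ u) ≡ true
      Mu = mem-Q-here xs u (inj₁ j) ys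
      drops : QPReason u j x → ∀ i → potential (membership hs) (above hs) x i ≡ suc (potential (membership hs) (above ht) x i)
      drops (absent m2u) = lower-absent-past-P Mu m2u (above-uv U) (above-uv′ U)
      drops (marked m2u xu) = lower-marked-past-P (∧-true Mu m2u) xu (above-uv U) (above-vu U) (above-uv′ U) (above-vu′ U) (exactlyOneAbove h2 U2 (inj₂ u) (inj₁ j) (λ ()) m2u (P⊆h2 j))
      drops (misordered m2u xu a2ju) = reorder-kept-P (∧-true Mu m2u) xu s1 s2
        where
        s1 : Potential.split h2 (membership hs) (above hs) (inj₁ j) (inj₂ u) ≡ true
        s1 rewrite above-uv U | above-vu U | a2ju = refl
        s2 : Potential.split h2 (membership hs) (above ht) (inj₁ j) (inj₂ u) ≡ false
        s2 rewrite above-uv′ U | above-vu′ U | above-asym h2 U2 (inj₁ j) (inj₂ u) a2ju = refl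
      drop : potential (membership hs) (above hs) x (invₜ hs) ≡ suc (potential (membership hs) (above ht) x (invₜ ht))
      drop = trans (drops reason (invₜ hs)) (cong (λ i → suc (potential (membership hs) (above ht) x i)) inv-same)

    swap-PQ-step : ∀ xs (j : Fin p) (u : Fin q) ys x → Broom (xs ++ inj₁ j ∷ inj₂ u ∷ ys) →
             mem₂ (inj₂ u) ≡ true → x u ≡ false → above h2 (inj₂ u) (inj₁ j) ≡ true → Step (xs ++ inj₁ j ∷ inj₂ u ∷ ys) x
    swap-PQ-step xs j u ys x B@(U , _) m2u xu a2uj = swap-step xs (inj₁ j) (inj₂ u) ys x B (λ _ → tt) drop
      where
      open SwapAt xs (inj₁ j) (inj₂ u) ys
      uv : inj₁ j ≢ inj₂ u
      uv ()
      open SwapCases h2 (membership hs) x (above hs) (above ht)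
      open QPCase u j (λ v w → above-swapped uv (inj₂ v) (inj₂ w) (λ ()) (λ _ ()))
                      (λ w i n → above-swapped uv (inj₂ w) (inj₁ i) (λ ()) (λ e → ⊥-elim (n (inj₂-inj e))))
                      (λ w i n → above-swapped uv (inj₁ i) (inj₂ w) (λ _ e → n (inj₂-inj e)) (λ ()))
                      (λ i n → above-swapped uv (inj₂ u) (inj₁ i) (λ ()) (λ _ e → n (inj₁-inj e)))
                      (λ i n → above-swapped uv (inj₁ i) (inj₂ u) (λ e _ → n (inj₁-inj e)) (λ ()))
      inv-same : invₜ hs ≡ invₜ ht
      inv-same = cong invList (σ-cong hs ht h2 (Pseq-swap-Q′ xs (inj₁ j) u ys))
      Mu : membership hs (inj₂ u) ≡ true
      Mu = mem-Q-next xs (inj₁ j) u ys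
      s1 : Potential.split h2 (membership hs) (above hs) (inj₁ j) (inj₂ u) ≡ true
      s1 rewrite above-uv U | a2uj = refl
      s2 : Potential.split h2 (membership hs) (above ht) (inj₁ j) (inj₂ u) ≡ false
      s2 rewrite above-uv′ U | above-vu′ U | above-asym h2 U2 (inj₂ u) (inj₁ j) a2uj = refl
      drop : potential (membership hs) (above hs) x (invₜ hs) ≡ suc (potential (membership hs) (above ht) x (invₜ ht))
      drop = trans (reorder-kept-P (∧-true Mu m2u) xu s1 s2 (invₜ hs)) (cong (λ i → suc (potential (membership hs) (above ht) x i)) inv-same)

    data QQReason (u w : Fin q) (x : Fin q → Bool) : Set where
      absent : mem₂ (inj₂ u) ≡ false → QQReason u w x
      marked : mem₂ (inj₂ u) ≡ true → x u ≡ true → QQReason u w x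
      misordered : mem₂ (inj₂ u) ≡ true → x u ≡ false → above h2 (inj₂ w) (inj₂ u) ≡ true → QQReason u w x

    swap-QQ-step : ∀ xs (u w : Fin q) ys x → Broom (xs ++ inj₂ u ∷ inj₂ w ∷ ys) → ys ≢ [] →
             mem₂ (inj₂ w) ≡ true → x w ≡ false → QQReason u w x → Step (xs ++ inj₂ u ∷ inj₂ w ∷ ys) x
    swap-QQ-step xs u w ys x B@(U , _) ne m2w xw reason = swap-step xs (inj₂ u) (inj₂ w) ys x B (λ e → ⊥-elim (ne e)) drop
      where
      open SwapAt xs (inj₂ u) (inj₂ w) ys
      uv : inj₂ u ≢ inj₂ w
      uv = u≢v U
      open SwapCases h2 (membership hs) x (above hs) (above ht)
      open QQCase u w (λ e → uv (cong inj₂ e))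
                      (λ v k h1 h2′ → above-swapped uv (inj₂ v) (inj₂ k) (λ e e′ → h1 (inj₂-inj e) (inj₂-inj e′)) (λ e e′ → h2′ (inj₂-inj e) (inj₂-inj e′)))
                      (λ k i → above-swapped uv (inj₂ k) (inj₁ i) (λ _ ()) (λ _ ()))
                      (λ k i → above-swapped uv (inj₁ i) (inj₂ k) (λ ()) (λ ()))
                      (above-uv U) (above-vu U) (above-uv′ U) (above-vu′ U)
      inv-same : invₜ hs ≡ invₜ ht
      inv-same = cong invList (σ-cong hs ht h2 (Pseq-swap-Q xs u (inj₂ w) ys))
      Mu : membership hs (inj₂ u) ≡ true
      Mu = mem-Q-here xs u (inj₂ w) ys
      yw : Potential.inY h2 (membership hs) (above hs) w ≡ true
      yw = ∧-true (mem-Q-next xs (inj₂ u) w ys) m2w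
      drops : QQReason u w x → ∀ i → potential (membership hs) (above hs) x i ≡ suc (potential (membership hs) (above ht) x i)
      drops (absent m2u) = lower-absent-past-kept Mu m2u yw xw
      drops (marked m2u xu) = lower-marked-past-kept (∧-true Mu m2u) xu yw xw (exactlyOneAbove h2 U2 (inj₂ u) (inj₂ w) uv m2u m2w)
      drops (misordered m2u xu a2wu) = reorder-kept-kept (∧-true Mu m2u) xu yw xw a2wu (above-asym h2 U2 (inj₂ w) (inj₂ u) a2wu)
      drop : potential (membership hs) (above hs) x (invₜ hs) ≡ suc (potential (membership hs) (above ht) x (invₜ ht))
      drop = trans (drops reason (invₜ hs)) (cong (λ i → suc (potential (membership hs) (above ht) x i)) inv-same)

    swap-PP-step : ∀ xs (i k : Fin p) ys x → Broom (xs ++ inj₁ i ∷ inj₁ k ∷ ys) → above h2 (inj₁ k) (inj₁ i) ≡ true →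
             Step (xs ++ inj₁ i ∷ inj₁ k ∷ ys) x
    swap-PP-step xs i k ys x B@(U , _) a2ki = swap-step xs (inj₁ i) (inj₁ k) ys x B (λ _ → tt) drop
      where
      open SwapAt xs (inj₁ i) (inj₁ k) ys
      uv : inj₁ i ≢ inj₁ k
      uv = u≢v U
      open SwapPotential h2 (membership hs) x (above hs) (above ht)
      open PP (λ v w → above-swapped uv (inj₂ v) (inj₂ w) (λ ()) (λ ()))
              (λ w l → above-swapped uv (inj₂ w) (inj₁ l) (λ ()) (λ ()))
              (λ w l → above-swapped uv (inj₁ l) (inj₂ w) (λ _ ()) (λ _ ()))
      drop : potential (membership hs) (above hs) x (invₜ hs) ≡ suc (potential (membership hs) (above ht) x (invₜ ht))
      drop = trans (potential-eq (invₜ hs)) (dec-inv (Potential.sumA h2 (membership hs) (above ht)) (Potential.sumBCD h2 (membership hs) (above ht) x)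
                     (Potential.sumE h2 (membership hs) (above ht) x / 2) (2 * Potential.sumF h2 (membership hs) (above ht) x) (invList-swap-P h2 xs i k ys U U2 a2ki))

    removable : (Fin q → Bool) → Vertex → Bool
    removable x (inj₁ _) = false
    removable x (inj₂ u) = not (mem₂ (inj₂ u)) ∨ x u

    removable-kept : (Fin q → Bool) → Vertex → Vertex → Bool
    removable-kept x a b = removable x a ∧ not (removable x b)

    out-of-order : Vertex → Vertex → Bool
    out-of-order c d = above h2 d c

    missingFrom : Handle → Vertex → Bool
    missingFrom h c = isQ c ∧ not (mem c h)

    ¬removable : ∀ x u → removable x (inj₂ u) ≡ false → (mem₂ (inj₂ u) ≡ true) × (x u ≡ false)
    ¬removable x u e with mem₂ (inj₂ u) | x u
    ... | true | false = refl , refl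
    ... | true | true = ⊥-elim (true≢false e)
    ... | false | _ = ⊥-elim (true≢false e)

    removable-cases : ∀ x u → removable x (inj₂ u) ≡ true → (mem₂ (inj₂ u) ≡ false) ⊎ ((mem₂ (inj₂ u) ≡ true) × (x u ≡ true))
    removable-cases x u e with mem₂ (inj₂ u) | x u
    ... | false | _ = inj₁ refl
    ... | true | true = inj₂ (refl , refl)
    ... | true | false = ⊥-elim (true≢false (sym e))

    bottom₂ : Fin p
    bottom₂ = proj₁ (proj₂ (endsInP⇒ h2 h2-endsInP))

    bottom₂-above-nothing : ∀ d → above h2 (inj₁ bottom₂) d ≡ false
    bottom₂-above-nothing d with endsInP⇒ h2 h2-endsInP
    ... | zs , t , eq = subst (λ l → above l (inj₁ t) d ≡ false) (sym eq) (above-last-false zs (inj₁ t) (subst Distinct eq U2) d)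

    AllKept : Handle → (Fin q → Bool) → Set
    AllKept h x = ∀ c → mem c h ≡ true → removable x c ≡ false

    removal-phase : ∀ h x → Broom h → AdjacentSearch (removable-kept x) h → Step h x ⊎ AllKept h x
    removal-phase h x B (none an) = inj₂ (adjacent-propagate (removable-kept x) (removable x) back h (proj₂ (proj₂ B)) onP an)
      where
      back : ∀ c d → removable-kept x c d ≡ false → removable x d ≡ false → removable x c ≡ false
      back c d e1 e2 rewrite e2 with removable x c
      ... | false = refl
      ... | true = ⊥-elim (true≢false e1)
      onP : ∀ c → isP c ≡ true → removable x c ≡ false
      onP (inj₁ _) _ = refl
      onP (inj₂ _) ()
    removal-phase .(xs ++ a ∷ b ∷ ys) x B (found xs a b ys refl ga _) = inj₁ (go a b ys B (∧-trueˡ _ ga) (not-true (∧-trueʳ _ ga)))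
      where
      go : ∀ a b ys → Broom (xs ++ a ∷ b ∷ ys) → removable x a ≡ true → removable x b ≡ false → Step (xs ++ a ∷ b ∷ ys) x
      go (inj₁ _) b ys B ()
      go (inj₂ u) (inj₁ j) [] B ra rb = remove-step xs u j x B (removable-cases x u ra)
      go (inj₂ u) (inj₂ w) [] B ra rb = ⊥-elim (true≢false (trans (sym (proj₂ (proj₂ B))) (endsInP-++ xs (inj₂ u) (inj₂ w ∷ []))))
      go (inj₂ u) (inj₁ j) (y ∷ ys) B ra rb with removable-cases x u ra
      ... | inj₁ m2u = swap-QP-step xs u j (y ∷ ys) x B (λ ()) (absent m2u)
      ... | inj₂ (m2u , xu) = swap-QP-step xs u j (y ∷ ys) x B (λ ()) (marked m2u xu)
      go (inj₂ u) (inj₂ w) (y ∷ ys) B ra rb with removable-cases x u ra | ¬removable x w rb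
      ... | inj₁ m2u | m2w , xw = swap-QQ-step xs u w (y ∷ ys) x B (λ ()) m2w xw (absent m2u)
      ... | inj₂ (m2u , xu) | m2w , xw = swap-QQ-step xs u w (y ∷ ys) x B (λ ()) m2w xw (marked m2u xu)

    module Kept (h : Handle) (x : Fin q → Bool) (kept : AllKept h x) where
      mem₂-of : ∀ u → mem (inj₂ u) h ≡ true → mem₂ (inj₂ u) ≡ true
      mem₂-of u m = proj₁ (¬removable x u (kept (inj₂ u) m))
      x-of : ∀ u → mem (inj₂ u) h ≡ true → x u ≡ false
      x-of u m = proj₂ (¬removable x u (kept (inj₂ u) m))
      ⊆h2 : ∀ c → mem c h ≡ true → mem c h2 ≡ true
      ⊆h2 (inj₁ i) _ = P⊆h2 i
      ⊆h2 (inj₂ u) m = mem₂-of u m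

    -- Unless j is the bottom of h₂, the bottom of h₂ lies in the sorted part above u, hence above u in h₂: impossible.
    bottom-pair-sorted : ∀ xs u j x → Broom (xs ++ inj₂ u ∷ inj₁ j ∷ []) → AllKept (xs ++ inj₂ u ∷ inj₁ j ∷ []) x →
                         AdjacentNot out-of-order (xs ++ [ inj₂ u ]) → above h2 (inj₁ j) (inj₂ u) ≡ false
    bottom-pair-sorted xs u j x (U , aP , _) kept sorted with bottom₂ F.≟ j
    ... | yes refl = bottom₂-above-nothing (inj₂ u)
    ... | no n = ⊥-elim (true≢false (trans (sym (adjacent-above⇒above h2 U2 pre asc (inj₁ bottom₂) (inj₂ u) bottom-above-u))
                                            (bottom₂-above-nothing (inj₂ u))))
      where
      open Kept (xs ++ inj₂ u ∷ inj₁ j ∷ []) x kept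
      pre = xs ++ [ inj₂ u ]
      pre-bottom : xs ++ inj₂ u ∷ inj₁ j ∷ [] ≡ pre ++ [ inj₁ j ]
      pre-bottom = sym (++-assoc xs [ inj₂ u ] [ inj₁ j ])
      asc : Adjacent (λ c d → above h2 c d ≡ true) pre
      asc = adjnot⇒asc h2 U2 pre (distinct-prefix pre [ inj₁ j ] (subst Distinct pre-bottom U))
              (λ c m → ⊆h2 c (subst (λ l → mem c l ≡ true) (sym pre-bottom) (mem-++ˡ c pre [ inj₁ j ] m))) sorted
      not-in-tail : mem (inj₁ bottom₂) (inj₂ u ∷ inj₁ j ∷ []) ≡ false
      not-in-tail rewrite ≢⇒==-false {inj₂ u} {inj₁ bottom₂} (λ ()) | ≢⇒==-false {inj₁ j} {inj₁ bottom₂} (λ e → n (sym (inj₁-inj e))) = refl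
      in-xs : mem (inj₁ bottom₂) xs ≡ true
      in-xs = trans (sym (∨-identityʳ (mem (inj₁ bottom₂) xs))) (trans (cong (mem (inj₁ bottom₂) xs ∨_) (sym not-in-tail))
                (trans (sym (mem-++ (inj₁ bottom₂) xs (inj₂ u ∷ inj₁ j ∷ []))) (aP bottom₂)))
      bottom-above-u : above pre (inj₁ bottom₂) (inj₂ u) ≡ true
      bottom-above-u rewrite above-++ xs [ inj₂ u ] (inj₁ bottom₂) (inj₂ u) | in-xs | ==-refl (inj₂ u) = ∨-true-r (above xs (inj₁ bottom₂) (inj₂ u)) refl

    sorting-phase : ∀ h x → Broom h → AllKept h x → AdjacentSearch out-of-order h →
                    Step h x ⊎ (∀ c d → above h c d ≡ true → above h2 c d ≡ true)
    sorting-phase h x B kept (none an) = inj₂ (adjacent-above⇒above h2 U2 h (adjnot⇒asc h2 U2 h (proj₁ B) ⊆h2 an))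
      where
      open Kept h x kept
    sorting-phase .(xs ++ a ∷ b ∷ ys) x B kept (found xs a b ys refl ga sorted) = inj₁ (go a b ys B kept ga sorted)
      where
      go : ∀ a b ys → Broom (xs ++ a ∷ b ∷ ys) → AllKept (xs ++ a ∷ b ∷ ys) x →
           above h2 b a ≡ true → AdjacentNot out-of-order (xs ++ [ a ]) → Step (xs ++ a ∷ b ∷ ys) x
      go (inj₁ i) (inj₁ k) ys B kept g _ = swap-PP-step xs i k ys x B g
      go (inj₁ j) (inj₂ u) ys B kept g _ = swap-PQ-step xs j u ys x B (mem₂-of u (mem-Q-next xs (inj₁ j) u ys)) (x-of u (mem-Q-next xs (inj₁ j) u ys)) g
        where
        open Kept (xs ++ inj₁ j ∷ inj₂ u ∷ ys) x kept
      go (inj₂ u) (inj₂ w) [] B kept g _ = ⊥-elim (true≢false (trans (sym (proj₂ (proj₂ B))) (endsInP-++ xs (inj₂ u) (inj₂ w ∷ []))))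
      go (inj₂ u) (inj₂ w) (y ∷ ys) B kept g _ =
        swap-QQ-step xs u w (y ∷ ys) x B (λ ()) (mem₂-of w (mem-Q-next xs (inj₂ u) w (y ∷ ys))) (x-of w (mem-Q-next xs (inj₂ u) w (y ∷ ys)))
          (misordered (mem₂-of u (mem-Q-here xs u (inj₂ w) (y ∷ ys))) (x-of u (mem-Q-here xs u (inj₂ w) (y ∷ ys))) g)
        where
        open Kept (xs ++ inj₂ u ∷ inj₂ w ∷ y ∷ ys) x kept
      go (inj₂ u) (inj₁ j) (y ∷ ys) B kept g _ =
        swap-QP-step xs u j (y ∷ ys) x B (λ ()) (misordered (mem₂-of u (mem-Q-here xs u (inj₁ j) (y ∷ ys))) (x-of u (mem-Q-here xs u (inj₁ j) (y ∷ ys))) g)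
        where
        open Kept (xs ++ inj₂ u ∷ inj₁ j ∷ y ∷ ys) x kept
      go (inj₂ u) (inj₁ j) [] B kept g sorted = ⊥-elim (true≢false (trans (sym g) (bottom-pair-sorted xs u j x B kept sorted)))

    above-head⇒mem : ∀ y l c → above (y ∷ l) c y ≡ true → mem y l ≡ true
    above-head⇒mem y l c e with y ≟ c
    ... | yes refl = e
    ... | no n = above⇒mem₂ l c y e

    Done : Handle → (Fin q → Bool) → Set
    Done h x = (h ≡ h2) × (∀ u → inYₜ h u ≡ true → x u ≡ false)

    mem-middle : ∀ l1 w l2 → mem w (l1 ++ w ∷ l2) ≡ true
    mem-middle l1 w l2 = trans (mem-++ w l1 _) (∨-true-r (mem w l1) (∨-true-l _ (==-refl w)))

    sorted⇒same-bottom : ∀ zs t → Broom (zs ++ inj₁ t ∷ []) →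
                         (∀ c d → above (zs ++ inj₁ t ∷ []) c d ≡ true → above h2 c d ≡ true) → t ≡ bottom₂
    sorted⇒same-bottom zs t (_ , aP , _) sorted with t F.≟ bottom₂
    ... | yes e = e
    ... | no n = ⊥-elim (true≢false (trans (sym (sorted (inj₁ bottom₂) (inj₁ t) bottom₂-above-t)) (bottom₂-above-nothing (inj₁ t))))
      where
      bottom₂∈zs : mem (inj₁ bottom₂) zs ≡ true
      bottom₂∈zs = trans (sym (∨-identityʳ (mem (inj₁ bottom₂) zs))) (trans (cong (mem (inj₁ bottom₂) zs ∨_)
             (sym (cong (_∨ false) (≢⇒==-false (λ e → n (inj₁-inj e)))))) (trans (sym (mem-++ (inj₁ bottom₂) zs (inj₁ t ∷ []))) (aP bottom₂)))
      bottom₂-above-t : above (zs ++ inj₁ t ∷ []) (inj₁ bottom₂) (inj₁ t) ≡ true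
      bottom₂-above-t rewrite above-++ zs (inj₁ t ∷ []) (inj₁ bottom₂) (inj₁ t) | bottom₂∈zs | ==-refl (inj₁ t) = ∨-true-r (above zs (inj₁ bottom₂) (inj₁ t)) refl

    -- As w is the topmost vertex of h₂ missing from the handle, everything above w in h₂ is present.
    insertion-step : ∀ zs t x → Broom (zs ++ inj₁ t ∷ []) → AllKept (zs ++ inj₁ t ∷ []) x →
                     (∀ c d → above (zs ++ inj₁ t ∷ []) c d ≡ true → above h2 c d ≡ true) →
                     ∀ l1 w l2 → h2 ≡ l1 ++ inj₂ w ∷ l2 → missingFrom (zs ++ inj₁ t ∷ []) (inj₂ w) ≡ true →
                     (∀ c → mem c l1 ≡ true → missingFrom (zs ++ inj₁ t ∷ []) c ≡ false) → Step (zs ++ inj₁ t ∷ []) x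
    insertion-step zs t x B kept sorted l1 w l2 eqh2 gw hl1 = insert-step zs t w x B w∉h mem₂-of x-of w∈h2 t-above-w w-above-t above-w⇒mem
      where
      hh = zs ++ inj₁ t ∷ []
      open Kept hh x kept
      aP = proj₁ (proj₂ B)
      w∉h : mem (inj₂ w) hh ≡ false
      w∉h = not-true gw
      w∈h2 : mem (inj₂ w) h2 ≡ true
      w∈h2 = subst (λ l → mem (inj₂ w) l ≡ true) (sym eqh2) (mem-middle l1 (inj₂ w) l2)
      t-above-w : above h2 (inj₁ t) (inj₂ w) ≡ false
      t-above-w rewrite sorted⇒same-bottom zs t B sorted = bottom₂-above-nothing (inj₂ w)
      w-above-t : above h2 (inj₂ w) (inj₁ t) ≡ true
      w-above-t with exactlyOneAbove h2 U2 (inj₂ w) (inj₁ t) (λ ()) w∈h2 (P⊆h2 t)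
      ... | inj₁ (r , _) = r
      ... | inj₂ (_ , r) = ⊥-elim (true≢false (trans (sym r) t-above-w))
      w∉l2 : mem (inj₂ w) l2 ≡ false
      w∉l2 = proj₂ (distinct-middle l1 (inj₂ w) l2 (subst Distinct eqh2 U2))
      present : ∀ c → missingFrom hh c ≡ false → mem c hh ≡ true
      present (inj₁ i) _ = aP i
      present (inj₂ v) g with mem (inj₂ v) hh
      ... | true = refl
      present (inj₂ v) () | false
      above-w⇒mem : ∀ c → above h2 c (inj₂ w) ≡ true → mem c hh ≡ true
      above-w⇒mem c e with mem c l1 in m
      ... | true = present c (hl1 c m)
      ... | false = ⊥-elim (true≢false (trans (sym (above-head⇒mem (inj₂ w) l2 c in-tail)) w∉l2))
        where
        in-tail : above (inj₂ w ∷ l2) c (inj₂ w) ≡ true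
        in-tail = trans (sym (cong (λ b → if b then (above l1 c (inj₂ w) ∨ mem (inj₂ w) (inj₂ w ∷ l2)) else above (inj₂ w ∷ l2) c (inj₂ w)) m))
                    (trans (sym (above-++ l1 (inj₂ w ∷ l2) c (inj₂ w))) (subst (λ l → above l c (inj₂ w) ≡ true) eqh2 e))

    complete⇒target : ∀ h x → Broom h → AllKept h x → (∀ c d → above h c d ≡ true → above h2 c d ≡ true) →
                      (∀ c → mem c h2 ≡ true → missingFrom h c ≡ false) → Done h x
    complete⇒target h x (U , aP , _) kept sorted complete = same-order⇒≡ h h2 U U2 same-members sorted , λ u e → x-of u (∧-trueˡ _ e)
      where
      open Kept h x kept
      same-members : ∀ c → mem c h ≡ mem c h2
      same-members c with mem c h in e1
      ... | true = sym (⊆h2 c e1)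
      ... | false with mem c h2 in e2
      ...   | false = refl
      ...   | true = ⊥-elim (true≢false (trans (sym (missing c e1)) (complete c e2)))
        where
        missing : ∀ c → mem c h ≡ false → missingFrom h c ≡ true
        missing (inj₁ i) m = ⊥-elim (true≢false (trans (sym (aP i)) m))
        missing (inj₂ v) m rewrite m = refl

    insertion-phase : ∀ h x → Broom h → AllKept h x → (∀ c d → above h c d ≡ true → above h2 c d ≡ true) →
                      Search (missingFrom h) h2 → Step h x ⊎ Done h x
    insertion-phase h x B kept sorted (none complete) = inj₂ (complete⇒target h x B kept sorted complete)
    insertion-phase h x B kept sorted (found l1 (inj₁ i) l2 eqh2 () hl1)
    insertion-phase h x B kept sorted (found l1 (inj₂ w) l2 eqh2 gw hl1) with endsInP⇒ h (proj₂ (proj₂ B))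
    ... | zs , t , refl = inj₁ (insertion-step zs t x B kept sorted l1 w l2 eqh2 gw hl1)

    greedy-step : ∀ h x → Broom h → Step h x ⊎ Done h x
    greedy-step h x B with removal-phase h x B (searchAdjacent (removable-kept x) h)
    ... | inj₁ s = inj₁ s
    ... | inj₂ kept with sorting-phase h x B kept (searchAdjacent out-of-order h)
    ...   | inj₁ s = inj₁ s
    ...   | inj₂ sorted = insertion-phase h x B kept sorted (search (missingFrom h) h2)

    cons-seq : ∀ n h h′ → Rot h h′ → RotSeq n h′ h2 → RotSeq (suc n) h h2
    D.RotSeq.broom (cons-seq n h h′ r s) zero = h
    D.RotSeq.broom (cons-seq n h h′ r s) (suc i) = D.RotSeq.broom s i
    D.RotSeq.start (cons-seq n h h′ r s) = refl
    D.RotSeq.end (cons-seq n h h′ r s) = D.RotSeq.end s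
    D.RotSeq.steps (cons-seq n h h′ r s) zero = subst (Rot h) (sym (D.RotSeq.start s)) r
    D.RotSeq.steps (cons-seq n h h′ r s) (suc i) = D.RotSeq.steps s i

    nil-seq : RotSeq 0 h2 h2
    D.RotSeq.broom nil-seq _ = h2
    D.RotSeq.start nil-seq = refl
    D.RotSeq.end nil-seq = refl
    D.RotSeq.steps nil-seq ()

    LeafSpec : ∀ n h → (Fin q → Bool) → RotSeq n h h2 → Set
    LeafSpec n h x s = (u : Fin q) → T (D.inY p q h h2 u) → ((∃ λ i → inj₂ u ∉ D.RotSeq.broom s i) ⇔ (x u ≡ true))

    f-target : ∀ x → (∀ u → inYₜ h2 u ≡ true → x u ≡ false) → fₜ h2 x ≡ 0
    f-target x xf = trans (f≡potential h2 x) (trans (cong (potential mem₂ above₂ x) (σ-self h2 U2)) (AtTarget.potential-target h2 U2 x xf))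

    nil-leaves : ∀ x → (∀ u → inYₜ h2 u ≡ true → x u ≡ false) → LeafSpec 0 h2 x nil-seq
    nil-leaves x xf u t = mk⇔ (λ { (i , nm) → ⊥-elim (nm (mem⇒∈ h2 (∧-trueˡ _ (T⇒≡true t)))) })
                              (λ xu → ⊥-elim (true≢false (trans (sym xu) (xf u (T⇒≡true t)))))

    cons-leaves : ∀ n h h′ x x′ (r : Rot h h′) (s : RotSeq n h′ h2) → TracksLeaves h x h′ x′ → LeafSpec n h′ x′ s →
                  LeafSpec (suc n) h x (cons-seq n h h′ r s)
    cons-leaves n h h′ x x′ r s leaves spec u t with leaves u (T⇒≡true t)
    ... | inj₂ (mn , xu) = mk⇔ (λ _ → xu) (λ _ → suc zero , subst (λ l → inj₂ u ∉ l) (sym (D.RotSeq.start s)) (mem-false⇒∉ h′ mn))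
    ... | inj₁ (mh , xe) = mk⇔ to from
      where
      t′ : T (D.inY p q h′ h2 u)
      t′ = ≡true⇒T (∧-true mh (∧-trueʳ _ (T⇒≡true t)))
      to : (∃ λ i → inj₂ u ∉ D.RotSeq.broom (cons-seq n h h′ r s) i) → x u ≡ true
      to (zero , nm) = ⊥-elim (nm (mem⇒∈ h (∧-trueˡ _ (T⇒≡true t))))
      to (suc i , nm) = trans (sym xe) (Equivalence.to (spec u t′) (i , nm))
      from : x u ≡ true → ∃ λ i → inj₂ u ∉ D.RotSeq.broom (cons-seq n h h′ r s) i
      from xu with Equivalence.from (spec u t′) (trans xe xu)
      ... | i , nm = suc i , nm

    run : ∀ n h x → Broom h → fₜ h x ≡ n → Σ (RotSeq n h h2) (LeafSpec n h x)
    run n h x B e with greedy-step h x B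
    ... | inj₂ (refl , xf) = subst (λ k → Σ (RotSeq k h2 h2) (LeafSpec k h2 x)) (trans (sym (f-target x xf)) e) (nil-seq , nil-leaves x xf)
    run zero h x B e | inj₁ (h′ , x′ , r , B′ , e′ , leaves) with trans (sym e′) e
    ... | ()
    run (suc n) h x B e | inj₁ (h′ , x′ , r , B′ , e′ , leaves) =
      let (s , spec) = run n h′ x′ B′ (suc-injective (trans (sym e′) e)) in cons-seq n h h′ r s , cons-leaves n h h′ x x′ r s leaves spec

open import Defs

lemma3p2 : (p q : ℕ) → 1 ≤ p → (h₁ h₂ : Handle p q) → IsBroom p q h₁ → IsBroom p q h₂ →
    (x : Fin q → Bool) →
    Σ (RotSeq p q (f p q h₁ h₂ x) h₁ h₂) λ s →
      (u : Fin q) → T (inY p q h₁ h₂ u) →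
        ((∃ λ i → inj₂ u ∉ RotSeq.broom s i) ⇔ (x u ≡ true))
lemma3p2 p q _ h₁ h₂ B₁ B₂ x = run (f p q h₁ h₂ x) h₁ x (IsBroom⇒Broom h₁ B₁) refl
  where
  open Rotations p q using (IsBroom⇒Broom; module Greedy)
  open Greedy h₂ (IsBroom⇒Broom h₂ B₂) using (run)
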